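{- Let $\Gamma=(V,E)$ be a graph with $n$ vertices, and let $d$ be the number of connected components of $\Gamma$ that do not contain an odd cycle, where loops count as odd cycles. Then $\mathrm{Odd}_{n-d}(\Gamma)\neq\emptyset$ but $\mathrm{Odd}_{n-d+1}(\Gamma)=\emptyset$. In particular, $\mathrm{rank}_{\mathbf Q(X_V)}(\mathsf C^+_\Gamma)=n-d$.
   Context: $\Gamma$ is a finite graph (loops allowed, no parallel edges), vertices ordered $v_1,\dots,v_n$, adjacency $\sim$. $\mathsf C^+_\Gamma\in\mathrm{Mat}_{|E|\times n}(\mathbf Z[X_v:v\in V])$: for an edge $e=\{v_i,v_j\}$ with $i\le j$, the entry in row $e$, column $k$ is $X_{v_i}$ if $k=j$, $X_{v_j}$ if $k=i\neq j$, and $0$ otherwise. An animation of $\Gamma$ is a partial function $\alpha:V\dashrightarrow V$ with $v^\alpha\sim v$ for all $v\in\mathrm{Dom}(\alpha)$; its degree is $|\mathrm{Dom}(\alpha)|$. A point $v$ is $\alpha$-periodic if $v^{\alpha^m}=v$ for some $m\ge1$, and its period is the least such $m$. $\mathrm{Odd}_k(\Gamma)$ is the set of animations of degree $k$ all of whose periodic points have odd period. -}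

module Defs where

open import Data.Nat as ℕ using (ℕ; zero; suc; _+_; _*_; _∸_; _<_; _≤_)
import Data.Nat.Properties as ℕP
open import Data.Integer as ℤ using (ℤ)
import Data.Integer.Properties as ℤP
open import Data.Nat.ListAction using (sum)
open import Data.Fin as Fin using (Fin; toℕ; punchIn)
import Data.Fin.Properties as FinP
open import Data.Fin.Subset using (Subset; _∈_; ∣_∣)
open import Data.Vec as Vec using (Vec)
import Data.Vec.Properties as VecP
open import Data.List as List using (List; []; _∷_; _++_; allFin)
open import Data.Bool using (Bool; true; false; if_then_else_; T)
open import Data.Maybe using (Maybe; just; nothing; is-just; _>>=_)
open import Data.Product using (Σ; ∃; _×_; _,_; proj₁; proj₂)
open import Relation.Nullary using (¬_; does)
open import Relation.Binary.PropositionalEquality using (_≡_; _≢_)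
open import Function using (_⇔_)
open import Function.Definitions using (Injective)

-- Graphs on the vertex set Fin n (ordered v₁ < … < vₙ by Fin order).
-- Loops allowed, no parallel edges: a symmetric Boolean adjacency matrix.

record Graph (n : ℕ) : Set where
  field
    adj : Fin n → Fin n → Bool
    adj-sym : ∀ i j → adj i j ≡ adj j i

module _ {n : ℕ} (Γ : Graph n) where
  open Graph Γ

  _∼_ : Fin n → Fin n → Set
  u ∼ v = T (adj u v)

  IsAnimation : (Fin n → Maybe (Fin n)) → Set
  IsAnimation α = ∀ v w → α v ≡ just w → w ∼ v

count : {n : ℕ} → (Fin n → Bool) → ℕ
count {n} p = sum (List.map (λ v → if p v then 1 else 0) (allFin n))

degree : {n : ℕ} → (Fin n → Maybe (Fin n)) → ℕ
degree α = count (λ v → is-just (α v))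

iter : {n : ℕ} → (Fin n → Maybe (Fin n)) → ℕ → Fin n → Maybe (Fin n)
iter α zero    v = just v
iter α (suc m) v = iter α m v >>= α

Odd : ℕ → Set
Odd m = ∃ λ k → m ≡ suc (2 * k)

IsPeriodOf : {n : ℕ} → (Fin n → Maybe (Fin n)) → Fin n → ℕ → Set
IsPeriodOf α v m =
  1 ≤ m × iter α m v ≡ just v × (∀ k → 1 ≤ k → k < m → iter α k v ≢ just v)

AllPeriodsOdd : {n : ℕ} → (Fin n → Maybe (Fin n)) → Set
AllPeriodsOdd α = ∀ v m → IsPeriodOf α v m → Odd m

OddNonempty : {n : ℕ} → Graph n → ℕ → Set
OddNonempty {n} Γ k =
  ∃ λ (α : Fin n → Maybe (Fin n)) → IsAnimation Γ α × degree α ≡ k × AllPeriodsOdd α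

data Reach {n : ℕ} (Γ : Graph n) : Fin n → Fin n → Set where
  here : ∀ {v} → Reach Γ v v
  step : ∀ {u w v} → _∼_ Γ u w → Reach Γ w v → Reach Γ u v

next : ∀ {k} → Fin (suc k) → Fin (suc k)
next {k} i with toℕ i ℕ.<? k
... | Relation.Nullary.yes p = Fin.fromℕ< (ℕ.s≤s p)
... | Relation.Nullary.no _  = Fin.zero

-- an odd cycle: k+1 (odd) distinct vertices c₀,…,c_k with cᵢ ∼ c_{i+1 mod (k+1)}.
-- For k = 0 this is a loop; k+1 = 2 is excluded by oddness.
record OddCycle {n : ℕ} (Γ : Graph n) : Set where
  field
    len    : ℕ
    odd    : Odd (suc len)
    vert   : Fin (suc len) → Fin n
    inj    : Injective _≡_ _≡_ vert
    edges  : ∀ i → _∼_ Γ (vert i) (vert (next i))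

ComponentHasOddCycle : {n : ℕ} → Graph n → Fin n → Set
ComponentHasOddCycle Γ v =
  ∃ λ (c : OddCycle Γ) → ∀ i → Reach Γ v (OddCycle.vert c i)

-- v is the least vertex of its component, and that component has no odd cycle
-- (so such v are in bijection with the components without odd cycles)
IsOddFreeComponentRep : {n : ℕ} → Graph n → Fin n → Set
IsOddFreeComponentRep Γ v =
  (∀ w → Reach Γ v w → toℕ v ≤ toℕ w) × ¬ ComponentHasOddCycle Γ v

-- Polynomials in ℤ[X_v : v ∈ Fin n] as formal finite sums of terms
-- c · X^e (e an exponent vector); two such are equal iff all collected
-- coefficients agree.

Poly : ℕ → Set
Poly n = List (ℤ × Vec ℕ n)

module _ {n : ℕ} where
  0P : Poly n
  0P = []

  1P : Poly n
  1P = (ℤ.+ 1 , Vec.replicate n 0) ∷ []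

  _+P_ : Poly n → Poly n → Poly n
  _+P_ = _++_

  -P_ : Poly n → Poly n
  -P_ = List.map (λ t → ℤ.- proj₁ t , proj₂ t)

  _*P_ : Poly n → Poly n → Poly n
  p *P q = List.concatMap (λ s → List.map (λ t → proj₁ s ℤ.* proj₁ t , Vec.zipWith _+_ (proj₂ s) (proj₂ t)) q) p

  X : Fin n → Poly n
  X v = (ℤ.+ 1 , Vec.tabulate (λ w → if does (v Fin.≟ w) then 1 else 0)) ∷ []

  coeff : Vec ℕ n → Poly n → ℤ
  coeff e [] = ℤ.+ 0
  coeff e ((c , e′) ∷ p) =
    (if does (VecP.≡-dec ℕP._≟_ e e′) then c else ℤ.+ 0) ℤ.+ coeff e p

  NonZeroPoly : Poly n → Set
  NonZeroPoly p = ∃ λ e → coeff e p ≢ ℤ.+ 0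

  sumP : ∀ {k} → (Fin k → Poly n) → Poly n
  sumP {zero}  f = 0P
  sumP {suc k} f = f Fin.zero +P sumP (λ i → f (Fin.suc i))

  evenℕ : ℕ → Bool
  evenℕ zero = true
  evenℕ (suc zero) = false
  evenℕ (suc (suc m)) = evenℕ m

  det : ∀ {k} → (Fin k → Fin k → Poly n) → Poly n
  det {zero}  M = 1P
  det {suc k} M = sumP λ j →
    (if evenℕ (toℕ j) then (λ p → p) else -P_)
      (M Fin.zero j *P det (λ a b → M (Fin.suc a) (punchIn j b)))

-- The matrix C⁺_Γ.  Rows are indexed by edges {vᵢ,vⱼ}, i ≤ j, represented
-- as pairs (i , j) with i ≤ j and vᵢ ∼ vⱼ; columns by Fin n.

IsEdgeRow : {n : ℕ} → Graph n → Fin n × Fin n → Set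
IsEdgeRow Γ (i , j) = toℕ i ≤ toℕ j × _∼_ Γ i j

C⁺ : {n : ℕ} → Fin n × Fin n → Fin n → Poly n
C⁺ (i , j) k =
  if does (k Fin.≟ j) then X i else
  (if does (k Fin.≟ i) then X j else 0P)

HasNonzeroMinor : {n : ℕ} → Graph n → ℕ → Set
HasNonzeroMinor {n} Γ k =
  ∃ λ (r : Fin k → Fin n × Fin n) → ∃ λ (c : Fin k → Fin n) →
    (∀ a → IsEdgeRow Γ (r a)) × (Injective _≡_ _≡_ r) × (Injective _≡_ _≡_ c) ×
    NonZeroPoly (det (λ a b → C⁺ (r a) (c b)))

-- rank over the fraction field Q(X_V) = largest size of a nonvanishing minor
RankC⁺ : {n : ℕ} → Graph n → ℕ → Set
RankC⁺ Γ ρ = HasNonzeroMinor Γ ρ × (∀ k → HasNonzeroMinor Γ k → k ≤ ρ)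

-- If all periods of an animation α are odd, every component without odd cycles contains a vertex
-- outside Dom α: otherwise iterating α inside it runs into a periodic orbit, a closed walk of odd
-- length, which contains an odd cycle. Hence deg α ≤ n − d. Conversely, send every vertex one step
-- closer to the least vertex of its component if the component is bipartite, and otherwise one step
-- closer to a chosen odd cycle, which is itself rotated: the periodic points are the cycle vertices,
-- of odd period, and exactly the d least vertices of the bipartite components are left out.
--
-- For the rank, the rows {v, α v} and columns v (v ∈ Dom α) of this animation form a minor which is
-- block triangular once the tree vertices are listed by decreasing distance before the cycles: each
-- tree row contributes one variable and each odd cycle the determinant 2 ∏ X, so the minor is a
-- nonzero monomial. A larger minor contains all columns of some bipartite component; the vector of
-- the ±X_w, signed by a 2-colouring, lies in its kernel, and since X_v is not a zero divisor and
-- ℤ[X] has no 2-torsion, the minor vanishes.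

module Submission where

module Determinants where

  open import Data.Nat as ℕ using (ℕ; zero; suc; _<_; parity)
  import Data.Nat.Properties as ℕP
  open import Data.Parity.Base as ℙ using (Parity; 0ℙ; 1ℙ; _⁻¹)
  open import Data.Fin as Fin using (Fin; toℕ; punchIn; inject₁)
  import Data.Fin.Properties as FinP
  open import Data.Product using (Σ; _,_)
  open import Data.Sum using (inj₁; inj₂)
  open import Data.Empty using (⊥-elim)
  open import Relation.Nullary using (yes; no)
  open import Relation.Binary using (tri<; tri≈; tri>)
  import Relation.Binary.PropositionalEquality as ≡
  open ≡ using (_≡_; _≢_)
  open import Function using (_∘_)
  open import Algebra.Bundles using (CommutativeRing)
  import Data.Parity.Properties as ℙP

  swap : ∀ {k} → Fin k → Fin (suc k) → Fin (suc k)
  swap Fin.zero    Fin.zero               = Fin.suc Fin.zero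
  swap Fin.zero    (Fin.suc Fin.zero)     = Fin.zero
  swap Fin.zero    (Fin.suc (Fin.suc x))  = Fin.suc (Fin.suc x)
  swap (Fin.suc i) Fin.zero               = Fin.zero
  swap (Fin.suc i) (Fin.suc x)            = Fin.suc (swap i x)

  swap-inject₁ : ∀ {k} (i : Fin k) → swap i (inject₁ i) ≡ Fin.suc i
  swap-inject₁ Fin.zero    = ≡.refl
  swap-inject₁ (Fin.suc i) = ≡.cong Fin.suc (swap-inject₁ i)

  swap-suc : ∀ {k} (i : Fin k) → swap i (Fin.suc i) ≡ inject₁ i
  swap-suc Fin.zero    = ≡.refl
  swap-suc (Fin.suc i) = ≡.cong Fin.suc (swap-suc i)

  swap-other : ∀ {k} (i : Fin k) x → x ≢ inject₁ i → x ≢ Fin.suc i → swap i x ≡ x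
  swap-other Fin.zero    Fin.zero              x≢i _   = ⊥-elim (x≢i ≡.refl)
  swap-other Fin.zero    (Fin.suc Fin.zero)    _   x≢i = ⊥-elim (x≢i ≡.refl)
  swap-other Fin.zero    (Fin.suc (Fin.suc x)) _   _   = ≡.refl
  swap-other (Fin.suc i) Fin.zero              _   _   = ≡.refl
  swap-other (Fin.suc i) (Fin.suc x)           x≢i x≢i+1 =
    ≡.cong Fin.suc (swap-other i x (x≢i ∘ ≡.cong Fin.suc) (x≢i+1 ∘ ≡.cong Fin.suc))

  swap-punchIn-inject₁ : ∀ {k} (i : Fin k) b → swap i (punchIn (inject₁ i) b) ≡ punchIn (Fin.suc i) b
  swap-punchIn-inject₁ Fin.zero    Fin.zero    = ≡.refl
  swap-punchIn-inject₁ Fin.zero    (Fin.suc b) = ≡.refl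
  swap-punchIn-inject₁ (Fin.suc i) Fin.zero    = ≡.refl
  swap-punchIn-inject₁ (Fin.suc i) (Fin.suc b) = ≡.cong Fin.suc (swap-punchIn-inject₁ i b)

  swap-punchIn-suc : ∀ {k} (i : Fin k) b → swap i (punchIn (Fin.suc i) b) ≡ punchIn (inject₁ i) b
  swap-punchIn-suc Fin.zero    Fin.zero    = ≡.refl
  swap-punchIn-suc Fin.zero    (Fin.suc b) = ≡.refl
  swap-punchIn-suc (Fin.suc i) Fin.zero    = ≡.refl
  swap-punchIn-suc (Fin.suc i) (Fin.suc b) = ≡.cong Fin.suc (swap-punchIn-suc i b)

  swap-punchIn : ∀ {m} (i : Fin (suc m)) (j : Fin (suc (suc m))) → j ≢ inject₁ i → j ≢ Fin.suc i →
    Σ (Fin m) λ i′ → ∀ b → swap i (punchIn j b) ≡ punchIn j (swap i′ b)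
  swap-punchIn Fin.zero Fin.zero              j≢i _   = ⊥-elim (j≢i ≡.refl)
  swap-punchIn Fin.zero (Fin.suc Fin.zero)    _   j≢i = ⊥-elim (j≢i ≡.refl)
  swap-punchIn {suc m} Fin.zero (Fin.suc (Fin.suc j)) _ _ = Fin.zero , commute
    where
    commute : ∀ b → swap Fin.zero (punchIn (Fin.suc (Fin.suc j)) b) ≡ punchIn (Fin.suc (Fin.suc j)) (swap Fin.zero b)
    commute Fin.zero               = ≡.refl
    commute (Fin.suc Fin.zero)     = ≡.refl
    commute (Fin.suc (Fin.suc b))  = ≡.refl
  swap-punchIn (Fin.suc i) Fin.zero _ _ = i , λ b → ≡.refl
  swap-punchIn {suc m} (Fin.suc i) (Fin.suc j) j≢i j≢i+1
    with swap-punchIn i j (j≢i ∘ ≡.cong Fin.suc) (j≢i+1 ∘ ≡.cong Fin.suc)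
  ... | i′ , commute = Fin.suc i′ , commute′
    where
    commute′ : ∀ b → swap (Fin.suc i) (punchIn (Fin.suc j) b) ≡ punchIn (Fin.suc j) (swap (Fin.suc i′) b)
    commute′ Fin.zero    = ≡.refl
    commute′ (Fin.suc b) = ≡.cong Fin.suc (commute b)

  module Laplace {c ℓ} (R : CommutativeRing c ℓ) where
    open CommutativeRing R
    open import Algebra.Properties.Ring ring using (-‿distribʳ-*; -‿involutive; -0#≈0#; -‿+-comm)
    open import Algebra.Properties.Semiring.Sum semiring using (sum; sum-cong-≋; sum-replicate-zero; ∑-distrib-+; *-distribˡ-sum)
    open import Relation.Binary.Reasoning.Setoid setoid

    Matrix : ℕ → Set c
    Matrix k = Fin k → Fin k → Carrier

    signed : Parity → Carrier → Carrier
    signed 0ℙ x = x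
    signed 1ℙ x = - x

    minor : ∀ {k} → Fin (suc k) → Matrix (suc k) → Matrix k
    minor j M a b = M (Fin.suc a) (punchIn j b)

    mutual
      determinant : ∀ {k} → Matrix k → Carrier
      determinant {zero}  M = 1#
      determinant {suc k} M = sum (laplace M)

      laplace : ∀ {k} → Matrix (suc k) → Fin (suc k) → Carrier
      laplace M j = signed (parity (toℕ j)) (M Fin.zero j * determinant (minor j M))

    sum-zero : ∀ {k} {f : Fin k → Carrier} → (∀ i → f i ≈ 0#) → sum f ≈ 0#
    sum-zero {k} f≈0 = trans (sum-cong-≋ f≈0) (sum-replicate-zero k)

    sum-neg : ∀ {k} (f : Fin k → Carrier) → sum (λ i → - f i) ≈ - sum f
    sum-neg {zero}  f = sym -0#≈0#
    sum-neg {suc k} f = trans (+-congˡ (sum-neg (f ∘ Fin.suc))) (-‿+-comm _ _)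

    sum-swap : ∀ {k} (i : Fin k) (f : Fin (suc k) → Carrier) → sum f ≈ sum (f ∘ swap i)
    sum-swap Fin.zero f = begin
      f Fin.zero + (f (Fin.suc Fin.zero) + rest) ≈⟨ sym (+-assoc _ _ _) ⟩
      (f Fin.zero + f (Fin.suc Fin.zero)) + rest ≈⟨ +-congʳ (+-comm _ _) ⟩
      (f (Fin.suc Fin.zero) + f Fin.zero) + rest ≈⟨ +-assoc _ _ _ ⟩
      f (Fin.suc Fin.zero) + (f Fin.zero + rest) ∎
      where rest = sum (f ∘ Fin.suc ∘ Fin.suc)
    sum-swap (Fin.suc i) f = +-congˡ (sum-swap i (f ∘ Fin.suc))

    sum-single : ∀ {k} (f : Fin k → Carrier) i₀ → (∀ i → i ≢ i₀ → f i ≈ 0#) → sum f ≈ f i₀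
    sum-single f Fin.zero      others = trans (+-congˡ (sum-zero (λ i → others (Fin.suc i) λ ()))) (+-identityʳ _)
    sum-single f (Fin.suc i₀) others = trans (+-congʳ (others Fin.zero λ ())) (trans (+-identityˡ _)
      (sum-single (f ∘ Fin.suc) i₀ (λ i i≢i₀ → others (Fin.suc i) (i≢i₀ ∘ FinP.suc-injective))))

    sum-pair : ∀ {k} (f : Fin k → Carrier) i₀ i₁ → i₀ ≢ i₁ → (∀ i → i ≢ i₀ → i ≢ i₁ → f i ≈ 0#) →
      sum f ≈ f i₀ + f i₁
    sum-pair f Fin.zero Fin.zero i₀≢i₁ _ = ⊥-elim (i₀≢i₁ ≡.refl)
    sum-pair f Fin.zero (Fin.suc i₁) _ others =
      +-congˡ (sum-single (f ∘ Fin.suc) i₁ (λ i i≢i₁ → others (Fin.suc i) (λ ()) (i≢i₁ ∘ FinP.suc-injective)))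
    sum-pair f (Fin.suc i₀) Fin.zero _ others = trans (+-congˡ
      (sum-single (f ∘ Fin.suc) i₀ (λ i i≢i₀ → others (Fin.suc i) (i≢i₀ ∘ FinP.suc-injective) (λ ())))) (+-comm _ _)
    sum-pair f (Fin.suc i₀) (Fin.suc i₁) i₀≢i₁ others = trans (+-congʳ (others Fin.zero (λ ()) (λ ())))
      (trans (+-identityˡ _) (sum-pair (f ∘ Fin.suc) i₀ i₁ (i₀≢i₁ ∘ ≡.cong Fin.suc)
        (λ i i≢i₀ i≢i₁ → others (Fin.suc i) (i≢i₀ ∘ FinP.suc-injective) (i≢i₁ ∘ FinP.suc-injective))))

    signed-cong : ∀ s {x y} → x ≈ y → signed s x ≈ signed s y
    signed-cong 0ℙ x≈y = x≈y
    signed-cong 1ℙ x≈y = -‿cong x≈y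

    signed-zero : ∀ s → signed s 0# ≈ 0#
    signed-zero 0ℙ = refl
    signed-zero 1ℙ = -0#≈0#

    signed-neg : ∀ s x → signed s (- x) ≈ - signed s x
    signed-neg 0ℙ x = refl
    signed-neg 1ℙ x = refl

    signed-⁻¹ : ∀ s x → signed (s ⁻¹) x ≈ - signed s x
    signed-⁻¹ 0ℙ x = refl
    signed-⁻¹ 1ℙ x = sym (-‿involutive x)

    signed-linear : ∀ s x a b → signed s (x * a + b) ≈ x * signed s a + signed s b
    signed-linear 0ℙ x a b = refl
    signed-linear 1ℙ x a b = begin
      - (x * a + b)     ≈⟨ sym (-‿+-comm _ _) ⟩
      - (x * a) + - b   ≈⟨ +-congʳ (-‿distribʳ-* x a) ⟩
      x * - a + - b     ∎

    laplace-zero : ∀ {k} (M : Matrix (suc k)) j → M Fin.zero j ≈ 0# → laplace M j ≈ 0#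
    laplace-zero M j M₀ⱼ≈0 = trans (signed-cong (parity (toℕ j)) (trans (*-congʳ M₀ⱼ≈0) (zeroˡ _))) (signed-zero (parity (toℕ j)))

    det-cong : ∀ {k} {M N : Matrix k} → (∀ a b → M a b ≈ N a b) → determinant M ≈ determinant N
    det-cong {zero}  M≈N = refl
    det-cong {suc k} M≈N = sum-cong-≋ λ j → signed-cong (parity (toℕ j))
      (*-cong (M≈N Fin.zero j) (det-cong (λ a b → M≈N (Fin.suc a) (punchIn j b))))

    det-zero-column : ∀ {k} (M : Matrix k) b → (∀ a → M a b ≈ 0#) → determinant M ≈ 0#
    det-zero-column {suc k} M b column≈0 = sum-zero term≈0
      where
      term≈0 : ∀ j → laplace M j ≈ 0#
      term≈0 j with j Fin.≟ b
      ... | yes ≡.refl = laplace-zero M j (column≈0 Fin.zero)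
      ... | no  j≢b    = trans (signed-cong (parity (toℕ j)) (trans (*-congˡ (det-zero-column (minor j M) (Fin.punchOut j≢b)
                            (λ a → ≡.subst (λ x → M (Fin.suc a) x ≈ 0#) (≡.sym (FinP.punchIn-punchOut j≢b)) (column≈0 (Fin.suc a)))))
                            (zeroʳ _))) (signed-zero (parity (toℕ j)))

    det-linear-column : ∀ {k} (P M N : Matrix k) b x →
      (∀ a c → c ≢ b → P a c ≈ M a c) → (∀ a c → c ≢ b → P a c ≈ N a c) → (∀ a → P a b ≈ x * M a b + N a b) →
      determinant P ≈ x * determinant M + determinant N
    det-linear-column {suc k} P M N b x P≈M P≈N column-b = begin
      sum (laplace P)                                   ≈⟨ sum-cong-≋ term ⟩
      sum (λ j → x * laplace M j + laplace N j)         ≈⟨ ∑-distrib-+ (λ j → x * laplace M j) (laplace N) ⟩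
      sum (λ j → x * laplace M j) + sum (laplace N)     ≈⟨ +-congʳ (sym (*-distribˡ-sum x (laplace M))) ⟩
      x * sum (laplace M) + sum (laplace N)             ∎
      where
      term : ∀ j → laplace P j ≈ x * laplace M j + laplace N j
      term j with j Fin.≟ b
      ... | yes ≡.refl = trans (signed-cong s (begin
            P Fin.zero j * D                               ≈⟨ *-congʳ (column-b Fin.zero) ⟩
            (x * M Fin.zero j + N Fin.zero j) * D          ≈⟨ distribʳ D _ _ ⟩
            x * M Fin.zero j * D + N Fin.zero j * D        ≈⟨ +-cong (*-assoc _ _ _) refl ⟩
            x * (M Fin.zero j * D) + N Fin.zero j * D      ≈⟨ +-cong (*-congˡ (*-congˡ D≈DM)) (*-congˡ D≈DN) ⟩
            x * (M Fin.zero j * determinant (minor j M)) + N Fin.zero j * determinant (minor j N) ∎))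
            (signed-linear s x _ _)
        where
        s = parity (toℕ j)
        D = determinant (minor j P)
        D≈DM : D ≈ determinant (minor j M)
        D≈DM = det-cong (λ a c → P≈M (Fin.suc a) (punchIn j c) (FinP.punchInᵢ≢i j c))
        D≈DN : D ≈ determinant (minor j N)
        D≈DN = det-cong (λ a c → P≈N (Fin.suc a) (punchIn j c) (FinP.punchInᵢ≢i j c))
      ... | no j≢b = trans (signed-cong s (begin
            P Fin.zero j * determinant (minor j P)                             ≈⟨ *-congˡ minor-linear ⟩
            P Fin.zero j * (x * DM + DN)                                        ≈⟨ distribˡ _ _ _ ⟩
            P Fin.zero j * (x * DM) + P Fin.zero j * DN                         ≈⟨ +-congʳ (x*-swap _ x DM) ⟩
            x * (P Fin.zero j * DM) + P Fin.zero j * DN                         ≈⟨ +-cong (*-congˡ (*-congʳ (P≈M Fin.zero j j≢b))) (*-congʳ (P≈N Fin.zero j j≢b)) ⟩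
            x * (M Fin.zero j * DM) + N Fin.zero j * DN                         ∎))
            (signed-linear s x _ _)
        where
        s = parity (toℕ j)
        DM = determinant (minor j M)
        DN = determinant (minor j N)
        b′ = Fin.punchOut j≢b
        punchIn-b′ : punchIn j b′ ≡ b
        punchIn-b′ = FinP.punchIn-punchOut j≢b
        off-b : ∀ c → c ≢ b′ → punchIn j c ≢ b
        off-b c c≢b′ eq = c≢b′ (FinP.punchIn-injective j c b′ (≡.trans eq (≡.sym punchIn-b′)))
        x*-swap : ∀ a y d → a * (y * d) ≈ y * (a * d)
        x*-swap a y d = trans (sym (*-assoc a y d)) (trans (*-congʳ (*-comm a y)) (*-assoc y a d))
        minor-linear : determinant (minor j P) ≈ x * DM + DN
        minor-linear = det-linear-column (minor j P) (minor j M) (minor j N) b′ x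
          (λ a c c≢b′ → P≈M (Fin.suc a) (punchIn j c) (off-b c c≢b′))
          (λ a c c≢b′ → P≈N (Fin.suc a) (punchIn j c) (off-b c c≢b′))
          (λ a → ≡.subst (λ y → P (Fin.suc a) y ≈ x * M (Fin.suc a) y + N (Fin.suc a) y) (≡.sym punchIn-b′) (column-b (Fin.suc a)))

    signed-parity-suc : ∀ t x → signed (parity t) x ≈ - signed (parity (suc t)) x
    signed-parity-suc t x = begin
      signed (parity t) x              ≡⟨ ≡.cong (λ q → signed q x) (≡.sym (ℙP.suc-homo-⁻¹ t)) ⟩
      signed (parity (suc t) ⁻¹) x     ≈⟨ signed-⁻¹ (parity (suc t)) x ⟩
      - signed (parity (suc t)) x      ∎

    laplace-swap-inject₁ : ∀ {m} (M : Matrix (suc (suc m))) i →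
      laplace (λ a b → M a (swap i b)) (inject₁ i) ≈ - laplace M (Fin.suc i)
    laplace-swap-inject₁ M i = begin
      signed (parity (toℕ (inject₁ i))) (M Fin.zero (swap i (inject₁ i)) * D)
        ≡⟨ ≡.cong₂ signed (≡.cong parity (FinP.toℕ-inject₁ i)) (≡.cong (λ x → M Fin.zero x * D) (swap-inject₁ i)) ⟩
      signed (parity (toℕ i)) (M Fin.zero (Fin.suc i) * D)
        ≈⟨ signed-cong (parity (toℕ i)) (*-congˡ (det-cong (λ a b → reflexive (≡.cong (M (Fin.suc a)) (swap-punchIn-inject₁ i b))))) ⟩
      signed (parity (toℕ i)) (M Fin.zero (Fin.suc i) * determinant (minor (Fin.suc i) M))
        ≈⟨ signed-parity-suc (toℕ i) (M Fin.zero (Fin.suc i) * determinant (minor (Fin.suc i) M)) ⟩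
      - laplace M (Fin.suc i) ∎
      where D = determinant (minor (inject₁ i) (λ a b → M a (swap i b)))

    laplace-swap-suc : ∀ {m} (M : Matrix (suc (suc m))) i →
      laplace (λ a b → M a (swap i b)) (Fin.suc i) ≈ - laplace M (inject₁ i)
    laplace-swap-suc M i = begin
      signed s (M Fin.zero (swap i (Fin.suc i)) * D)
        ≡⟨ ≡.cong (λ x → signed s (M Fin.zero x * D)) (swap-suc i) ⟩
      signed s (M Fin.zero (inject₁ i) * D)
        ≈⟨ signed-cong s (*-congˡ (det-cong (λ a b → reflexive (≡.cong (M (Fin.suc a)) (swap-punchIn-suc i b))))) ⟩
      signed s Y
        ≈⟨ sym (trans (-‿cong (signed-parity-suc (toℕ i) Y)) (-‿involutive (signed s Y))) ⟩
      - signed (parity (toℕ i)) Y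
        ≡⟨ ≡.cong (λ q → - signed q Y) (≡.sym (≡.cong parity (FinP.toℕ-inject₁ i))) ⟩
      - laplace M (inject₁ i) ∎
      where
      s = parity (toℕ (Fin.suc i))
      D = determinant (minor (Fin.suc i) (λ a b → M a (swap i b)))
      Y = M Fin.zero (inject₁ i) * determinant (minor (inject₁ i) M)

    laplace-swap-other : ∀ {m} (M : Matrix (suc (suc m))) i j → j ≢ inject₁ i → j ≢ Fin.suc i →
      (∀ (N : Matrix (suc m)) i′ → determinant (λ a b → N a (swap i′ b)) ≈ - determinant N) →
      laplace (λ a b → M a (swap i b)) j ≈ - laplace M j
    laplace-swap-other M i j j≢i j≢i+1 det-swap-minor with swap-punchIn i j j≢i j≢i+1
    ... | i′ , commute = begin
      signed s (M Fin.zero (swap i j) * determinant (minor j M′))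
        ≡⟨ ≡.cong (λ x → signed s (M Fin.zero x * determinant (minor j M′))) (swap-other i j j≢i j≢i+1) ⟩
      signed s (M Fin.zero j * determinant (minor j M′))
        ≈⟨ signed-cong s (*-congˡ (det-cong (λ a b → reflexive (≡.cong (M (Fin.suc a)) (commute b))))) ⟩
      signed s (M Fin.zero j * determinant (λ a b → minor j M a (swap i′ b)))
        ≈⟨ signed-cong s (*-congˡ (det-swap-minor (minor j M) i′)) ⟩
      signed s (M Fin.zero j * - determinant (minor j M))
        ≈⟨ signed-cong s (sym (-‿distribʳ-* (M Fin.zero j) (determinant (minor j M)))) ⟩
      signed s (- (M Fin.zero j * determinant (minor j M)))
        ≈⟨ signed-neg s (M Fin.zero j * determinant (minor j M)) ⟩
      - laplace M j ∎
      where
      s = parity (toℕ j)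
      M′ = λ a b → M a (swap i b)

    det-swap : ∀ {m} (M : Matrix (suc m)) (i : Fin m) → determinant (λ a b → M a (swap i b)) ≈ - determinant M
    det-swap {suc m} M i = begin
      sum (laplace (λ a b → M a (swap i b))) ≈⟨ sum-cong-≋ term ⟩
      sum (λ j → - laplace M (swap i j))     ≈⟨ sum-neg (laplace M ∘ swap i) ⟩
      - sum (laplace M ∘ swap i)             ≈⟨ -‿cong (sym (sum-swap i (laplace M))) ⟩
      - sum (laplace M)                      ∎
      where
      term : ∀ j → laplace (λ a b → M a (swap i b)) j ≈ - laplace M (swap i j)
      term j with j Fin.≟ inject₁ i | j Fin.≟ Fin.suc i
      ... | yes ≡.refl | _ = trans (laplace-swap-inject₁ M i) (reflexive (≡.cong (λ x → - laplace M x) (≡.sym (swap-inject₁ i))))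
      ... | no _ | yes ≡.refl = trans (laplace-swap-suc M i) (reflexive (≡.cong (λ x → - laplace M x) (≡.sym (swap-suc i))))
      ... | no j≢i | no j≢i+1 = trans (laplace-swap-other M i j j≢i j≢i+1 det-swap)
        (reflexive (≡.cong (λ x → - laplace M x) (≡.sym (swap-other i j j≢i j≢i+1))))

    laplace-column₀ : ∀ {k} (M : Matrix (suc k)) → (∀ a → M (Fin.suc a) Fin.zero ≈ 0#) →
      ∀ j → j ≢ Fin.zero → laplace M j ≈ 0#
    laplace-column₀ M _ Fin.zero j≢0 = ⊥-elim (j≢0 ≡.refl)
    laplace-column₀ {suc k} M column₀≈0 (Fin.suc j) _ = trans (signed-cong (parity (toℕ (Fin.suc j)))
      (trans (*-congˡ (det-zero-column (minor (Fin.suc j) M) Fin.zero column₀≈0)) (zeroʳ _))) (signed-zero (parity (toℕ (Fin.suc j))))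

    det-column₀ : ∀ {k} (M : Matrix (suc k)) → (∀ a → M (Fin.suc a) Fin.zero ≈ 0#) →
      determinant M ≈ M Fin.zero Fin.zero * determinant (minor Fin.zero M)
    det-column₀ M column₀≈0 = sum-single (laplace M) Fin.zero (laplace-column₀ M column₀≈0)

    det-row₀-single : ∀ {k} (M : Matrix (suc (suc k))) → (∀ j → j ≢ Fin.suc Fin.zero → M Fin.zero j ≈ 0#) →
      determinant M ≈ - (M Fin.zero (Fin.suc Fin.zero) * determinant (minor (Fin.suc Fin.zero) M))
    det-row₀-single M row₀≈0 = sum-single (laplace M) (Fin.suc Fin.zero) (λ j j≢1 → laplace-zero M j (row₀≈0 j j≢1))

    det-row₀-pair : ∀ {k} (M : Matrix (suc (suc k))) → (∀ j → j ≢ Fin.zero → j ≢ Fin.suc Fin.zero → M Fin.zero j ≈ 0#) →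
      determinant M ≈ M Fin.zero Fin.zero * determinant (minor Fin.zero M)
                      + - (M Fin.zero (Fin.suc Fin.zero) * determinant (minor (Fin.suc Fin.zero) M))
    det-row₀-pair M row₀≈0 = sum-pair (laplace M) Fin.zero (Fin.suc Fin.zero) (λ ())
      (λ j j≢0 j≢1 → laplace-zero M j (row₀≈0 j j≢0 j≢1))

    setColumn : ∀ {k} → Matrix k → Fin k → (Fin k → Carrier) → Matrix k
    setColumn M b₀ v a b with b Fin.≟ b₀
    ... | yes _ = v a
    ... | no  _ = M a b

    setColumn-≡ : ∀ {k} (M : Matrix k) b₀ v a → setColumn M b₀ v a b₀ ≡ v a
    setColumn-≡ M b₀ v a with b₀ Fin.≟ b₀
    ... | yes _    = ≡.refl
    ... | no b₀≢b₀ = ⊥-elim (b₀≢b₀ ≡.refl)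

    setColumn-≢ : ∀ {k} (M : Matrix k) b₀ v a b → b ≢ b₀ → setColumn M b₀ v a b ≡ M a b
    setColumn-≢ M b₀ v a b b≢b₀ with b Fin.≟ b₀
    ... | yes b≡b₀ = ⊥-elim (b≢b₀ b≡b₀)
    ... | no  _    = ≡.refl

    det-linear-sum : ∀ {k m} (M : Matrix k) b₀ (w : Fin m → Carrier) (v : Fin m → Fin k → Carrier) →
      determinant (setColumn M b₀ (λ a → sum (λ i → w i * v i a))) ≈ sum (λ i → w i * determinant (setColumn M b₀ (v i)))
    det-linear-sum {m = zero} M b₀ w v =
      det-zero-column _ b₀ (λ a → reflexive (setColumn-≡ M b₀ (λ a′ → sum {ℕ.zero} (λ i → w i * v i a′)) a))
    det-linear-sum {m = suc m} M b₀ w v = trans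
      (det-linear-column (setColumn M b₀ all) (setColumn M b₀ (v Fin.zero)) (setColumn M b₀ rest) b₀ (w Fin.zero)
        (λ a c c≢b₀ → reflexive (≡.trans (setColumn-≢ M b₀ all a c c≢b₀) (≡.sym (setColumn-≢ M b₀ (v Fin.zero) a c c≢b₀))))
        (λ a c c≢b₀ → reflexive (≡.trans (setColumn-≢ M b₀ all a c c≢b₀) (≡.sym (setColumn-≢ M b₀ rest a c c≢b₀))))
        (λ a → reflexive (≡.trans (setColumn-≡ M b₀ all a)
          (≡.sym (≡.cong₂ (λ x y → w Fin.zero * x + y) (setColumn-≡ M b₀ (v Fin.zero) a) (setColumn-≡ M b₀ rest a))))))
      (+-congˡ (det-linear-sum M b₀ (w ∘ Fin.suc) (v ∘ Fin.suc)))
      where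
      all  = λ a → sum (λ i → w i * v i a)
      rest = λ a → sum (λ i → w (Fin.suc i) * v (Fin.suc i) a)

    module WithoutTwoTorsion (no-2-torsion : ∀ x → x + x ≈ 0# → x ≈ 0#) where

      det-equal-adjacent : ∀ {m} (M : Matrix (suc m)) (i : Fin m) → (∀ a → M a (inject₁ i) ≈ M a (Fin.suc i)) →
        determinant M ≈ 0#
      det-equal-adjacent M i same = no-2-torsion _ (begin
        determinant M + determinant M                         ≈⟨ +-congʳ (det-cong swap-invariant) ⟩
        determinant (λ a b → M a (swap i b)) + determinant M  ≈⟨ +-congʳ (det-swap M i) ⟩
        - determinant M + determinant M                       ≈⟨ -‿inverseˡ _ ⟩
        0#                                                    ∎)
        where
        swap-invariant : ∀ a b → M a b ≈ M a (swap i b)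
        swap-invariant a b with b Fin.≟ inject₁ i | b Fin.≟ Fin.suc i
        ... | yes ≡.refl | _          = trans (same a) (reflexive (≡.cong (M a) (≡.sym (swap-inject₁ i))))
        ... | no _       | yes ≡.refl = trans (sym (same a)) (reflexive (≡.cong (M a) (≡.sym (swap-suc i))))
        ... | no b≢i     | no b≢i+1   = reflexive (≡.cong (M a) (≡.sym (swap-other i b b≢i b≢i+1)))

      -- Column q is moved next to column p by adjacent swaps; d = toℕ q makes the recursion structural.
      det-equal-columns-< : ∀ d {k} (M : Matrix k) p q → toℕ q ≡ d → toℕ p < toℕ q → (∀ a → M a p ≈ M a q) →
        determinant M ≈ 0#
      det-equal-columns-< d {suc zero} M Fin.zero Fin.zero _ () _
      det-equal-columns-< d {suc (suc k)} M p Fin.zero _ () _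
      det-equal-columns-< (suc d) {suc (suc k)} M p (Fin.suc q′) q≡d p<q same
        with ℕP.m≤n⇒m<n∨m≡n (ℕP.≤-pred p<q)
      ... | inj₂ p≡q′ = det-equal-adjacent M q′ (λ a → trans (reflexive (≡.cong (M a) (≡.sym p≡inject₁q′))) (same a))
        where
        p≡inject₁q′ : p ≡ inject₁ q′
        p≡inject₁q′ = FinP.toℕ-injective (≡.trans p≡q′ (≡.sym (FinP.toℕ-inject₁ q′)))
      ... | inj₁ p<q′ = begin
        determinant M                             ≈⟨ sym (-‿involutive _) ⟩
        - - determinant M                         ≈⟨ -‿cong (sym (det-swap M q′)) ⟩
        - determinant (λ a b → M a (swap q′ b))   ≈⟨ -‿cong swapped≈0 ⟩
        - 0#                                      ≈⟨ -0#≈0# ⟩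
        0#                                        ∎
        where
        p≢inject₁q′ : p ≢ inject₁ q′
        p≢inject₁q′ eq = ℕP.<-irrefl (≡.trans (≡.cong toℕ eq) (FinP.toℕ-inject₁ q′)) p<q′
        p≢q : p ≢ Fin.suc q′
        p≢q eq = ℕP.<-irrefl (≡.cong toℕ eq) p<q
        swapped≈0 : determinant (λ a b → M a (swap q′ b)) ≈ 0#
        swapped≈0 = det-equal-columns-< d _ p (inject₁ q′) (≡.trans (FinP.toℕ-inject₁ q′) (ℕP.suc-injective q≡d))
          (≡.subst (toℕ p <_) (≡.sym (FinP.toℕ-inject₁ q′)) p<q′)
          (λ a → trans (reflexive (≡.cong (M a) (swap-other q′ p p≢inject₁q′ p≢q)))
                       (trans (same a) (reflexive (≡.cong (M a) (≡.sym (swap-inject₁ q′))))))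

      det-equal-columns : ∀ {k} (M : Matrix k) p q → p ≢ q → (∀ a → M a p ≈ M a q) → determinant M ≈ 0#
      det-equal-columns M p q p≢q same with ℕP.<-cmp (toℕ p) (toℕ q)
      ... | tri< p<q _ _ = det-equal-columns-< (toℕ q) M p q ≡.refl p<q same
      ... | tri≈ _ p≡q _ = ⊥-elim (p≢q (FinP.toℕ-injective p≡q))
      ... | tri> _ _ q<p = det-equal-columns-< (toℕ p) M q p ≡.refl q<p (λ a → sym (same a))

      -- Cramer: replacing column b₀ by ∑ y_b · (column b) multiplies the determinant by y_{b₀}.
      det-kernel : ∀ {k} (M : Matrix k) (y : Fin k → Carrier) → (∀ a → sum (λ b → y b * M a b) ≈ 0#) →
        ∀ b₀ → y b₀ * determinant M ≈ 0#
      det-kernel M y My≈0 b₀ = begin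
        y b₀ * determinant M                                      ≈⟨ *-congˡ (det-cong (λ a b → reflexive (≡.sym (unchanged a b)))) ⟩
        y b₀ * determinant (setColumn M b₀ (λ a → M a b₀))        ≈⟨ sym (sum-single _ b₀ others) ⟩
        sum (λ b → y b * determinant (setColumn M b₀ (λ a → M a b))) ≈⟨ sym (det-linear-sum M b₀ y (λ b a → M a b)) ⟩
        determinant (setColumn M b₀ (λ a → sum (λ b → y b * M a b)))
          ≈⟨ det-zero-column _ b₀ (λ a → trans (reflexive (setColumn-≡ M b₀ (λ a′ → sum (λ b → y b * M a′ b)) a)) (My≈0 a)) ⟩
        0#                                                        ∎
        where
        unchanged : ∀ a b → setColumn M b₀ (λ a → M a b₀) a b ≡ M a b
        unchanged a b with b Fin.≟ b₀
        ... | yes ≡.refl = ≡.refl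
        ... | no  _      = ≡.refl
        others : ∀ b → b ≢ b₀ → y b * determinant (setColumn M b₀ (λ a → M a b)) ≈ 0#
        others b b≢b₀ = trans (*-congˡ (det-equal-columns _ b₀ b (b≢b₀ ∘ ≡.sym)
          (λ a → reflexive (≡.trans (setColumn-≡ M b₀ (λ a′ → M a′ b) a) (≡.sym (setColumn-≢ M b₀ (λ a′ → M a′ b) a b b≢b₀))))))
          (zeroʳ _)

open import Defs
open import Data.Nat as ℕ using (ℕ; zero; suc; _+_; _∸_; _<_; _≤_; z≤n; s≤s; _*_; parity)
import Data.Nat.Properties as ℕP
import Data.Nat.ListAction as ListAction
open import Data.Fin as Fin using (Fin; toℕ; punchIn)
open import Data.Fin.Subset using (Subset; _∈_; ∣_∣)
open import Data.Vec as Vec using (Vec)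
import Data.Vec.Properties as VecP
open import Data.List as List using (List; []; _∷_; _++_; allFin; length; filterᵇ)
import Data.List.Properties as ListP
open import Data.List.Relation.Unary.All as All using (All; []; _∷_)
open import Data.List.Relation.Unary.Any using (here; there)
open import Data.List.Relation.Unary.Unique.Propositional using (Unique)
open import Data.List.Relation.Unary.AllPairs using (AllPairs; []; _∷_)
import Data.List.Relation.Unary.Unique.Propositional.Properties as UniqueP
import Data.List.Membership.Propositional as Mem
import Data.List.Membership.Propositional.Properties as MemP
open import Data.Bool using (Bool; true; false; if_then_else_; T; not; T?; _∧_)
open import Data.Product using (∃; _×_; _,_; proj₁; proj₂; Σ)
open import Data.Empty using (⊥-elim; ⊥)
open import Data.Sum using (inj₁; inj₂; _⊎_)
open import Data.Unit using (tt; ⊤)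
open import Relation.Nullary using (¬_; Dec; yes; no; does)
open import Relation.Binary.PropositionalEquality using (_≡_; _≢_; refl; sym; trans; cong; cong₂; subst; module ≡-Reasoning)
open import Function using (_∘_; id; _⇔_; mk⇔; Equivalence)
open import Data.Nat.DivMod using (_%_; m<n⇒m%n≡m; n%n≡0; [m+n]%n≡m%n; %-distribˡ-+; m%n%n≡m%n)
import Data.Fin.Properties as FinP
open import Data.Parity.Base as ℙ using (Parity; 0ℙ; 1ℙ; _⁻¹)
import Data.Parity.Properties as ℙP
import Data.List.Membership.DecPropositional as DecMem
open import Relation.Nullary.Decidable using (_×-dec_; _→-dec_)
open import Data.Nat.Tactic.RingSolver using (solve-∀)
open import Data.Maybe using (Maybe; just; nothing; is-just; _>>=_; fromMaybe)
open import Data.Maybe.Properties using (just-injective; ≡-dec)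
open import Relation.Binary using (tri<; tri≈; tri>)
open import Function.Definitions using (Injective)
open import Data.Bool.Properties using (T-≡; T-∧)
import Function.Properties.Equivalence as ⇔
open import Data.Integer as ℤ using (ℤ; 0ℤ) renaming (_+_ to _+ℤ_; _*_ to _*ℤ_; -_ to -ℤ_)
import Data.Integer.Properties as ℤP
open import Algebra.Bundles using (CommutativeRing)
open import Algebra.Structures using (IsCommutativeRing)
open import Algebra.Properties.CommutativeSemigroup ℤP.+-commutativeSemigroup using () renaming (interchange to +-interchange)
open import Data.Fin.Subset.Properties using (_∈?_)
import Data.List.Relation.Unary.AllPairs.Properties as AllPairsP

-- Counting

countᴸ : {A : Set} → (A → Bool) → List A → ℕ
countᴸ P xs = ListAction.sum (List.map (λ v → if P v then 1 else 0) xs)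

length-filterᵇ : {A : Set} (P : A → Bool) (xs : List A) → length (filterᵇ P xs) ≡ countᴸ P xs
length-filterᵇ P [] = refl
length-filterᵇ P (x ∷ xs) with P x
... | true  = cong suc (length-filterᵇ P xs)
... | false = length-filterᵇ P xs

countᴸ-complement : {A : Set} (P : A → Bool) (xs : List A) →
  countᴸ P xs + countᴸ (not ∘ P) xs ≡ length xs
countᴸ-complement P [] = refl
countᴸ-complement P (x ∷ xs) with P x
... | true  = cong suc (countᴸ-complement P xs)
... | false = trans (ℕP.+-suc (countᴸ P xs) _) (cong suc (countᴸ-complement P xs))

∈-filterᵇ⁺ : {A : Set} (P : A → Bool) {x : A} {xs : List A} → x Mem.∈ xs → T (P x) → x Mem.∈ filterᵇ P xs
∈-filterᵇ⁺ P = MemP.∈-filter⁺ (T? ∘ P)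

∈-filterᵇ⁻ : {A : Set} (P : A → Bool) {x : A} {xs : List A} → x Mem.∈ filterᵇ P xs → T (P x)
∈-filterᵇ⁻ P {xs = xs} m = proj₂ (MemP.∈-filter⁻ (T? ∘ P) {xs = xs} m)

Unique-⊆⇒length≤ : {A : Set} {xs : List A} (ys : List A) → Unique xs →
  (∀ {x} → x Mem.∈ xs → x Mem.∈ ys) → length xs ≤ length ys
Unique-⊆⇒length≤ {xs = []} ys u sub = z≤n
Unique-⊆⇒length≤ {xs = x ∷ xs} ys (x∉xs ∷ u) sub with MemP.∈-∃++ (sub (here refl))
... | as , bs , refl = begin
  suc (length xs)             ≤⟨ s≤s (Unique-⊆⇒length≤ (as ++ bs) u sub′) ⟩
  suc (length (as ++ bs))     ≡⟨ cong suc (ListP.length-++ as) ⟩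
  suc (length as + length bs) ≡⟨ sym (ℕP.+-suc (length as) (length bs)) ⟩
  length as + length (x ∷ bs) ≡⟨ sym (ListP.length-++ as) ⟩
  length (as ++ x ∷ bs)       ∎
  where
  open ℕP.≤-Reasoning
  sub′ : ∀ {y} → y Mem.∈ xs → y Mem.∈ (as ++ bs)
  sub′ y∈xs with MemP.∈-++⁻ as (sub (there y∈xs))
  ... | inj₁ y∈as = MemP.∈-++⁺ˡ y∈as
  ... | inj₂ (here refl) = ⊥-elim (All.lookup x∉xs y∈xs refl)
  ... | inj₂ (there y∈bs) = MemP.∈-++⁺ʳ as y∈bs

module _ {n : ℕ} where

  count-complement : (P : Fin n → Bool) → count P + count (not ∘ P) ≡ n
  count-complement P = trans (countᴸ-complement P (allFin n)) (ListP.length-tabulate id)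

  count-cong : {P Q : Fin n → Bool} → (∀ v → P v ≡ Q v) → count P ≡ count Q
  count-cong P≗Q = cong ListAction.sum (ListP.map-cong (λ v → cong (λ b → if b then 1 else 0) (P≗Q v)) (allFin n))

  length≤count : (Q : Fin n → Bool) {xs : List (Fin n)} → Unique xs →
    (∀ {v} → v Mem.∈ xs → T (Q v)) → length xs ≤ count Q
  length≤count Q u xs⊆Q = subst (_ ≤_) (length-filterᵇ Q (allFin n))
    (Unique-⊆⇒length≤ _ u (λ {x} x∈xs → ∈-filterᵇ⁺ Q (MemP.∈-allFin x) (xs⊆Q x∈xs)))

  count≤length : (P : Fin n → Bool) {xs : List (Fin n)} →
    (∀ {v} → T (P v) → v Mem.∈ xs) → count P ≤ length xs
  count≤length P P⊆xs = subst (_≤ _) (length-filterᵇ P (allFin n))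
    (Unique-⊆⇒length≤ _ (UniqueP.filter⁺ (T? ∘ P) (UniqueP.allFin⁺ n))
      (λ {x} x∈P → P⊆xs (∈-filterᵇ⁻ P {xs = allFin n} x∈P)))

  length≡count : (P : Fin n → Bool) {xs : List (Fin n)} → Unique xs →
    (∀ {v} → v Mem.∈ xs → T (P v)) → (∀ {v} → T (P v) → v Mem.∈ xs) → length xs ≡ count P
  length≡count P u xs⊆P P⊆xs = ℕP.≤-antisym (length≤count P u xs⊆P) (count≤length P P⊆xs)

  count-mono-injection : (P Q : Fin n → Bool) (f : ∀ v → T (P v) → Fin n) →
    (∀ v p → T (Q (f v p))) → (∀ {v w} p q → f v p ≡ f w q → v ≡ w) → count P ≤ count Q
  count-mono-injection P Q f f-Q f-inj = begin
    count P                ≡⟨ sym (length-filterᵇ P (allFin n)) ⟩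
    length Ps              ≡⟨ sym (length-image Ps _) ⟩
    length (image Ps P-Ps) ≤⟨ length≤count Q (unique-image (UniqueP.filter⁺ (T? ∘ P) (UniqueP.allFin⁺ n)) P-Ps) (image-Q Ps P-Ps) ⟩
    count Q                ∎
    where
    open ℕP.≤-Reasoning
    Ps = filterᵇ P (allFin n)
    P-Ps : All (T ∘ P) Ps
    P-Ps = All.tabulate (∈-filterᵇ⁻ P {xs = allFin n})
    image : (xs : List (Fin n)) → All (T ∘ P) xs → List (Fin n)
    image [] [] = []
    image (x ∷ xs) (p ∷ ps) = f x p ∷ image xs ps
    length-image : ∀ xs ps → length (image xs ps) ≡ length xs
    length-image [] [] = refl
    length-image (x ∷ xs) (p ∷ ps) = cong suc (length-image xs ps)
    ∈-image⁻ : ∀ {xs ps y} → y Mem.∈ image xs ps → ∃ λ x → x Mem.∈ xs × ∃ λ p → y ≡ f x p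
    ∈-image⁻ {x ∷ xs} {p ∷ ps} (here y≡fx) = x , here refl , p , y≡fx
    ∈-image⁻ {x ∷ xs} {p ∷ ps} (there y∈) with ∈-image⁻ y∈
    ... | x′ , x′∈ , p′ , y≡ = x′ , there x′∈ , p′ , y≡
    image-Q : ∀ xs ps {y} → y Mem.∈ image xs ps → T (Q y)
    image-Q xs ps y∈ with ∈-image⁻ y∈
    ... | x , _ , p , refl = f-Q x p
    unique-image : ∀ {xs} → Unique xs → (ps : All (T ∘ P) xs) → Unique (image xs ps)
    unique-image [] [] = []
    unique-image (x∉xs ∷ u) (p ∷ ps) =
      All.tabulate (λ y∈ fx≡y → let (x′ , x′∈ , p′ , y≡) = ∈-image⁻ y∈ in
        All.lookup x∉xs x′∈ (f-inj p p′ (trans fx≡y y≡)))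
      ∷ unique-image u ps

count-suc : {n : ℕ} (P : Fin (suc n) → Bool) → count P ≡ (if P Fin.zero then 1 else 0) + count (P ∘ Fin.suc)
count-suc {n} P = cong (λ xs → (if P Fin.zero then 1 else 0) + ListAction.sum xs)
  (trans (ListP.map-tabulate Fin.suc ind∘P) (sym (ListP.map-tabulate id (ind∘P ∘ Fin.suc))))
  where
  ind∘P : Fin (suc n) → ℕ
  ind∘P v = if P v then 1 else 0

∣S∣≡count : {n : ℕ} (S : Subset n) → ∣ S ∣ ≡ count (Vec.lookup S)
∣S∣≡count Vec.[] = refl
∣S∣≡count (true Vec.∷ S)  = trans (cong suc (∣S∣≡count S)) (sym (count-suc (Vec.lookup (true Vec.∷ S))))
∣S∣≡count (false Vec.∷ S) = trans (∣S∣≡count S) (sym (count-suc (Vec.lookup (false Vec.∷ S))))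

∈⇔T-lookup : {n : ℕ} (S : Subset n) (v : Fin n) → v ∈ S ⇔ T (Vec.lookup S v)
∈⇔T-lookup S v = mk⇔ (λ v∈S → subst T (sym (VecP.[]=⇒lookup v∈S)) tt)
                     (λ t → VecP.lookup⇒[]= v S (Equivalence.to T-≡ t))

T-does⁺ : {A : Set} (d : Dec A) → A → T (does d)
T-does⁺ (yes _)  _ = tt
T-does⁺ (no ¬a)  a = ¬a a

T-does⁻ : {A : Set} (d : Dec A) → T (does d) → A
T-does⁻ (yes a) _ = a

T-not-does⁺ : {A : Set} (d : Dec A) → ¬ A → T (not (does d))
T-not-does⁺ (yes a) ¬a = ¬a a
T-not-does⁺ (no _)  _  = tt

-- Cyclic successor and parity

module _ {k : ℕ} where

  next-< : (i : Fin (suc k)) → toℕ i < k → toℕ (next i) ≡ suc (toℕ i)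
  next-< i i<k with toℕ i ℕ.<? k
  ... | yes i<k′ = FinP.toℕ-fromℕ< (s≤s i<k′)
  ... | no  i≮k  = ⊥-elim (i≮k i<k)

  next-≮ : (i : Fin (suc k)) → ¬ (toℕ i < k) → next i ≡ Fin.zero
  next-≮ i i≮k with toℕ i ℕ.<? k
  ... | yes i<k  = ⊥-elim (i≮k i<k)
  ... | no  _    = refl

  ≮⇒toℕ≡ : (i : Fin (suc k)) → ¬ (toℕ i < k) → toℕ i ≡ k
  ≮⇒toℕ≡ i i≮k = ℕP.≤-antisym (ℕP.≤-pred (FinP.toℕ<n i)) (ℕP.≮⇒≥ i≮k)

  toℕ-next : (i : Fin (suc k)) → toℕ (next i) ≡ suc (toℕ i) % suc k
  toℕ-next i with toℕ i ℕ.<? k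
  ... | yes i<k = trans (FinP.toℕ-fromℕ< (s≤s i<k)) (sym (m<n⇒m%n≡m (s≤s i<k)))
  ... | no  i≮k = trans (sym (n%n≡0 (suc k))) (cong (λ m → suc m % suc k) (sym (≮⇒toℕ≡ i i≮k)))

  next^ : ℕ → Fin (suc k) → Fin (suc k)
  next^ zero    i = i
  next^ (suc m) i = next (next^ m i)

  toℕ-next^ : ∀ m (i : Fin (suc k)) → toℕ (next^ m i) ≡ (toℕ i + m) % suc k
  toℕ-next^ zero i = trans (sym (m<n⇒m%n≡m (FinP.toℕ<n i))) (cong (_% suc k) (sym (ℕP.+-identityʳ (toℕ i))))
  toℕ-next^ (suc m) i = begin
    toℕ (next (next^ m i))     ≡⟨ toℕ-next (next^ m i) ⟩
    suc (toℕ (next^ m i)) % L  ≡⟨ cong (λ x → suc x % L) (toℕ-next^ m i) ⟩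
    (1 + (t + m) % L) % L      ≡⟨ %-distribˡ-+ 1 ((t + m) % L) L ⟩
    (1 % L + (t + m) % L % L) % L ≡⟨ cong (λ x → (1 % L + x) % L) (m%n%n≡m%n (t + m) L) ⟩
    (1 % L + (t + m) % L) % L  ≡⟨ sym (%-distribˡ-+ 1 (t + m) L) ⟩
    (1 + (t + m)) % L          ≡⟨ cong (_% L) (sym (ℕP.+-suc t m)) ⟩
    (t + suc m) % L            ∎
    where
    open ≡-Reasoning
    L = suc k
    t = toℕ i

  next^-period : (i : Fin (suc k)) → next^ (suc k) i ≡ i
  next^-period i = FinP.toℕ-injective (begin
    toℕ (next^ (suc k) i)     ≡⟨ toℕ-next^ (suc k) i ⟩
    (toℕ i + suc k) % suc k   ≡⟨ [m+n]%n≡m%n (toℕ i) (suc k) ⟩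
    toℕ i % suc k             ≡⟨ m<n⇒m%n≡m (FinP.toℕ<n i) ⟩
    toℕ i                     ∎)
    where open ≡-Reasoning

  next^-≢ : ∀ m (i : Fin (suc k)) → 1 ≤ m → m < suc k → next^ m i ≢ i
  next^-≢ m i 1≤m m<L next^m≡i with toℕ i + m ℕ.<? suc k
  ... | yes t+m<L = ℕP.<-irrefl refl (ℕP.≤-trans t<t+m (ℕP.≤-reflexive t+m≡t))
    where
    t = toℕ i
    t+m≡t : t + m ≡ t
    t+m≡t = trans (sym (m<n⇒m%n≡m t+m<L)) (trans (sym (toℕ-next^ m i)) (cong toℕ next^m≡i))
    t<t+m : t < t + m
    t<t+m = subst (_≤ t + m) (ℕP.+-comm t 1) (ℕP.+-monoʳ-≤ t 1≤m)
  ... | no t+m≮L = ℕP.<-irrefl refl (subst (_< L) m≡L m<L)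
    where
    L = suc k
    t = toℕ i
    d = t + m ∸ L
    d+L≡t+m : d + L ≡ t + m
    d+L≡t+m = ℕP.m∸n+n≡m (ℕP.≮⇒≥ t+m≮L)
    d<L : d < L
    d<L = ℕP.+-cancelʳ-< L d L (subst (_< L + L) (sym d+L≡t+m) (ℕP.+-mono-< (FinP.toℕ<n i) m<L))
    d≡t : d ≡ t
    d≡t = begin
      d                ≡⟨ sym (m<n⇒m%n≡m d<L) ⟩
      d % L            ≡⟨ sym ([m+n]%n≡m%n d L) ⟩
      (d + L) % L      ≡⟨ cong (_% L) d+L≡t+m ⟩
      (t + m) % L      ≡⟨ sym (toℕ-next^ m i) ⟩
      toℕ (next^ m i)  ≡⟨ cong toℕ next^m≡i ⟩
      t                ∎
      where open ≡-Reasoning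
    m≡L : m ≡ L
    m≡L = ℕP.+-cancelˡ-≡ t m L (trans (sym d+L≡t+m) (cong (_+ L) d≡t))

parity-suc : ∀ m → parity (suc m) ≡ parity m ⁻¹
parity-suc m = trans (sym (ℙP.⁻¹-involutive (parity (suc m)))) (cong _⁻¹ (ℙP.suc-homo-⁻¹ m))

Odd⇒parity≡1ℙ : ∀ {m} → Odd m → parity m ≡ 1ℙ
Odd⇒parity≡1ℙ (k , refl) = trans (parity-suc (2 * k)) (cong _⁻¹ (ℙP.*-homo-* 2 k))

parity≡1ℙ⇒Odd : ∀ m → parity m ≡ 1ℙ → Odd m
parity≡1ℙ⇒Odd (suc zero) _ = 0 , refl
parity≡1ℙ⇒Odd (suc (suc m)) pm≡1 with parity≡1ℙ⇒Odd m pm≡1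
... | k , refl = suc k , cong (λ x → suc (suc x)) (sym (ℕP.+-suc k (k + 0)))

Odd-+ : ∀ a b → Odd (a + b) → Odd a ⊎ Odd b
Odd-+ a b odd with parity a in pa | ℙP.+-homo-+ a b
... | 1ℙ | _ = inj₁ (parity≡1ℙ⇒Odd a pa)
... | 0ℙ | pab = inj₂ (parity≡1ℙ⇒Odd b (trans (sym pab) (Odd⇒parity≡1ℙ odd)))

≢⇒≡⁻¹ : ∀ {p q : Parity} → p ≢ q → q ≡ p ⁻¹
≢⇒≡⁻¹ {0ℙ} {0ℙ} p≢q = ⊥-elim (p≢q refl)
≢⇒≡⁻¹ {0ℙ} {1ℙ} _ = refl
≢⇒≡⁻¹ {1ℙ} {0ℙ} _ = refl
≢⇒≡⁻¹ {1ℙ} {1ℙ} p≢q = ⊥-elim (p≢q refl)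

⁻¹-distribʳ-+ : ∀ p q → (p ℙ.+ q) ⁻¹ ≡ p ℙ.+ q ⁻¹
⁻¹-distribʳ-+ 0ℙ q = refl
⁻¹-distribʳ-+ 1ℙ q = refl

next∘next≡⇒next≡ : ∀ {len} → Odd (suc len) → (i : Fin (suc len)) → next (next i) ≡ i → next i ≡ i
next∘next≡⇒next≡ {zero}        _   Fin.zero _ = refl
next∘next≡⇒next≡ {suc zero}    odd _        _ with () ← Odd⇒parity≡1ℙ odd
next∘next≡⇒next≡ {suc (suc _)} _   i        next²≡ = ⊥-elim (next^-≢ 2 i (s≤s z≤n) (s≤s (s≤s (s≤s z≤n))) next²≡)

-- Reachability and components

least-ℕ : (P : ℕ → Set) → (∀ k → Dec (P k)) → (N : ℕ) → P N →
  Σ ℕ λ k → P k × (∀ j → j < k → ¬ P j)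
least-ℕ P P? zero p = zero , p , λ _ ()
least-ℕ P P? (suc N) p with P? zero
... | yes p0 = zero , p0 , λ _ ()
... | no ¬p0 with least-ℕ (λ k → P (suc k)) (λ k → P? (suc k)) N p
... | k , pk , k-least = suc k , pk , least
  where
  least : ∀ j → j < suc k → ¬ P j
  least zero    _         = ¬p0
  least (suc j) (s≤s j<k) = k-least j j<k

least-Fin : {m : ℕ} (P : Fin m → Set) → (∀ k → Dec (P k)) → (w : Fin m) → P w →
  Σ (Fin m) λ k → P k × (∀ j → P j → toℕ k ≤ toℕ j)
least-Fin {suc m} P P? w p with P? Fin.zero
... | yes p0 = Fin.zero , p0 , λ _ _ → z≤n
least-Fin {suc m} P P? Fin.zero p       | no ¬p0 = ⊥-elim (¬p0 p)
least-Fin {suc m} P P? (Fin.suc w) p    | no ¬p0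
  with least-Fin (λ k → P (Fin.suc k)) (λ k → P? (Fin.suc k)) w p
... | k , pk , k-least = Fin.suc k , pk , least
  where
  least : ∀ j → P j → toℕ (Fin.suc k) ≤ toℕ j
  least Fin.zero    pj = ⊥-elim (¬p0 pj)
  least (Fin.suc j) pj = s≤s (k-least j pj)

module _ {n : ℕ} (Γ : Graph n) where
  open Graph Γ

  infix 4 _∼?_

  ∼-sym : ∀ {u v} → _∼_ Γ u v → _∼_ Γ v u
  ∼-sym {u} {v} = subst T (adj-sym u v)

  _∼?_ : ∀ u v → Dec (_∼_ Γ u v)
  u ∼? v = T? (adj u v)

  ∼⇒Reach : ∀ {u v} → _∼_ Γ u v → Reach Γ u v
  ∼⇒Reach u∼v = step u∼v here

  Reach-trans : ∀ {u v w} → Reach Γ u v → Reach Γ v w → Reach Γ u w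
  Reach-trans here       q = q
  Reach-trans (step e p) q = step e (Reach-trans p q)

  Reach-∷ʳ : ∀ {u v w} → Reach Γ u v → _∼_ Γ v w → Reach Γ u w
  Reach-∷ʳ p e = Reach-trans p (∼⇒Reach e)

  Reach-sym : ∀ {u v} → Reach Γ u v → Reach Γ v u
  Reach-sym here       = here
  Reach-sym (step e p) = Reach-∷ʳ (Reach-sym p) (∼-sym e)

  vertices : ∀ {u v} → Reach Γ u v → List (Fin n)
  vertices {v = v} here     = v ∷ []
  vertices {u = u} (step _ p) = u ∷ vertices p

  shorten : ∀ {u v} → Reach Γ u v → Σ (Reach Γ u v) λ q → Unique (vertices q)
  shorten here = here , [] ∷ []
  shorten {u} (step e p) with shorten p
  ... | q , q-unique with DecMem._∈?_ Fin._≟_ u (vertices q)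
  ... | no u∉q  = step e q , All.tabulate (λ x∈q u≡x → u∉q (subst (Mem._∈ vertices q) (sym u≡x) x∈q)) ∷ q-unique
  ... | yes u∈q = suffix q u∈q q-unique
    where
    suffix : ∀ {w} (q : Reach Γ w _) → u Mem.∈ vertices q → Unique (vertices q) →
      Σ (Reach Γ u _) λ q′ → Unique (vertices q′)
    suffix here         (here refl) _            = here , [] ∷ []
    suffix (step e′ q′) (here refl) q-unique     = step e′ q′ , q-unique
    suffix (step _ q′)  (there u∈)  (_ ∷ unique) = suffix q′ u∈ unique

  ReachWithin : ℕ → Fin n → Fin n → Set
  ReachWithin zero    u v = ⊥
  ReachWithin (suc k) u v = u ≡ v ⊎ ∃ λ w → _∼_ Γ u w × ReachWithin k w v

  ReachWithin? : ∀ k u v → Dec (ReachWithin k u v)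
  ReachWithin? zero    u v = no λ ()
  ReachWithin? (suc k) u v with u Fin.≟ v
  ... | yes u≡v = yes (inj₁ u≡v)
  ... | no  u≢v with FinP.any? (λ w → (u ∼? w) ×-dec ReachWithin? k w v)
  ... | yes w = yes (inj₂ w)
  ... | no ¬w = no λ { (inj₁ u≡v) → u≢v u≡v ; (inj₂ w) → ¬w w }

  ReachWithin-mono : ∀ {k k′ u v} → k ≤ k′ → ReachWithin k u v → ReachWithin k′ u v
  ReachWithin-mono {suc k} {suc k′} _          (inj₁ u≡v)      = inj₁ u≡v
  ReachWithin-mono {suc k} {suc k′} (s≤s k≤k′) (inj₂ (w , e , r)) = inj₂ (w , e , ReachWithin-mono k≤k′ r)

  ReachWithin⇒Reach : ∀ {k u v} → ReachWithin k u v → Reach Γ u v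
  ReachWithin⇒Reach {suc k} (inj₁ refl)       = here
  ReachWithin⇒Reach {suc k} (inj₂ (_ , e , r)) = step e (ReachWithin⇒Reach r)

  Reach⇒ReachWithin : ∀ {u v} (p : Reach Γ u v) → ReachWithin (length (vertices p)) u v
  Reach⇒ReachWithin here       = inj₁ refl
  Reach⇒ReachWithin (step e p) = inj₂ (_ , e , Reach⇒ReachWithin p)

  Reach⇒ReachWithin-n : ∀ {u v} → Reach Γ u v → ReachWithin n u v
  Reach⇒ReachWithin-n p with shorten p
  ... | q , q-unique = ReachWithin-mono
    (subst (length (vertices q) ≤_) (ListP.length-tabulate {n = n} id)
      (Unique-⊆⇒length≤ (allFin n) q-unique (λ {x} _ → MemP.∈-allFin x)))
    (Reach⇒ReachWithin q)

  Reach? : ∀ u v → Dec (Reach Γ u v)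
  Reach? u v with ReachWithin? n u v
  ... | yes r = yes (ReachWithin⇒Reach r)
  ... | no ¬r = no (λ p → ¬r (Reach⇒ReachWithin-n p))

Unique-map⇒lookup-injective : {A B : Set} (f : A → B) (xs : List A) → Unique (List.map f xs) →
  ∀ {i j} → f (List.lookup xs i) ≡ f (List.lookup xs j) → i ≡ j
Unique-map⇒lookup-injective f (x ∷ xs) (fx∉ ∷ u) {Fin.zero}  {Fin.zero}  _ = refl
Unique-map⇒lookup-injective f (x ∷ xs) (fx∉ ∷ u) {Fin.zero}  {Fin.suc j} eq =
  ⊥-elim (All.lookup fx∉ (MemP.∈-map⁺ f (MemP.∈-lookup j)) eq)
Unique-map⇒lookup-injective f (x ∷ xs) (fx∉ ∷ u) {Fin.suc i} {Fin.zero}  eq =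
  ⊥-elim (All.lookup fx∉ (MemP.∈-map⁺ f (MemP.∈-lookup i)) (sym eq))
Unique-map⇒lookup-injective f (x ∷ xs) (fx∉ ∷ u) {Fin.suc i} {Fin.suc j} eq =
  cong Fin.suc (Unique-map⇒lookup-injective f xs u eq)

Unique-or-duplicate : {A : Set} → (∀ (x y : A) → Dec (x ≡ y)) → (xs : List A) →
  Unique xs ⊎ ∃ λ as → ∃ λ z → ∃ λ bs → ∃ λ cs → xs ≡ as ++ z ∷ bs ++ z ∷ cs
Unique-or-duplicate _≟_ [] = inj₁ []
Unique-or-duplicate _≟_ (x ∷ xs) with DecMem._∈?_ _≟_ x xs
... | yes x∈xs = let (bs , cs , xs≡) = MemP.∈-∃++ x∈xs in inj₂ ([] , x , bs , cs , cong (x ∷_) xs≡)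
... | no  x∉xs with Unique-or-duplicate _≟_ xs
... | inj₁ u = inj₁ (All.tabulate (λ y∈xs x≡y → x∉xs (subst (Mem._∈ xs) (sym x≡y) y∈xs)) ∷ u)
... | inj₂ (as , z , bs , cs , xs≡) = inj₂ (x ∷ as , z , bs , cs , cong (x ∷_) xs≡)

module _ {n : ℕ} (Γ : Graph n) where

  root : Fin n → Fin n
  root v = proj₁ (least-Fin (Reach Γ v) (Reach? Γ v) v here)

  Reach-root : ∀ v → Reach Γ v (root v)
  Reach-root v = proj₁ (proj₂ (least-Fin (Reach Γ v) (Reach? Γ v) v here))

  root-minimal : ∀ v w → Reach Γ v w → toℕ (root v) ≤ toℕ w
  root-minimal v = proj₂ (proj₂ (least-Fin (Reach Γ v) (Reach? Γ v) v here))

  Reach⇒root≡ : ∀ {v w} → Reach Γ v w → root v ≡ root w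
  Reach⇒root≡ {v} {w} p = FinP.toℕ-injective (ℕP.≤-antisym
    (root-minimal v (root w) (Reach-trans Γ p (Reach-root w)))
    (root-minimal w (root v) (Reach-trans Γ (Reach-sym Γ p) (Reach-root v))))

  root-idem : ∀ v → root (root v) ≡ root v
  root-idem v = sym (Reach⇒root≡ (Reach-root v))

  Minimal⇒root≡ : ∀ {v} → (∀ w → Reach Γ v w → toℕ v ≤ toℕ w) → root v ≡ v
  Minimal⇒root≡ {v} v-min = FinP.toℕ-injective
    (ℕP.≤-antisym (root-minimal v v here) (v-min (root v) (Reach-root v)))

  root≡⇒Minimal : ∀ {v} → root v ≡ v → ∀ w → Reach Γ v w → toℕ v ≤ toℕ w
  root≡⇒Minimal {v} root≡v w p = subst (λ x → toℕ x ≤ toℕ w) root≡v (root-minimal v w p)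

  ComponentHasOddCycle-Reach : ∀ {v w} → Reach Γ v w → ComponentHasOddCycle Γ w → ComponentHasOddCycle Γ v
  ComponentHasOddCycle-Reach p (c , w⇝c) = c , λ i → Reach-trans Γ p (w⇝c i)

  -- Closed walks of odd length and odd cycles

  infixr 5 _∷ʷ_

  -- Walk u xs v: a walk u → x₁ → ⋯ → xₖ → v with at least one edge.
  data Walk : Fin n → List (Fin n) → Fin n → Set where
    [_]ʷ : ∀ {u v} → _∼_ Γ u v → Walk u [] v
    _∷ʷ_ : ∀ {u x xs v} → _∼_ Γ u x → Walk x xs v → Walk u (x ∷ xs) v

  Walk-split : ∀ {u v y} xs ys → Walk u (xs ++ y ∷ ys) v → Walk u xs y × Walk y ys v
  Walk-split []       ys (e ∷ʷ w) = [ e ]ʷ , w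
  Walk-split (x ∷ xs) ys (e ∷ʷ w) = let (w₁ , w₂) = Walk-split xs ys w in e ∷ʷ w₁ , w₂

  Walk-join : ∀ {u v y xs ys} → Walk u xs y → Walk y ys v → Walk u (xs ++ y ∷ ys) v
  Walk-join [ e ]ʷ     w = e ∷ʷ w
  Walk-join (e ∷ʷ w₁) w = e ∷ʷ Walk-join w₁ w

  Walk-∈⇒Reach : ∀ {u xs v x} → Walk u xs v → x Mem.∈ (u ∷ xs) → Reach Γ u x
  Walk-∈⇒Reach w        (here refl)         = here
  Walk-∈⇒Reach (e ∷ʷ w) (there x∈)          = step e (Walk-∈⇒Reach w x∈)

  Walk-step : ∀ {u xs v} → Walk u xs v → (i j : Fin (suc (length xs))) → toℕ j ≡ suc (toℕ i) →
    _∼_ Γ (List.lookup (u ∷ xs) i) (List.lookup (u ∷ xs) j)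
  Walk-step (e ∷ʷ w) Fin.zero    (Fin.suc Fin.zero) _  = e
  Walk-step (e ∷ʷ w) (Fin.suc i) (Fin.suc j)        eq = Walk-step w i j (ℕP.suc-injective eq)

  Walk-last : ∀ {u xs v} → Walk u xs v → (i : Fin (suc (length xs))) → toℕ i ≡ length xs →
    _∼_ Γ (List.lookup (u ∷ xs) i) v
  Walk-last [ e ]ʷ    Fin.zero    refl = e
  Walk-last (e ∷ʷ w) (Fin.suc i) eq   = Walk-last w i (ℕP.suc-injective eq)

  closedPath⇒OddCycle : ∀ {y ms} → Walk y ms y → Unique (y ∷ ms) → Odd (suc (length ms)) → OddCycle Γ
  closedPath⇒OddCycle {y} {ms} w u odd = record
    { len = length ms ; odd = odd ; vert = List.lookup (y ∷ ms)
    ; inj = Unique-map⇒lookup-injective id (y ∷ ms) (subst Unique (sym (ListP.map-id (y ∷ ms))) u) ; edges = edges }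
    where
    edges : ∀ i → _∼_ Γ (List.lookup (y ∷ ms) i) (List.lookup (y ∷ ms) (next i))
    edges i = from-decision (toℕ i ℕ.<? length ms)
      where
      from-decision : Dec (toℕ i < length ms) → _∼_ Γ (List.lookup (y ∷ ms) i) (List.lookup (y ∷ ms) (next i))
      from-decision (yes i<len) = Walk-step w i (next i) (next-< i i<len)
      from-decision (no  i≮len) = subst (λ j → _∼_ Γ (List.lookup (y ∷ ms) i) (List.lookup (y ∷ ms) j))
                                      (sym (next-≮ i i≮len)) (Walk-last w i (≮⇒toℕ≡ i i≮len))

  ClosedWalkIn : List (Fin n) → ℕ → Set
  ClosedWalkIn vs ℓ = ∃ λ y → ∃ λ ms → Walk y ms y × suc (length ms) ≡ ℓ × (∀ {v} → v Mem.∈ (y ∷ ms) → v Mem.∈ vs)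

  split-closed-walk : ∀ {y ms} → Walk y ms y → ∀ as z bs cs → y ∷ ms ≡ as ++ z ∷ bs ++ z ∷ cs →
    ∃ λ ℓ₁ → ∃ λ ℓ₂ → ℓ₁ + ℓ₂ ≡ suc (length ms) × ClosedWalkIn (y ∷ ms) ℓ₁ × ClosedWalkIn (y ∷ ms) ℓ₂
  split-closed-walk w [] z bs cs refl =
    let (w₁ , w₂) = Walk-split bs cs w in
    _ , _ , cong suc (sym (ListP.length-++ bs)) ,
    (z , bs , w₁ , refl , λ { (here refl) → here refl ; (there v∈) → there (MemP.∈-++⁺ˡ v∈) }) ,
    (z , cs , w₂ , refl , λ { (here refl) → here refl ; (there v∈) → there (MemP.∈-++⁺ʳ bs (there v∈)) })
  split-closed-walk {y} w (y ∷ as) z bs cs refl =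
    let (w₁ , w₂₃) = Walk-split as (bs ++ z ∷ cs) w in
    let (w₂ , w₃) = Walk-split bs cs w₂₃ in
    _ , _ , lengths ,
    (z , bs , w₂ , refl , λ v∈ → there (MemP.∈-++⁺ʳ as (inner v∈))) ,
    (y , as ++ z ∷ cs , Walk-join w₁ w₃ , refl , outer)
    where
    inner : ∀ {v} → v Mem.∈ z ∷ bs → v Mem.∈ z ∷ bs ++ z ∷ cs
    inner (here refl) = here refl
    inner (there v∈)  = there (MemP.∈-++⁺ˡ v∈)
    outer : ∀ {v} → v Mem.∈ y ∷ as ++ z ∷ cs → v Mem.∈ y ∷ as ++ z ∷ bs ++ z ∷ cs
    outer (here refl) = here refl
    outer (there v∈) with MemP.∈-++⁻ as v∈
    ... | inj₁ v∈as         = there (MemP.∈-++⁺ˡ v∈as)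
    ... | inj₂ (here refl)  = there (MemP.∈-++⁺ʳ as (here refl))
    ... | inj₂ (there v∈cs) = there (MemP.∈-++⁺ʳ as (there (MemP.∈-++⁺ʳ bs (there v∈cs))))
    lengths : suc (length bs) + suc (length (as ++ z ∷ cs)) ≡ suc (length (as ++ z ∷ bs ++ z ∷ cs))
    lengths = begin
      suc (length bs) + suc (length (as ++ z ∷ cs))      ≡⟨ cong (λ m → suc (length bs) + suc m) (ListP.length-++ as) ⟩
      suc (length bs) + suc (length as + suc (length cs)) ≡⟨ arith (length as) (length bs) (length cs) ⟩
      suc (length as + suc (length bs + suc (length cs))) ≡⟨ cong (λ m → suc (length as + suc m)) (sym (ListP.length-++ bs)) ⟩
      suc (length as + suc (length (bs ++ z ∷ cs)))       ≡⟨ cong suc (sym (ListP.length-++ as)) ⟩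
      suc (length (as ++ z ∷ bs ++ z ∷ cs))               ∎
      where
      open ≡-Reasoning
      arith : ∀ a b c → suc b + suc (a + suc c) ≡ suc (a + suc (b + suc c))
      arith = solve-∀

  odd-closed-walk⇒OddCycle : ∀ {y ms} → Walk y ms y → Odd (suc (length ms)) →
    Σ (OddCycle Γ) λ c → ∀ i → OddCycle.vert c i Mem.∈ (y ∷ ms)
  odd-closed-walk⇒OddCycle {ms = ms} = go (suc (length ms)) ℕP.≤-refl
    where
    part< : ∀ a b m fuel → suc a + suc b ≡ suc m → m < suc fuel → a < fuel
    part< a b m fuel eq m≤fuel = ℕP.≤-trans (s≤s (ℕP.m≤m+n a b))
      (ℕP.≤-trans (ℕP.≤-reflexive (trans (sym (ℕP.+-suc a b)) (ℕP.suc-injective eq))) (ℕP.≤-pred m≤fuel))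
    go : ∀ fuel {y ms} → length ms < fuel → Walk y ms y → Odd (suc (length ms)) →
      Σ (OddCycle Γ) λ c → ∀ i → OddCycle.vert c i Mem.∈ (y ∷ ms)
    go (suc fuel) {y} {ms} ms<fuel w odd with Unique-or-duplicate Fin._≟_ (y ∷ ms)
    ... | inj₁ u = closedPath⇒OddCycle w u odd , MemP.∈-lookup
    ... | inj₂ (as , z , bs , cs , y∷ms≡) with split-closed-walk w as z bs cs y∷ms≡
    ... | _ , _ , ℓ₁+ℓ₂ , (_ , ms₁ , w₁ , refl , ⊆₁) , (_ , ms₂ , w₂ , refl , ⊆₂)
      with Odd-+ (suc (length ms₁)) (suc (length ms₂)) (subst Odd (sym ℓ₁+ℓ₂) odd)
    ... | inj₁ odd₁ = let (c , c⊆) = go fuel (part< _ _ _ _ ℓ₁+ℓ₂ ms<fuel) w₁ odd₁ in c , λ i → ⊆₁ (c⊆ i)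
    ... | inj₂ odd₂ = let (c , c⊆) = go fuel (part< _ _ _ _ (trans (ℕP.+-comm (suc (length ms₂)) _) ℓ₁+ℓ₂) ms<fuel) w₂ odd₂
                      in c , λ i → ⊆₂ (c⊆ i)

  steps : ∀ {u v} → Reach Γ u v → ℕ
  steps here       = 0
  steps (step _ p) = suc (steps p)

  steps-trans : ∀ {u v w} (p : Reach Γ u v) (q : Reach Γ v w) → steps (Reach-trans Γ p q) ≡ steps p + steps q
  steps-trans here       q = refl
  steps-trans (step _ p) q = cong suc (steps-trans p q)

  steps-sym : ∀ {u v} (p : Reach Γ u v) → steps (Reach-sym Γ p) ≡ steps p
  steps-sym here       = refl
  steps-sym (step e p) = trans (steps-trans (Reach-sym Γ p) _)
    (trans (cong (_+ 1) (steps-sym p)) (ℕP.+-comm (steps p) 1))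

  Reach⇒Walk : ∀ {u x v} → _∼_ Γ u x → (p : Reach Γ x v) → ∃ λ xs → Walk u xs v × length xs ≡ steps p
  Reach⇒Walk e here       = [] , [ e ]ʷ , refl
  Reach⇒Walk e (step e′ p) = let (xs , w , len≡) = Reach⇒Walk e′ p in _ ∷ xs , e ∷ʷ w , cong suc len≡

  odd-closed-Reach⇒ComponentHasOddCycle : ∀ {r} (q : Reach Γ r r) → Odd (steps q) → ComponentHasOddCycle Γ r
  odd-closed-Reach⇒ComponentHasOddCycle here (_ , ())
  odd-closed-Reach⇒ComponentHasOddCycle (step e p) odd =
    let (xs , w , len≡) = Reach⇒Walk e p in
    let (c , c⊆) = odd-closed-walk⇒OddCycle w (subst Odd (cong suc (sym len≡)) odd) in
    c , λ i → Walk-∈⇒Reach w (c⊆ i)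

  ProperColouring : Fin n → (Fin n → Parity) → Set
  ProperColouring r col = ∀ u w → Reach Γ r u → _∼_ Γ u w → col u ≢ col w

  data OddCycleOrColouring (r : Fin n) : Set where
    oddCycle  : ComponentHasOddCycle Γ r → OddCycleOrColouring r
    colouring : (col : Fin n → Parity) → ProperColouring r col → OddCycleOrColouring r

  colour : Fin n → Fin n → Parity
  colour r w with Reach? Γ r w
  ... | yes p = parity (steps p)
  ... | no  _ = 0ℙ

  colour-walk : ∀ {r w} → Reach Γ r w → Σ (Reach Γ r w) λ p → colour r w ≡ parity (steps p)
  colour-walk {r} {w} p₀ with Reach? Γ r w
  ... | yes p = p , refl
  ... | no ¬p = ⊥-elim (¬p p₀)

  same-colour⇒ComponentHasOddCycle : ∀ {r u w} → Reach Γ r u → _∼_ Γ u w → colour r u ≡ colour r w →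
    ComponentHasOddCycle Γ r
  same-colour⇒ComponentHasOddCycle {r} {u} {w} r⇝u e same
    with colour-walk r⇝u | colour-walk (Reach-∷ʳ Γ r⇝u e)
  ... | pu , cu | pw , cw = odd-closed-Reach⇒ComponentHasOddCycle (Reach-trans Γ pu (step e (Reach-sym Γ pw)))
    (parity≡1ℙ⇒Odd _ (begin
      parity (steps (Reach-trans Γ pu (step e (Reach-sym Γ pw)))) ≡⟨ cong parity (steps-trans pu _) ⟩
      parity (steps pu + suc (steps (Reach-sym Γ pw)))            ≡⟨ cong (λ m → parity (steps pu + suc m)) (steps-sym pw) ⟩
      parity (steps pu + suc (steps pw))                          ≡⟨ ℙP.+-homo-+ (steps pu) _ ⟩
      parity (steps pu) ℙ.+ parity (suc (steps pw))               ≡⟨ cong (parity (steps pu) ℙ.+_) (parity-suc (steps pw)) ⟩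
      parity (steps pu) ℙ.+ parity (steps pw) ⁻¹                  ≡⟨ cong (λ p → p ℙ.+ parity (steps pw) ⁻¹) (trans (sym cu) (trans same cw)) ⟩
      parity (steps pw) ℙ.+ parity (steps pw) ⁻¹                  ≡⟨ ℙP.p+p⁻¹≡1ℙ (parity (steps pw)) ⟩
      1ℙ                                                          ∎))
    where open ≡-Reasoning

  oddCycle-or-colouring : ∀ r → OddCycleOrColouring r
  oddCycle-or-colouring r with FinP.any? (λ u → FinP.any? (λ w →
    Reach? Γ r u ×-dec (_∼?_ Γ u w) ×-dec (colour r u ℙP.≟ colour r w)))
  ... | yes (u , w , r⇝u , e , same) = oddCycle (same-colour⇒ComponentHasOddCycle r⇝u e same)
  ... | no ¬same = colouring (colour r) (λ u w r⇝u e same → ¬same (u , w , r⇝u , e , same))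

  ProperColouring⇒¬ComponentHasOddCycle : ∀ {r col} → ProperColouring r col → ¬ ComponentHasOddCycle Γ r
  ProperColouring⇒¬ComponentHasOddCycle {r} {col} proper (c , r⇝c) =
    ℙP.p≢p⁻¹ c₀ (begin
      c₀                                      ≡⟨ cong (col ∘ vert) (sym (next^-period Fin.zero)) ⟩
      col (vert (next^ (suc len) Fin.zero))   ≡⟨ colour-along (suc len) ⟩
      c₀ ℙ.+ parity (suc len)                 ≡⟨ cong (c₀ ℙ.+_) (Odd⇒parity≡1ℙ odd) ⟩
      c₀ ℙ.+ 1ℙ                               ≡⟨ +1ℙ c₀ ⟩
      c₀ ⁻¹                                   ∎)
    where
    open OddCycle c
    open ≡-Reasoning
    c₀ = col (vert Fin.zero)
    +1ℙ : ∀ p → p ℙ.+ 1ℙ ≡ p ⁻¹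
    +1ℙ 0ℙ = refl
    +1ℙ 1ℙ = refl
    colour-along : ∀ k → col (vert (next^ k Fin.zero)) ≡ c₀ ℙ.+ parity k
    colour-along zero    = sym (ℙP.+-identityʳ c₀)
    colour-along (suc k) = begin
      col (vert (next (next^ k Fin.zero))) ≡⟨ ≢⇒≡⁻¹ (proper _ _ (r⇝c _) (edges _)) ⟩
      col (vert (next^ k Fin.zero)) ⁻¹     ≡⟨ cong _⁻¹ (colour-along k) ⟩
      (c₀ ℙ.+ parity k) ⁻¹                 ≡⟨ ⁻¹-distribʳ-+ c₀ (parity k) ⟩
      c₀ ℙ.+ parity k ⁻¹                   ≡⟨ cong (c₀ ℙ.+_) (sym (parity-suc k)) ⟩
      c₀ ℙ.+ parity (suc k)                ∎

module _ {n : ℕ} (Γ : Graph n) where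

  OddFreeComponentReps-≡ : ∀ {v w} → IsOddFreeComponentRep Γ v → IsOddFreeComponentRep Γ w → Reach Γ v w → v ≡ w
  OddFreeComponentReps-≡ {v} {w} (v-min , _) (w-min , _) p =
    FinP.toℕ-injective (ℕP.≤-antisym (v-min w p) (w-min v (Reach-sym Γ p)))

  -- Distinct representatives lie in distinct components, so witnesses chosen in their components are distinct.
  ∣S∣≤count : (S : Subset n) → (∀ v → (v ∈ S) ⇔ IsOddFreeComponentRep Γ v) → (Q : Fin n → Bool) →
    (∀ v → IsOddFreeComponentRep Γ v → ∃ λ w → Reach Γ v w × T (Q w)) → ∣ S ∣ ≤ count Q
  ∣S∣≤count S S-reps Q witness = subst (_≤ count Q) (sym (∣S∣≡count S))
    (count-mono-injection (Vec.lookup S) Q w (λ v p → proj₂ (proj₂ (witness v (rep p))))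
      (λ p p′ w≡w′ → OddFreeComponentReps-≡ (rep p) (rep p′)
        (Reach-trans Γ (v⇝w p) (subst (λ x → Reach Γ x _) (sym w≡w′) (Reach-sym Γ (v⇝w p′))))))
    where
    rep : ∀ {v} → T (Vec.lookup S v) → IsOddFreeComponentRep Γ v
    rep {v} t = Equivalence.to (S-reps v) (Equivalence.from (∈⇔T-lookup S v) t)
    w : ∀ v → T (Vec.lookup S v) → Fin n
    w v t = proj₁ (witness v (rep t))
    v⇝w : ∀ {v} (t : T (Vec.lookup S v)) → Reach Γ v (w v t)
    v⇝w {v} t = proj₁ (proj₂ (witness v (rep t)))

-- Iterating animations: deg α ≤ n − d

module _ {n : ℕ} (α : Fin n → Maybe (Fin n)) where

  iter-+ : ∀ l k v → iter α (l + k) v ≡ (iter α k v >>= iter α l)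
  iter-+ zero    k v with iter α k v
  ... | just _  = refl
  ... | nothing = refl
  iter-+ (suc l) k v = trans (cong (_>>= α) (iter-+ l k v)) (bind-assoc (iter α k v))
    where
    bind-assoc : (m : Maybe (Fin n)) → ((m >>= iter α l) >>= α) ≡ (m >>= λ x → iter α l x >>= α)
    bind-assoc (just _) = refl
    bind-assoc nothing  = refl

  iter-from : ∀ l k v {w} → iter α k v ≡ just w → iter α (l + k) v ≡ iter α l w
  iter-from l k v eq = trans (iter-+ l k v) (cong (_>>= iter α l) eq)

  iter-stuck : ∀ l k v → iter α k v ≡ nothing → iter α (l + k) v ≡ nothing
  iter-stuck l k v eq = trans (iter-+ l k v) (cong (_>>= iter α l) eq)

  iterate : Fin n → ℕ → Fin n
  iterate v k = fromMaybe v (iter α k v)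

  iter-defined-below : ∀ {m v w} → iter α m v ≡ just w → ∀ k → k ≤ m → iter α k v ≡ just (iterate v k)
  iter-defined-below {m} {v} defined k k≤m with iter α k v in eq
  ... | just _  = refl
  ... | nothing with () ← trans (sym defined)
                            (subst (λ j → iter α j v ≡ nothing) (ℕP.m∸n+n≡m k≤m) (iter-stuck (m ∸ k) k v eq))

  periodic⇒IsPeriodOf : ∀ {p u} → 1 ≤ p → iter α p u ≡ just u → ∃ λ m → IsPeriodOf α u m
  periodic⇒IsPeriodOf {p} {u} 1≤p returns with least-ℕ Returns Returns? p (1≤p , returns)
    where
    Returns : ℕ → Set
    Returns m = 1 ≤ m × iter α m u ≡ just u
    Returns? : ∀ m → Dec (Returns m)
    Returns? m = (1 ℕ.≤? m) ×-dec ≡-dec FinP._≟_ (iter α m u) (just u)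
  ... | m , (1≤m , returns-m) , m-least = m , 1≤m , returns-m , λ k 1≤k k<m eq → m-least k k<m (1≤k , eq)

module _ {n : ℕ} (Γ : Graph n) {α : Fin n → Maybe (Fin n)} (anim : IsAnimation Γ α) where

  iter⇒Reach : ∀ k v {w} → iter α k v ≡ just w → Reach Γ v w
  iter⇒Reach zero    v refl = here
  iter⇒Reach (suc k) v {w} eq with iter α k v in eq′
  ... | just w′ = Reach-∷ʳ Γ (iter⇒Reach k v eq′) (∼-sym Γ (anim w′ w eq))

  module PeriodicOrbit (u : Fin n) (len : ℕ) (period : IsPeriodOf α u (suc len)) where

    private
      m = suc len
      returns : iter α m u ≡ just u
      returns = proj₁ (proj₂ period)
      minimal : ∀ k → 1 ≤ k → k < m → iter α k u ≢ just u
      minimal = proj₂ (proj₂ period)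

    orbit : ℕ → Fin n
    orbit = iterate α u

    iter≡orbit : ∀ k → k ≤ m → iter α k u ≡ just (orbit k)
    iter≡orbit = iter-defined-below α returns

    orbit-step : ∀ k → k < m → _∼_ Γ (orbit k) (orbit (suc k))
    orbit-step k k<m = ∼-sym Γ (anim _ _ (trans (cong (_>>= α) (sym (iter≡orbit k (ℕP.<⇒≤ k<m)))) (iter≡orbit (suc k) k<m)))

    orbit-injective : ∀ a b → a < b → b < m → orbit a ≢ orbit b
    orbit-injective a b a<b b<m orbit-a≡b = minimal (m ∸ b + a) 1≤ shift<m (begin
      iter α (m ∸ b + a) u  ≡⟨ iter-from α (m ∸ b) a u (iter≡orbit a (ℕP.<⇒≤ (ℕP.<-trans a<b b<m))) ⟩
      iter α (m ∸ b) (orbit a) ≡⟨ cong (iter α (m ∸ b)) orbit-a≡b ⟩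
      iter α (m ∸ b) (orbit b) ≡⟨ sym (iter-from α (m ∸ b) b u (iter≡orbit b (ℕP.<⇒≤ b<m))) ⟩
      iter α (m ∸ b + b) u  ≡⟨ cong (λ j → iter α j u) (ℕP.m∸n+n≡m (ℕP.<⇒≤ b<m)) ⟩
      iter α m u            ≡⟨ returns ⟩
      just u                ∎)
      where
      open ≡-Reasoning
      1≤ : 1 ≤ m ∸ b + a
      1≤ = ℕP.≤-trans (ℕP.m<n⇒0<n∸m b<m) (ℕP.m≤m+n (m ∸ b) a)
      shift<m : m ∸ b + a < m
      shift<m = subst (m ∸ b + a <_) (ℕP.m∸n+n≡m (ℕP.<⇒≤ b<m)) (ℕP.+-monoʳ-< (m ∸ b) a<b)

    vert : Fin m → Fin n
    vert i = orbit (toℕ i)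

    vert-injective : Injective _≡_ _≡_ vert
    vert-injective {i} {j} eq with ℕP.<-cmp (toℕ i) (toℕ j)
    ... | tri< i<j _ _ = ⊥-elim (orbit-injective _ _ i<j (FinP.toℕ<n j) eq)
    ... | tri≈ _ i≡j _ = FinP.toℕ-injective i≡j
    ... | tri> _ _ j<i = ⊥-elim (orbit-injective _ _ j<i (FinP.toℕ<n i) (sym eq))

    vert-edges : ∀ i → _∼_ Γ (vert i) (vert (next i))
    vert-edges i = from-decision (toℕ i ℕ.<? len)
      where
      from-decision : Dec (toℕ i < len) → _∼_ Γ (vert i) (vert (next i))
      from-decision (yes i<len) = subst (λ k → _∼_ Γ (vert i) (orbit k)) (sym (next-< i i<len))
                                        (orbit-step (toℕ i) (FinP.toℕ<n i))
      from-decision (no  i≮len) = subst (_∼_ Γ (vert i)) (orbit-m≡u (next-≮ i i≮len))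
                                        (subst (λ k → _∼_ Γ (vert i) (orbit (suc k))) (≮⇒toℕ≡ i i≮len)
                                               (orbit-step (toℕ i) (FinP.toℕ<n i)))
        where
        orbit-m≡u : next i ≡ Fin.zero → orbit m ≡ vert (next i)
        orbit-m≡u next≡0 = trans (just-injective (trans (sym (iter≡orbit m ℕP.≤-refl)) returns))
                                 (cong vert (sym next≡0))

    cycle : Odd m → OddCycle Γ
    cycle odd = record { len = len ; odd = odd ; vert = vert ; inj = vert-injective ; edges = vert-edges }

    Reach-cycle : (odd : Odd m) → ∀ i → Reach Γ u (OddCycle.vert (cycle odd) i)
    Reach-cycle odd i = iter⇒Reach (toℕ i) u (iter≡orbit (toℕ i) (ℕP.<⇒≤ (FinP.toℕ<n i)))

  periodic⇒ComponentHasOddCycle : AllPeriodsOdd α → ∀ {u m} → IsPeriodOf α u m → ComponentHasOddCycle Γ u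
  periodic⇒ComponentHasOddCycle odd {u} {suc len} period =
    cycle (odd u _ period) , Reach-cycle (odd u _ period)
    where open PeriodicOrbit u len period

  escape-or-defined : ∀ v k → (∃ λ z → Reach Γ v z × α z ≡ nothing) ⊎ (∃ λ w → iter α k v ≡ just w)
  escape-or-defined v zero = inj₂ (v , refl)
  escape-or-defined v (suc k) with escape-or-defined v k
  ... | inj₁ escape = inj₁ escape
  ... | inj₂ (w , eq) with α w in αw
  ...   | nothing = inj₁ (w , iter⇒Reach k v eq , αw)
  ...   | just w′ = inj₂ (w′ , trans (cong (_>>= α) eq) αw)

  -- Otherwise the first n + 1 iterates repeat a vertex, which is then periodic with odd period.
  odd-free-component-escapes : AllPeriodsOdd α → ∀ v → ¬ ComponentHasOddCycle Γ v →
    ∃ λ z → Reach Γ v z × α z ≡ nothing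
  odd-free-component-escapes odd v no-odd-cycle with escape-or-defined v n
  ... | inj₁ escape = escape
  ... | inj₂ (_ , defined) with FinP.pigeonhole (ℕP.n<1+n n) (λ i → iterate α v (toℕ i))
  ... | i , j , i<j , same = ⊥-elim (no-odd-cycle (ComponentHasOddCycle-Reach Γ (iter⇒Reach (toℕ i) v (def i))
          (periodic⇒ComponentHasOddCycle odd (proj₂ (periodic⇒IsPeriodOf α (ℕP.m<n⇒0<n∸m i<j) returns)))))
    where
    def : ∀ i → iter α (toℕ i) v ≡ just (iterate α v (toℕ i))
    def i = iter-defined-below α defined (toℕ i) (FinP.toℕ≤pred[n] i)
    returns : iter α (toℕ j ∸ toℕ i) (iterate α v (toℕ i)) ≡ just (iterate α v (toℕ i))
    returns = begin
      iter α (toℕ j ∸ toℕ i) (iterate α v (toℕ i)) ≡⟨ sym (iter-from α (toℕ j ∸ toℕ i) (toℕ i) v (def i)) ⟩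
      iter α (toℕ j ∸ toℕ i + toℕ i) v            ≡⟨ cong (λ k → iter α k v) (ℕP.m∸n+n≡m (ℕP.<⇒≤ i<j)) ⟩
      iter α (toℕ j) v                            ≡⟨ def j ⟩
      just (iterate α v (toℕ j))                  ≡⟨ cong just (sym same) ⟩
      just (iterate α v (toℕ i))                  ∎
      where open ≡-Reasoning

  degree≤n∸∣S∣ : AllPeriodsOdd α → (S : Subset n) → (∀ v → (v ∈ S) ⇔ IsOddFreeComponentRep Γ v) →
    degree α ≤ n ∸ ∣ S ∣
  degree≤n∸∣S∣ odd S S-reps = ℕP.m+n≤o⇒m≤o∸n (degree α) (subst (degree α + ∣ S ∣ ≤_) (count-complement (is-just ∘ α))
    (ℕP.+-monoʳ-≤ (degree α) (∣S∣≤count Γ S S-reps (not ∘ is-just ∘ α) undefined-in-component)))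
    where
    undefined-in-component : ∀ v → IsOddFreeComponentRep Γ v → ∃ λ w → Reach Γ v w × T (not (is-just (α w)))
    undefined-in-component v (_ , no-odd-cycle) with odd-free-component-escapes odd v no-odd-cycle
    ... | z , v⇝z , αz≡nothing = z , v⇝z , subst (λ m → T (not (is-just m))) (sym αz≡nothing) tt

¬OddNonempty-n∸∣S∣+1 : {n : ℕ} (Γ : Graph n) (S : Subset n) → (∀ v → (v ∈ S) ⇔ IsOddFreeComponentRep Γ v) →
  ¬ OddNonempty Γ ((n ∸ ∣ S ∣) + 1)
¬OddNonempty-n∸∣S∣+1 Γ S S-reps (α , anim , deg , odd) = ℕP.<-irrefl refl
  (subst (_≤ _) (trans deg (ℕP.+-comm _ 1)) (degree≤n∸∣S∣ Γ anim odd S S-reps))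

-- An animation of degree n − d all of whose periods are odd

module Descent {n : ℕ} (Γ : Graph n) (R : Fin n → Set) (R? : ∀ v → Dec (R v)) where

  NearWithin : ℕ → Fin n → Set
  NearWithin k v = ∃ λ t → R t × ReachWithin Γ k v t

  NearWithin? : ∀ k v → Dec (NearWithin k v)
  NearWithin? k v = FinP.any? (λ t → R? t ×-dec ReachWithin? Γ k v t)

  Reach⇒NearWithin : ∀ {v t} → R t → Reach Γ v t → NearWithin n v
  Reach⇒NearWithin rt p = _ , rt , Reach⇒ReachWithin-n Γ p

  -- dist v is one more than the distance from v to R (and 0 when R is out of reach).
  dist : Fin n → ℕ
  dist v with NearWithin? n v
  ... | yes near = proj₁ (least-ℕ (λ k → NearWithin k v) (λ k → NearWithin? k v) n near)
  ... | no  _    = 0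

  dist-spec : ∀ v → NearWithin n v → NearWithin (dist v) v × (∀ k → NearWithin k v → dist v ≤ k)
  dist-spec v near with NearWithin? n v
  ... | no ¬near = ⊥-elim (¬near near)
  ... | yes near′ with least-ℕ (λ k → NearWithin k v) (λ k → NearWithin? k v) n near′
  ... | _ , near-d , d-least = near-d , λ k near-k → ℕP.≮⇒≥ (λ k<d → d-least k k<d near-k)

  dist≤n : ∀ v → dist v ≤ n
  dist≤n v with NearWithin? n v
  ... | no  _    = z≤n
  ... | yes near with least-ℕ (λ k → NearWithin k v) (λ k → NearWithin? k v) n near
  ... | _ , _ , d-least = ℕP.≮⇒≥ (λ n<d → d-least n n<d near)

  NearWithin-mono : ∀ {k k′ v} → k ≤ k′ → NearWithin k v → NearWithin k′ v
  NearWithin-mono k≤k′ (t , rt , r) = t , rt , ReachWithin-mono Γ k≤k′ r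

  private
    descend : ∀ d v → NearWithin d v → ¬ R v → Σ (Fin n) λ w → _∼_ Γ v w × ∃ λ d′ → d ≡ suc d′ × NearWithin d′ w
    descend (suc d) v (t , rt , inj₁ refl)        ¬rv = ⊥-elim (¬rv rt)
    descend (suc d) v (t , rt , inj₂ (w , e , r)) ¬rv = w , e , d , refl , (t , rt , r)

    closer : (v : Fin n) → ¬ R v → NearWithin n v → Fin n
    closer v ¬rv near = proj₁ (descend (dist v) v (proj₁ (dist-spec v near)) ¬rv)

    closer-∼ : ∀ v ¬rv near → _∼_ Γ v (closer v ¬rv near)
    closer-∼ v ¬rv near = proj₁ (proj₂ (descend (dist v) v (proj₁ (dist-spec v near)) ¬rv))

    closer-dist : ∀ v ¬rv near → dist (closer v ¬rv near) < dist v
    closer-dist v ¬rv near with descend (dist v) v (proj₁ (dist-spec v near)) ¬rv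
    ... | w , _ , d′ , d≡1+d′ , near-w = subst (dist w <_) (sym d≡1+d′)
      (s≤s (proj₂ (dist-spec w (NearWithin-mono d′≤n near-w)) d′ near-w))
      where
      d′≤n : d′ ≤ n
      d′≤n = ℕP.≤-trans (ℕP.n≤1+n d′) (subst (_≤ n) d≡1+d′ (dist≤n v))

    towardᵈ : (v : Fin n) → ¬ R v → Dec (NearWithin n v) → Fin n
    towardᵈ v ¬rv (yes near) = closer v ¬rv near
    towardᵈ v ¬rv (no  _)    = v

  -- When R is out of reach, toward v returns the junk value v.
  toward : (v : Fin n) → ¬ R v → Fin n
  toward v ¬rv = towardᵈ v ¬rv (NearWithin? n v)

  toward-∼ : ∀ {v t} → R t → Reach Γ v t → (¬rv : ¬ R v) → _∼_ Γ v (toward v ¬rv)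
  toward-∼ {v} rt v⇝t ¬rv = go (NearWithin? n v)
    where
    go : (d : Dec (NearWithin n v)) → _∼_ Γ v (towardᵈ v ¬rv d)
    go (yes near) = closer-∼ v ¬rv near
    go (no  far)  = ⊥-elim (far (Reach⇒NearWithin rt v⇝t))

  toward-dist : ∀ {v t} → R t → Reach Γ v t → (¬rv : ¬ R v) → dist (toward v ¬rv) < dist v
  toward-dist {v} rt v⇝t ¬rv = go (NearWithin? n v)
    where
    go : (d : Dec (NearWithin n v)) → dist (towardᵈ v ¬rv d) < dist v
    go (yes near) = closer-dist v ¬rv near
    go (no  far)  = ⊥-elim (far (Reach⇒NearWithin rt v⇝t))

OnCycle : {n : ℕ} {Γ : Graph n} → OddCycle Γ → Fin n → Set
OnCycle c v = ∃ λ i → OddCycle.vert c i ≡ v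

OnCycle? : {n : ℕ} {Γ : Graph n} (c : OddCycle Γ) → ∀ v → Dec (OnCycle c v)
OnCycle? c v = FinP.any? (λ i → OddCycle.vert c i Fin.≟ v)

data Class : Set where
  rep tree cycle : Class

-- Every vertex outside the roots of odd-free components is sent to a neighbour: along the chosen
-- odd cycle of its component, or one step closer to that cycle, resp. to the root.
module SpanningMap {n : ℕ} (Γ : Graph n) where

  kind : ∀ r → OddCycleOrColouring Γ r
  kind = oddCycle-or-colouring Γ

  module ToRoot (r : Fin n) = Descent Γ (_≡ r) (Fin._≟ r)
  module ToCycle (c : OddCycle Γ) = Descent Γ (OnCycle c) (OnCycle? c)

  classᴷ : ∀ r → OddCycleOrColouring Γ r → Fin n → Class
  classᴷ r (colouring _ _) v with v Fin.≟ r
  ... | yes _ = rep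
  ... | no  _ = tree
  classᴷ r (oddCycle (c , _)) v with OnCycle? c v
  ... | yes _ = cycle
  ... | no  _ = tree

  βᴷ : ∀ r → OddCycleOrColouring Γ r → Fin n → Fin n
  βᴷ r (colouring _ _) v with v Fin.≟ r
  ... | yes _   = v
  ... | no  v≢r = ToRoot.toward r v v≢r
  βᴷ r (oddCycle (c , _)) v with OnCycle? c v
  ... | yes (i , _) = OddCycle.vert c (next i)
  ... | no  v∉c     = ToCycle.toward c v v∉c

  potᴷ : ∀ r → OddCycleOrColouring Γ r → Fin n → ℕ
  potᴷ r (colouring _ _)     = ToRoot.dist r
  potᴷ r (oddCycle (c , _)) = ToCycle.dist c

  class : Fin n → Class
  class v = classᴷ (root Γ v) (kind (root Γ v)) v

  β : Fin n → Fin n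
  β v = βᴷ (root Γ v) (kind (root Γ v)) v

  pot : Fin n → ℕ
  pot v = potᴷ (root Γ v) (kind (root Γ v)) v

  pot≤n : ∀ v → pot v ≤ n
  pot≤n v with kind (root Γ v)
  ... | colouring _ _     = ToRoot.dist≤n (root Γ v) v
  ... | oddCycle (c , _) = ToCycle.dist≤n c v

  private
    at-root : ∀ {A : Set} (f : ∀ r → OddCycleOrColouring Γ r → Fin n → A) {r v} →
      root Γ v ≡ r → f (root Γ v) (kind (root Γ v)) v ≡ f r (kind r) v
    at-root f {v = v} root≡r = cong (λ x → f x (kind x) v) root≡r

  treeᴷ : ∀ r K v → Reach Γ v r → classᴷ r K v ≡ tree →
    _∼_ Γ v (βᴷ r K v) × potᴷ r K (βᴷ r K v) < potᴷ r K v
  treeᴷ r (colouring _ _) v v⇝r class≡ with v Fin.≟ r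
  ... | yes _   with () ← class≡
  ... | no  v≢r = ToRoot.toward-∼ r refl v⇝r v≢r , ToRoot.toward-dist r refl v⇝r v≢r
  treeᴷ r (oddCycle (c , r⇝c)) v v⇝r class≡ with OnCycle? c v
  ... | yes _   with () ← class≡
  ... | no  v∉c = ToCycle.toward-∼ c c₀ v⇝c₀ v∉c , ToCycle.toward-dist c c₀ v⇝c₀ v∉c
    where
    c₀ : OnCycle c (OddCycle.vert c Fin.zero)
    c₀ = Fin.zero , refl
    v⇝c₀ : Reach Γ v (OddCycle.vert c Fin.zero)
    v⇝c₀ = Reach-trans Γ v⇝r (r⇝c Fin.zero)

  tree-∼β : ∀ v → class v ≡ tree → _∼_ Γ v (β v)
  tree-∼β v class≡ = proj₁ (treeᴷ (root Γ v) (kind (root Γ v)) v (Reach-root Γ v) class≡)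

  tree-pot : ∀ v → class v ≡ tree → pot (β v) < pot v
  tree-pot v class≡ = subst (_< pot v) (sym (at-root potᴷ (sym (Reach⇒root≡ Γ (∼⇒Reach Γ (tree-∼β v class≡))))))
    (proj₂ (treeᴷ (root Γ v) (kind (root Γ v)) v (Reach-root Γ v) class≡))

  on-cycle : ∀ {r c r⇝c} → root Γ r ≡ r → kind r ≡ oddCycle (c , r⇝c) → ∀ i →
    let open OddCycle c in root Γ (vert i) ≡ r × class (vert i) ≡ cycle × β (vert i) ≡ vert (next i)
  on-cycle {r} {c} {r⇝c} root≡r kind≡ i =
    root≡ , trans (at-root classᴷ root≡) (trans (cong (λ K → classᴷ r K (vert i)) kind≡) class-vert) ,
            trans (at-root βᴷ root≡) (trans (cong (λ K → βᴷ r K (vert i)) kind≡) β-vert)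
    where
    open OddCycle c
    root≡ : root Γ (vert i) ≡ r
    root≡ = trans (sym (Reach⇒root≡ Γ (r⇝c i))) root≡r
    class-vert : classᴷ r (oddCycle (c , r⇝c)) (vert i) ≡ cycle
    class-vert with OnCycle? c (vert i)
    ... | yes _ = refl
    ... | no  ∉ = ⊥-elim (∉ (i , refl))
    β-vert : βᴷ r (oddCycle (c , r⇝c)) (vert i) ≡ vert (next i)
    β-vert with OnCycle? c (vert i)
    ... | yes (j , vert-j≡) = cong (vert ∘ next) (inj vert-j≡)
    ... | no  ∉             = ⊥-elim (∉ (i , refl))

  CycleThrough : Fin n → Set
  CycleThrough v = Σ (OddCycle Γ) λ c → Σ (∀ i → Reach Γ (root Γ v) (OddCycle.vert c i)) λ r⇝c →
    kind (root Γ v) ≡ oddCycle (c , r⇝c) × OnCycle c v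

  cycle⇒CycleThrough : ∀ v → class v ≡ cycle → CycleThrough v
  cycle⇒CycleThrough v class≡ with kind (root Γ v)
  ... | colouring _ _ with v Fin.≟ root Γ v
  ...   | yes _ with () ← class≡
  ...   | no  _ with () ← class≡
  cycle⇒CycleThrough v class≡ | oddCycle (c , r⇝c) with OnCycle? c v
  ...   | yes v∈c = c , r⇝c , refl , v∈c
  ...   | no  _ with () ← class≡

  cycle-β : ∀ v → class v ≡ cycle → class (β v) ≡ cycle × _∼_ Γ v (β v)
  cycle-β v class≡ with cycle⇒CycleThrough v class≡
  ... | c , r⇝c , kind≡ , i , refl =
    let (_ , _ , β≡) = on-cycle (root-idem Γ (vert i)) kind≡ i in
    let (_ , class-next , _) = on-cycle (root-idem Γ (vert i)) kind≡ (next i) in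
    subst (λ w → class w ≡ cycle) (sym β≡) class-next , subst (_∼_ Γ (vert i)) (sym β≡) (edges i)
    where open OddCycle c

  rep⇔IsOddFreeComponentRep : ∀ v → class v ≡ rep ⇔ IsOddFreeComponentRep Γ v
  rep⇔IsOddFreeComponentRep v = mk⇔ to from
    where
    to : class v ≡ rep → IsOddFreeComponentRep Γ v
    to class≡ with kind (root Γ v)
    ... | oddCycle (c , _) with OnCycle? c v
    ...   | yes _ with () ← class≡
    ...   | no  _ with () ← class≡
    to class≡ | colouring col proper with v Fin.≟ root Γ v
    ...   | no  _ with () ← class≡
    ...   | yes v≡root = root≡⇒Minimal Γ (sym v≡root) ,
                         λ odd → ProperColouring⇒¬ComponentHasOddCycle Γ proper
                                   (ComponentHasOddCycle-Reach Γ (Reach-sym Γ (Reach-root Γ v)) odd)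
    from : IsOddFreeComponentRep Γ v → class v ≡ rep
    from (v-min , no-odd) with kind (root Γ v)
    ... | oddCycle odd = ⊥-elim (no-odd (ComponentHasOddCycle-Reach Γ (Reach-root Γ v) odd))
    ... | colouring _ _ with v Fin.≟ root Γ v
    ...   | yes _     = refl
    ...   | no  v≢root = ⊥-elim (v≢root (sym (Minimal⇒root≡ Γ v-min)))

  ∼β : ∀ v → class v ≢ rep → _∼_ Γ v (β v)
  ∼β v class≢rep with class v in class≡
  ... | rep   = ⊥-elim (class≢rep refl)
  ... | tree  = tree-∼β v class≡
  ... | cycle = proj₂ (cycle-β v class≡)

module SpanningAnimation {n : ℕ} (Γ : Graph n) where
  open SpanningMap Γ

  animate : Class → Fin n → Maybe (Fin n)
  animate rep   _ = nothing
  animate tree  w = just w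
  animate cycle w = just w

  α : Fin n → Maybe (Fin n)
  α v = animate (class v) (β v)

  α≡just : ∀ {v w} → α v ≡ just w → class v ≢ rep × β v ≡ w
  α≡just {v} eq with class v
  ... | tree  = (λ ()) , just-injective eq
  ... | cycle = (λ ()) , just-injective eq

  α-animation : IsAnimation Γ α
  α-animation v w eq with α≡just eq
  ... | class≢rep , refl = ∼-sym Γ (∼β v class≢rep)

  degree-α : (S : Subset n) → (∀ v → (v ∈ S) ⇔ IsOddFreeComponentRep Γ v) → degree α ≡ n ∸ ∣ S ∣
  degree-α S S-reps = begin
    count (is-just ∘ α)             ≡⟨ count-cong is-just-α ⟩
    count (not ∘ Vec.lookup S)      ≡⟨ sym (ℕP.m+n∸m≡n (count (Vec.lookup S)) _) ⟩
    count (Vec.lookup S) + count (not ∘ Vec.lookup S) ∸ count (Vec.lookup S)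
                                    ≡⟨ cong₂ _∸_ (count-complement (Vec.lookup S)) (sym (∣S∣≡count S)) ⟩
    n ∸ ∣ S ∣                       ∎
    where
    open ≡-Reasoning
    rep⇔∈S : ∀ v → class v ≡ rep ⇔ T (Vec.lookup S v)
    rep⇔∈S v = ⇔.trans (rep⇔IsOddFreeComponentRep v) (⇔.trans (⇔.sym (S-reps v)) (∈⇔T-lookup S v))
    is-just-α : ∀ v → is-just (α v) ≡ not (Vec.lookup S v)
    is-just-α v with class v in class≡ | Vec.lookup S v in ∈S
    ... | rep   | true  = refl
    ... | rep   | false = ⊥-elim (subst T ∈S (Equivalence.to (rep⇔∈S v) class≡))
    ... | tree  | false = refl
    ... | tree  | true  with () ← trans (sym class≡) (Equivalence.from (rep⇔∈S v) (Equivalence.from T-≡ ∈S))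
    ... | cycle | false = refl
    ... | cycle | true  with () ← trans (sym class≡) (Equivalence.from (rep⇔∈S v) (Equivalence.from T-≡ ∈S))

  -- Along an orbit the potential drops at every tree vertex, and cycle vertices are mapped to cycle vertices.
  orbit-descends : ∀ u k {w} → iter α k u ≡ just w → class w ≡ cycle ⊎ pot w + k ≤ pot u
  orbit-descends u zero    refl = inj₂ (ℕP.≤-reflexive (ℕP.+-identityʳ (pot u)))
  orbit-descends u (suc k) {w} eq with iter α k u in eq₀
  ... | just w₀ with α≡just eq | orbit-descends u k eq₀
  ...   | class≢rep , refl | inj₁ on-cycle = inj₁ (proj₁ (cycle-β w₀ on-cycle))
  ...   | class≢rep , refl | inj₂ pot≤ with class w₀ in class≡
  ...     | rep   = ⊥-elim (class≢rep refl)
  ...     | cycle = inj₁ (proj₁ (cycle-β w₀ class≡))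
  ...     | tree  = inj₂ (begin
    pot (β w₀) + suc k ≡⟨ ℕP.+-suc (pot (β w₀)) k ⟩
    suc (pot (β w₀) + k) ≤⟨ ℕP.+-monoˡ-≤ k (tree-pot w₀ class≡) ⟩
    pot w₀ + k          ≤⟨ pot≤ ⟩
    pot u               ∎)
    where open ℕP.≤-Reasoning

  periodic⇒cycle : ∀ {u m} → IsPeriodOf α u m → class u ≡ cycle
  periodic⇒cycle {u} {m} (1≤m , returns , _) with orbit-descends u m returns
  ... | inj₁ on-cycle = on-cycle
  ... | inj₂ pot+m≤pot = ⊥-elim (ℕP.<-irrefl refl (ℕP.<-≤-trans (ℕP.m<m+n (pot u) 1≤m) pot+m≤pot))

  periods-odd : AllPeriodsOdd α
  periods-odd u m period@(1≤m , returns , minimal) with cycle⇒CycleThrough u (periodic⇒cycle period)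
  ... | c , r⇝c , kind≡ , i , refl = subst Odd (sym m≡len+1) odd
    where
    open OddCycle c
    α-vert : ∀ j → α (vert j) ≡ just (vert (next j))
    α-vert j with on-cycle (root-idem Γ (vert i)) kind≡ j
    ... | _ , class≡ , β≡ rewrite class≡ = cong just β≡
    iter-vert : ∀ k → iter α k (vert i) ≡ just (vert (next^ k i))
    iter-vert zero    = refl
    iter-vert (suc k) = trans (cong (_>>= α) (iter-vert k)) (α-vert (next^ k i))
    m≡len+1 : m ≡ suc len
    m≡len+1 with ℕP.<-cmp m (suc len)
    ... | tri≈ _ m≡ _ = m≡
    ... | tri< m<L _ _ = ⊥-elim (next^-≢ m i 1≤m m<L (inj (just-injective (trans (sym (iter-vert m)) returns))))
    ... | tri> _ _ L<m = ⊥-elim (minimal (suc len) (s≤s z≤n) L<m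
                           (trans (iter-vert (suc len)) (cong (just ∘ vert) (next^-period i))))

OddNonempty-n∸∣S∣ : {n : ℕ} (Γ : Graph n) (S : Subset n) → (∀ v → (v ∈ S) ⇔ IsOddFreeComponentRep Γ v) →
  OddNonempty Γ (n ∸ ∣ S ∣)
OddNonempty-n∸∣S∣ Γ S S-reps = α , α-animation , degree-α S S-reps , periods-odd
  where open SpanningAnimation Γ

-- The polynomial ring ℤ[X_v]

i+i≡0⇒i≡0 : ∀ i → i +ℤ i ≡ 0ℤ → i ≡ 0ℤ
i+i≡0⇒i≡0 (ℤ.+ zero) _ = refl

-- Poly n is a commutative ring when two formal sums are identified as soon as all their
-- collected coefficients agree.
module PolynomialRing (n : ℕ) where

  Term : Set
  Term = ℤ × Vec ℕ n

  infixl 6 _+ᵉ_ _∸ᵉ_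
  infix 4 _≟ᵉ_

  _+ᵉ_ : Vec ℕ n → Vec ℕ n → Vec ℕ n
  _+ᵉ_ = Vec.zipWith ℕ._+_

  _∸ᵉ_ : Vec ℕ n → Vec ℕ n → Vec ℕ n
  _∸ᵉ_ = Vec.zipWith ℕ._∸_

  _≟ᵉ_ : (e f : Vec ℕ n) → Dec (e ≡ f)
  _≟ᵉ_ = VecP.≡-dec ℕP._≟_

  +ᵉ-comm : ∀ e f → e +ᵉ f ≡ f +ᵉ e
  +ᵉ-comm = VecP.zipWith-comm ℕP.+-comm

  +ᵉ-assoc : ∀ e f g → (e +ᵉ f) +ᵉ g ≡ e +ᵉ (f +ᵉ g)
  +ᵉ-assoc = VecP.zipWith-assoc ℕP.+-assoc

  +ᵉ-identityˡ : ∀ e → Vec.replicate n 0 +ᵉ e ≡ e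
  +ᵉ-identityˡ = VecP.zipWith-identityˡ ℕP.+-identityˡ

  +ᵉ-∸ᵉ : ∀ {k} (e f : Vec ℕ k) → Vec.zipWith ℕ._∸_ (Vec.zipWith ℕ._+_ e f) f ≡ e
  +ᵉ-∸ᵉ Vec.[]       Vec.[]       = refl
  +ᵉ-∸ᵉ (x Vec.∷ e) (y Vec.∷ f) = cong₂ Vec._∷_ (ℕP.m+n∸n≡m x y) (+ᵉ-∸ᵉ e f)

  +ᵉ-cancelˡ : ∀ e f g → e +ᵉ f ≡ e +ᵉ g → f ≡ g
  +ᵉ-cancelˡ e f g eq = trans (sym (+ᵉ-∸ᵉ f e))
    (trans (cong (_∸ᵉ e) (trans (+ᵉ-comm f e) (trans eq (+ᵉ-comm e g)))) (+ᵉ-∸ᵉ g e))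

  term* : Term → Term → Term
  term* (a , e) (b , f) = a *ℤ b , e +ᵉ f

  term*-comm : ∀ s t → term* s t ≡ term* t s
  term*-comm (a , e) (b , f) = cong₂ _,_ (ℤP.*-comm a b) (+ᵉ-comm e f)

  term*-assoc : ∀ s t u → term* (term* s t) u ≡ term* s (term* t u)
  term*-assoc (a , e) (b , f) (c , g) = cong₂ _,_ (ℤP.*-assoc a b c) (+ᵉ-assoc e f g)

  ∑ᵗ : (Term → ℤ) → List Term → ℤ
  ∑ᵗ g []       = 0ℤ
  ∑ᵗ g (t ∷ ts) = g t +ℤ ∑ᵗ g ts

  coeffᵗ : Vec ℕ n → Term → ℤ
  coeffᵗ e (a , f) = if does (e ≟ᵉ f) then a else 0ℤ

  coeff≡∑ᵗ : ∀ e (p : Poly n) → coeff e p ≡ ∑ᵗ (coeffᵗ e) p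
  coeff≡∑ᵗ e []      = refl
  coeff≡∑ᵗ e (t ∷ p) = cong (coeffᵗ e t +ℤ_) (coeff≡∑ᵗ e p)

  ∑ᵗ-cong : ∀ {g h} ts → (∀ t → g t ≡ h t) → ∑ᵗ g ts ≡ ∑ᵗ h ts
  ∑ᵗ-cong []       g≗h = refl
  ∑ᵗ-cong (t ∷ ts) g≗h = cong₂ _+ℤ_ (g≗h t) (∑ᵗ-cong ts g≗h)

  ∑ᵗ-++ : ∀ g ts us → ∑ᵗ g (ts ++ us) ≡ ∑ᵗ g ts +ℤ ∑ᵗ g us
  ∑ᵗ-++ g []       us = sym (ℤP.+-identityˡ _)
  ∑ᵗ-++ g (t ∷ ts) us = trans (cong (g t +ℤ_) (∑ᵗ-++ g ts us)) (sym (ℤP.+-assoc (g t) _ _))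

  ∑ᵗ-map : ∀ g h ts → ∑ᵗ g (List.map h ts) ≡ ∑ᵗ (λ t → g (h t)) ts
  ∑ᵗ-map g h []       = refl
  ∑ᵗ-map g h (t ∷ ts) = cong (g (h t) +ℤ_) (∑ᵗ-map g h ts)

  ∑ᵗ-*P : ∀ g (p q : Poly n) → ∑ᵗ g (p *P q) ≡ ∑ᵗ (λ s → ∑ᵗ (λ t → g (term* s t)) q) p
  ∑ᵗ-*P g []      q = refl
  ∑ᵗ-*P g (s ∷ p) q = trans (∑ᵗ-++ g (List.map (term* s) q) (p *P q))
    (cong₂ _+ℤ_ (∑ᵗ-map g (term* s) q) (∑ᵗ-*P g p q))

  ∑ᵗ-zero : ∀ ts → ∑ᵗ (λ _ → 0ℤ) ts ≡ 0ℤ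
  ∑ᵗ-zero []       = refl
  ∑ᵗ-zero (t ∷ ts) = trans (ℤP.+-identityˡ _) (∑ᵗ-zero ts)

  ∑ᵗ-+ : ∀ g h ts → ∑ᵗ (λ t → g t +ℤ h t) ts ≡ ∑ᵗ g ts +ℤ ∑ᵗ h ts
  ∑ᵗ-+ g h []       = refl
  ∑ᵗ-+ g h (t ∷ ts) = trans (cong (g t +ℤ h t +ℤ_) (∑ᵗ-+ g h ts)) (+-interchange (g t) (h t) _ _)

  ∑ᵗ-*ʳ : ∀ g c ts → ∑ᵗ (λ t → g t *ℤ c) ts ≡ ∑ᵗ g ts *ℤ c
  ∑ᵗ-*ʳ g c []       = refl
  ∑ᵗ-*ʳ g c (t ∷ ts) = trans (cong (g t *ℤ c +ℤ_) (∑ᵗ-*ʳ g c ts)) (sym (ℤP.*-distribʳ-+ c (g t) (∑ᵗ g ts)))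

  ∑ᵗ-neg : ∀ g ts → ∑ᵗ (λ t → -ℤ g t) ts ≡ -ℤ ∑ᵗ g ts
  ∑ᵗ-neg g []       = refl
  ∑ᵗ-neg g (t ∷ ts) = trans (cong (-ℤ g t +ℤ_) (∑ᵗ-neg g ts)) (sym (ℤP.neg-distrib-+ (g t) (∑ᵗ g ts)))

  ∑ᵗ-comm : ∀ (F : Term → Term → ℤ) ts us → ∑ᵗ (λ t → ∑ᵗ (F t) us) ts ≡ ∑ᵗ (λ u → ∑ᵗ (λ t → F t u) ts) us
  ∑ᵗ-comm F []       us = sym (∑ᵗ-zero us)
  ∑ᵗ-comm F (t ∷ ts) us = trans (cong (∑ᵗ (F t) us +ℤ_) (∑ᵗ-comm F ts us))
    (sym (∑ᵗ-+ (F t) (λ u → ∑ᵗ (λ t′ → F t′ u) ts) us))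

  infix 4 _≈ᴾ_

  record _≈ᴾ_ (p q : Poly n) : Set where
    constructor coeffs
    field coeff-≡ : ∀ e → coeff e p ≡ coeff e q
  open _≈ᴾ_ public

  ≈ᴾ-refl : ∀ {p} → p ≈ᴾ p
  ≈ᴾ-refl = coeffs λ _ → refl

  ≈ᴾ-reflexive : ∀ {p q} → p ≡ q → p ≈ᴾ q
  ≈ᴾ-reflexive refl = ≈ᴾ-refl

  ≈ᴾ-sym : ∀ {p q} → p ≈ᴾ q → q ≈ᴾ p
  ≈ᴾ-sym p≈q = coeffs λ e → sym (coeff-≡ p≈q e)

  ≈ᴾ-trans : ∀ {p q r} → p ≈ᴾ q → q ≈ᴾ r → p ≈ᴾ r
  ≈ᴾ-trans p≈q q≈r = coeffs λ e → trans (coeff-≡ p≈q e) (coeff-≡ q≈r e)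

  ∑ᵗ⇒≈ᴾ : ∀ {p q} → (∀ e → ∑ᵗ (coeffᵗ e) p ≡ ∑ᵗ (coeffᵗ e) q) → p ≈ᴾ q
  ∑ᵗ⇒≈ᴾ {p} {q} eq = coeffs λ e → trans (coeff≡∑ᵗ e p) (trans (eq e) (sym (coeff≡∑ᵗ e q)))

  coeff-+P : ∀ e p q → coeff e (p +P q) ≡ coeff e p +ℤ coeff e q
  coeff-+P e p q = trans (coeff≡∑ᵗ e (p +P q))
    (trans (∑ᵗ-++ (coeffᵗ e) p q) (sym (cong₂ _+ℤ_ (coeff≡∑ᵗ e p) (coeff≡∑ᵗ e q))))

  coeff--P : ∀ e p → coeff e (-P p) ≡ -ℤ coeff e p
  coeff--P e p = trans (coeff≡∑ᵗ e (-P p)) (trans (∑ᵗ-map (coeffᵗ e) _ p)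
    (trans (∑ᵗ-cong p coeffᵗ-neg) (trans (∑ᵗ-neg (coeffᵗ e) p) (cong -ℤ_ (sym (coeff≡∑ᵗ e p))))))
    where
    coeffᵗ-neg : ∀ t → coeffᵗ e (-ℤ proj₁ t , proj₂ t) ≡ -ℤ coeffᵗ e t
    coeffᵗ-neg (a , f) with e ≟ᵉ f
    ... | yes _ = refl
    ... | no  _ = refl

  -- The coefficient of e in p *P q only depends on the coefficients of p.
  Fits : Vec ℕ n → Vec ℕ n → Bool
  Fits e f = does ((e ∸ᵉ f) +ᵉ f ≟ᵉ e)

  coeff-*P : ∀ e p q → coeff e (p *P q) ≡
    ∑ᵗ (λ t → (if Fits e (proj₂ t) then coeff (e ∸ᵉ proj₂ t) p else 0ℤ) *ℤ proj₁ t) q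
  coeff-*P e p q = trans (coeff≡∑ᵗ e (p *P q)) (trans (∑ᵗ-*P (coeffᵗ e) p q)
    (trans (∑ᵗ-comm (λ s t → coeffᵗ e (term* s t)) p q)
      (∑ᵗ-cong q (λ t → trans (∑ᵗ-cong p (λ s → coeffᵗ-term* s t))
        (trans (∑ᵗ-*ʳ _ (proj₁ t) p) (cong (_*ℤ proj₁ t) (collect t)))))))
    where
    coeffᵗ-term* : ∀ s t → coeffᵗ e (term* s t) ≡
      (if Fits e (proj₂ t) then coeffᵗ (e ∸ᵉ proj₂ t) s else 0ℤ) *ℤ proj₁ t
    coeffᵗ-term* (a , f) (b , g) with (e ∸ᵉ g) +ᵉ g ≟ᵉ e
    ... | yes fits with e ≟ᵉ f +ᵉ g | e ∸ᵉ g ≟ᵉ f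
    ...   | yes _     | yes _     = refl
    ...   | yes e≡f+g | no  e-g≢f = ⊥-elim (e-g≢f (trans (cong (_∸ᵉ g) e≡f+g) (+ᵉ-∸ᵉ f g)))
    ...   | no  e≢f+g | yes e-g≡f = ⊥-elim (e≢f+g (trans (sym fits) (cong (_+ᵉ g) e-g≡f)))
    ...   | no  _     | no  _     = refl
    coeffᵗ-term* (a , f) (b , g) | no ¬fits with e ≟ᵉ f +ᵉ g
    ...   | yes e≡f+g = ⊥-elim (¬fits (trans (cong (_+ᵉ g) (trans (cong (_∸ᵉ g) e≡f+g) (+ᵉ-∸ᵉ f g))) (sym e≡f+g)))
    ...   | no  _     = refl
    collect : ∀ t → ∑ᵗ (λ s → if Fits e (proj₂ t) then coeffᵗ (e ∸ᵉ proj₂ t) s else 0ℤ) p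
                  ≡ (if Fits e (proj₂ t) then coeff (e ∸ᵉ proj₂ t) p else 0ℤ)
    collect t with Fits e (proj₂ t)
    ... | true  = sym (coeff≡∑ᵗ _ p)
    ... | false = ∑ᵗ-zero p

  +P-cong : ∀ {p p′ q q′} → p ≈ᴾ p′ → q ≈ᴾ q′ → p +P q ≈ᴾ p′ +P q′
  +P-cong {p} {p′} {q} {q′} p≈p′ q≈q′ = coeffs λ e →
    trans (coeff-+P e p q) (trans (cong₂ _+ℤ_ (coeff-≡ p≈p′ e) (coeff-≡ q≈q′ e)) (sym (coeff-+P e p′ q′)))

  +P-assoc : ∀ p q r → (p +P q) +P r ≈ᴾ p +P (q +P r)
  +P-assoc p q r = ≈ᴾ-reflexive (ListP.++-assoc p q r)

  +P-comm : ∀ p q → p +P q ≈ᴾ q +P p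
  +P-comm p q = coeffs λ e →
    trans (coeff-+P e p q) (trans (ℤP.+-comm (coeff e p) (coeff e q)) (sym (coeff-+P e q p)))

  +P-identityʳ : ∀ p → p +P 0P ≈ᴾ p
  +P-identityʳ p = ≈ᴾ-reflexive (ListP.++-identityʳ p)

  -P-cong : ∀ {p q} → p ≈ᴾ q → -P p ≈ᴾ -P q
  -P-cong {p} {q} p≈q = coeffs λ e → trans (coeff--P e p) (trans (cong -ℤ_ (coeff-≡ p≈q e)) (sym (coeff--P e q)))

  -P-inverseˡ : ∀ p → (-P p) +P p ≈ᴾ 0P
  -P-inverseˡ p = coeffs λ e →
    trans (coeff-+P e (-P p) p) (trans (cong (_+ℤ coeff e p) (coeff--P e p)) (ℤP.+-inverseˡ (coeff e p)))

  -P-inverseʳ : ∀ p → p +P (-P p) ≈ᴾ 0P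
  -P-inverseʳ p = ≈ᴾ-trans (+P-comm p (-P p)) (-P-inverseˡ p)

  *P-comm : ∀ p q → p *P q ≈ᴾ q *P p
  *P-comm p q = ∑ᵗ⇒≈ᴾ λ e → trans (∑ᵗ-*P (coeffᵗ e) p q) (trans (∑ᵗ-comm (λ s t → coeffᵗ e (term* s t)) p q)
    (trans (∑ᵗ-cong q (λ t → ∑ᵗ-cong p (λ s → cong (coeffᵗ e) (term*-comm s t)))) (sym (∑ᵗ-*P (coeffᵗ e) q p))))

  *P-congʳ : ∀ {p p′} q → p ≈ᴾ p′ → p *P q ≈ᴾ p′ *P q
  *P-congʳ {p} {p′} q p≈p′ = coeffs λ e → trans (coeff-*P e p q) (trans (∑ᵗ-cong q (λ t →
    cong (λ c → (if Fits e (proj₂ t) then c else 0ℤ) *ℤ proj₁ t) (coeff-≡ p≈p′ (e ∸ᵉ proj₂ t)))) (sym (coeff-*P e p′ q)))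

  *P-cong : ∀ {p p′ q q′} → p ≈ᴾ p′ → q ≈ᴾ q′ → p *P q ≈ᴾ p′ *P q′
  *P-cong {p} {p′} {q} {q′} p≈p′ q≈q′ =
    ≈ᴾ-trans (*P-congʳ q p≈p′) (≈ᴾ-trans (*P-comm p′ q) (≈ᴾ-trans (*P-congʳ p′ q≈q′) (*P-comm q′ p′)))

  *P-assoc : ∀ p q r → (p *P q) *P r ≈ᴾ p *P (q *P r)
  *P-assoc p q r = ∑ᵗ⇒≈ᴾ λ e → trans (∑ᵗ-*P (coeffᵗ e) (p *P q) r)
    (trans (∑ᵗ-*P (λ x → ∑ᵗ (λ u → coeffᵗ e (term* x u)) r) p q)
    (trans (∑ᵗ-cong p (λ s → ∑ᵗ-cong q (λ t → ∑ᵗ-cong r (λ u → cong (coeffᵗ e) (term*-assoc s t u)))))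
    (sym (trans (∑ᵗ-*P (coeffᵗ e) p (q *P r)) (∑ᵗ-cong p (λ s → ∑ᵗ-*P (λ y → coeffᵗ e (term* s y)) q r))))))

  *P-identityˡ : ∀ p → 1P *P p ≈ᴾ p
  *P-identityˡ p = ∑ᵗ⇒≈ᴾ λ e → trans (∑ᵗ-*P (coeffᵗ e) 1P p) (trans (ℤP.+-identityʳ _)
    (∑ᵗ-cong p (λ t → cong (coeffᵗ e) (cong₂ _,_ (ℤP.*-identityˡ (proj₁ t)) (+ᵉ-identityˡ (proj₂ t))))))

  *P-identityʳ : ∀ p → p *P 1P ≈ᴾ p
  *P-identityʳ p = ≈ᴾ-trans (*P-comm p 1P) (*P-identityˡ p)

  *P-distribˡ : ∀ p q r → p *P (q +P r) ≈ᴾ (p *P q) +P (p *P r)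
  *P-distribˡ p q r = ∑ᵗ⇒≈ᴾ λ e → trans (∑ᵗ-*P (coeffᵗ e) p (q +P r))
    (trans (∑ᵗ-cong p (λ s → ∑ᵗ-++ (λ t → coeffᵗ e (term* s t)) q r))
    (trans (∑ᵗ-+ _ _ p) (sym (trans (∑ᵗ-++ (coeffᵗ e) (p *P q) (p *P r))
      (cong₂ _+ℤ_ (∑ᵗ-*P (coeffᵗ e) p q) (∑ᵗ-*P (coeffᵗ e) p r))))))

  *P-distribʳ : ∀ p q r → (q +P r) *P p ≈ᴾ (q *P p) +P (r *P p)
  *P-distribʳ p q r = ≈ᴾ-trans (*P-comm (q +P r) p) (≈ᴾ-trans (*P-distribˡ p q r) (+P-cong (*P-comm p q) (*P-comm p r)))

  isCommutativeRing : IsCommutativeRing _≈ᴾ_ _+P_ _*P_ -P_ 0P 1P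
  isCommutativeRing = record
    { isRing = record
      { +-isAbelianGroup = record
        { isGroup = record
          { isMonoid = record
            { isSemigroup = record
              { isMagma = record
                { isEquivalence = record { refl = ≈ᴾ-refl ; sym = ≈ᴾ-sym ; trans = ≈ᴾ-trans }
                ; ∙-cong = +P-cong }
              ; assoc = +P-assoc }
            ; identity = (λ _ → ≈ᴾ-refl) , +P-identityʳ }
          ; inverse = -P-inverseˡ , -P-inverseʳ
          ; ⁻¹-cong = -P-cong }
        ; comm = +P-comm }
      ; *-cong = *P-cong
      ; *-assoc = *P-assoc
      ; *-identity = *P-identityˡ , *P-identityʳ
      ; distrib = *P-distribˡ , *P-distribʳ }
    ; *-comm = *P-comm }

  commutativeRing : CommutativeRing _ _
  commutativeRing = record { isCommutativeRing = isCommutativeRing }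

  +P-no-2-torsion : ∀ p → p +P p ≈ᴾ 0P → p ≈ᴾ 0P
  +P-no-2-torsion p p+p≈0 = coeffs λ e → i+i≡0⇒i≡0 _ (trans (sym (coeff-+P e p p)) (coeff-≡ p+p≈0 e))

  exponentOf : Fin n → Vec ℕ n
  exponentOf v = Vec.tabulate (λ w → if does (v Fin.≟ w) then 1 else 0)

  coeff-X*P : ∀ v e p → coeff (exponentOf v +ᵉ e) (X v *P p) ≡ coeff e p
  coeff-X*P v e p = trans (coeff≡∑ᵗ _ (X v *P p)) (trans (∑ᵗ-*P _ (X v) p)
    (trans (ℤP.+-identityʳ _) (trans (∑ᵗ-cong p shift) (sym (coeff≡∑ᵗ e p)))))
    where
    shift : ∀ t → coeffᵗ (exponentOf v +ᵉ e) (term* (ℤ.+ 1 , exponentOf v) t) ≡ coeffᵗ e t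
    shift (a , f) with exponentOf v +ᵉ e ≟ᵉ exponentOf v +ᵉ f | e ≟ᵉ f
    ... | yes _   | yes _   = ℤP.*-identityˡ a
    ... | yes v+e≡v+f | no e≢f = ⊥-elim (e≢f (+ᵉ-cancelˡ _ _ _ v+e≡v+f))
    ... | no v+e≢v+f | yes e≡f = ⊥-elim (v+e≢v+f (cong (exponentOf v +ᵉ_) e≡f))
    ... | no  _   | no  _   = refl

  X*P-cancel : ∀ v p → X v *P p ≈ᴾ 0P → p ≈ᴾ 0P
  X*P-cancel v p Xp≈0 = coeffs λ e → trans (sym (coeff-X*P v e p)) (coeff-≡ Xp≈0 _)

  monomial : ℤ → Vec ℕ n → Poly n
  monomial a e = (a , e) ∷ []

  X*monomial : ∀ v a e → X v *P monomial a e ≈ᴾ monomial a (exponentOf v +ᵉ e)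
  X*monomial v a e = coeffs λ f →
    cong (λ b → (if does (f ≟ᵉ exponentOf v +ᵉ e) then b else 0ℤ) +ℤ 0ℤ) (ℤP.*-identityˡ a)

  monomial-+ : ∀ a b e → monomial a e +P monomial b e ≈ᴾ monomial (a +ℤ b) e
  monomial-+ a b e = coeffs same
    where
    same : ∀ f → coeff f (monomial a e +P monomial b e) ≡ coeff f (monomial (a +ℤ b) e)
    same f with does (f ≟ᵉ e)
    ... | true  = trans (cong (a +ℤ_) (ℤP.+-identityʳ b)) (sym (ℤP.+-identityʳ (a +ℤ b)))
    ... | false = refl

  ≈monomial⇒NonZeroPoly : ∀ {p} a e → p ≈ᴾ monomial a e → a ≢ 0ℤ → NonZeroPoly p
  ≈monomial⇒NonZeroPoly {p} a e p≈ a≢0 = e , λ coeff≡0 → a≢0 (trans (sym coeff-monomial) (trans (sym (coeff-≡ p≈ e)) coeff≡0))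
    where
    coeff-monomial : coeff e (monomial a e) ≡ a
    coeff-monomial with e ≟ᵉ e
    ... | yes _ = ℤP.+-identityʳ a
    ... | no e≢e = ⊥-elim (e≢e refl)

open Determinants

module PolynomialDeterminant (n : ℕ) where
  open PolynomialRing n public
  open Laplace commutativeRing public
  open WithoutTwoTorsion +P-no-2-torsion public
  open import Algebra.Properties.Semiring.Sum (CommutativeRing.semiring commutativeRing) public using (sum; sum-cong-≋)

  sumP≡sum : ∀ {k} (f : Fin k → Poly n) → sumP f ≡ sum f
  sumP≡sum {zero}  f = refl
  sumP≡sum {suc k} f = cong (f Fin.zero +P_) (sumP≡sum (λ i → f (Fin.suc i)))

  evenℕ-sign≡signed : ∀ m p → (if evenℕ {n} m then (λ q → q) else -P_) p ≡ signed (parity m) p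
  evenℕ-sign≡signed zero          p = refl
  evenℕ-sign≡signed (suc zero)    p = refl
  evenℕ-sign≡signed (suc (suc m)) p = evenℕ-sign≡signed m p

  det≈determinant : ∀ {k} (M : Fin k → Fin k → Poly n) → det M ≈ᴾ determinant M
  det≈determinant {zero}  M = ≈ᴾ-refl
  det≈determinant {suc k} M = ≈ᴾ-trans (≈ᴾ-reflexive (sumP≡sum expansion)) (sum-cong-≋ λ j →
    ≈ᴾ-trans (≈ᴾ-reflexive (evenℕ-sign≡signed (toℕ j) (M Fin.zero j *P det (minor j M))))
             (signed-cong (parity (toℕ j)) (*P-cong (≈ᴾ-refl {M Fin.zero j}) (det≈determinant (minor j M)))))
    where
    expansion : Fin (suc k) → Poly n
    expansion j = (if evenℕ {n} (toℕ j) then (λ q → q) else -P_) (M Fin.zero j *P det (λ a b → M (Fin.suc a) (punchIn j b)))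

-- Minors of size larger than n − d vanish

C⁺-at-j : ∀ {n} (i j : Fin n) → C⁺ (i , j) j ≡ X i
C⁺-at-j i j with j Fin.≟ j
... | yes _   = refl
... | no j≢j  = ⊥-elim (j≢j refl)

C⁺-at-i : ∀ {n} (i j : Fin n) → i ≢ j → C⁺ (i , j) i ≡ X j
C⁺-at-i i j i≢j with i Fin.≟ j | i Fin.≟ i
... | yes i≡j | _     = ⊥-elim (i≢j i≡j)
... | no _    | yes _ = refl
... | no _    | no i≢i = ⊥-elim (i≢i refl)

C⁺-elsewhere : ∀ {n} (i j w : Fin n) → w ≢ i → w ≢ j → C⁺ (i , j) w ≡ 0P
C⁺-elsewhere i j w w≢i w≢j with w Fin.≟ j | w Fin.≟ i
... | yes w≡j | _       = ⊥-elim (w≢j w≡j)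
... | no _    | yes w≡i = ⊥-elim (w≢i w≡i)
... | no _    | no _    = refl

module _ {n : ℕ} (Γ : Graph n) where
  open PolynomialDeterminant n

  InImage : ∀ {k} → (Fin k → Fin n) → Fin n → Set
  InImage c w = ∃ λ b → c b ≡ w

  InImage? : ∀ {k} (c : Fin k → Fin n) w → Dec (InImage c w)
  InImage? c w = FinP.any? (λ b → c b Fin.≟ w)

  count-image : ∀ {k} (c : Fin k → Fin n) → Injective _≡_ _≡_ c → count (does ∘ InImage? c) ≡ k
  count-image {k} c c-inj = trans (sym (length≡count (does ∘ InImage? c) (UniqueP.tabulate⁺ c-inj)
      (λ {w} w∈ → let (b , w≡) = MemP.∈-tabulate⁻ w∈ in T-does⁺ (InImage? c w) (b , sym w≡))
      (λ {w} t → let (b , c-b≡w) = T-does⁻ (InImage? c w) t in subst (λ x → x Mem.∈ List.tabulate c) c-b≡w (MemP.∈-tabulate⁺ b))))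
    (ListP.length-tabulate c)

  module _ (S : Subset n) (S-reps : ∀ v → (v ∈ S) ⇔ IsOddFreeComponentRep Γ v) where

    -- Otherwise every odd-free component meets the complement of the image, which has n ∸ k elements.
    component-within-columns : ∀ {k} (c : Fin k → Fin n) → Injective _≡_ _≡_ c → n ∸ ∣ S ∣ < k →
      ∃ λ v → IsOddFreeComponentRep Γ v × (∀ w → Reach Γ v w → InImage c w)
    component-within-columns {k} c c-inj n-∣S∣<k with FinP.any? (λ v → (v ∈? S)
                                                     ×-dec FinP.all? (λ w → Reach? Γ v w →-dec InImage? c w))
    ... | yes (v , v∈S , within) = v , Equivalence.to (S-reps v) v∈S , within
    ... | no ¬within = ⊥-elim (ℕP.<⇒≱ n-∣S∣<k k≤n-∣S∣)
      where
      outside : ∀ v → IsOddFreeComponentRep Γ v → ∃ λ w → Reach Γ v w × T (not (does (InImage? c w)))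
      outside v v-rep with FinP.¬∀⟶∃¬ n _ (λ w → Reach? Γ v w →-dec InImage? c w)
                           (λ within → ¬within (v , Equivalence.from (S-reps v) v-rep , within))
      ... | w , ¬implication with Reach? Γ v w
      ...   | yes v⇝w = w , v⇝w , T-not-does⁺ (InImage? c w) (λ w∈ → ¬implication (λ _ → w∈))
      ...   | no ¬v⇝w = ⊥-elim (¬implication (λ v⇝w → ⊥-elim (¬v⇝w v⇝w)))
      complement : count (not ∘ does ∘ InImage? c) ≡ n ∸ k
      complement = trans (sym (ℕP.m+n∸m≡n (count (does ∘ InImage? c)) _))
        (cong₂ _∸_ (count-complement (does ∘ InImage? c)) (count-image c c-inj))
      k≤n : k ≤ n
      k≤n = subst (_≤ n) (count-image c c-inj) (subst (count (does ∘ InImage? c) ≤_) (count-complement (does ∘ InImage? c)) (ℕP.m≤m+n _ _))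
      ∣S∣≤n-k : ∣ S ∣ ≤ n ∸ k
      ∣S∣≤n-k = subst (∣ S ∣ ≤_) complement (∣S∣≤count Γ S S-reps (not ∘ does ∘ InImage? c) outside)
      k≤n-∣S∣ : k ≤ n ∸ ∣ S ∣
      k≤n-∣S∣ = ℕP.m+n≤o⇒m≤o∸n k (subst (_≤ n) (ℕP.+-comm ∣ S ∣ k) (ℕP.m≤o∸n⇒m+n≤o ∣ S ∣ k≤n ∣S∣≤n-k))

  -- On a bipartite component all of whose vertices index columns, the signed variables ±X_w
  -- (sign given by the colour of w) form a kernel vector of the minor.
  module KernelVector {k} (r : Fin k → Fin n × Fin n) (c : Fin k → Fin n)
    (rows : ∀ a → IsEdgeRow Γ (r a)) (c-inj : Injective _≡_ _≡_ c)
    {v} (col : Fin n → Parity) (proper : ProperColouring Γ v col) (within : ∀ w → Reach Γ v w → InImage c w) where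

    open CommutativeRing commutativeRing using (zeroˡ; zeroʳ)
    open import Algebra.Properties.Ring (CommutativeRing.ring commutativeRing) using (-‿distribˡ-*; -‿involutive; -0#≈0#)

    y : Fin n → Poly n
    y w with Reach? Γ v w
    ... | yes _ = signed (col w) (X w)
    ... | no  _ = 0P

    y-in : ∀ {w} → Reach Γ v w → y w ≡ signed (col w) (X w)
    y-in {w} v⇝w with Reach? Γ v w
    ... | yes _    = refl
    ... | no ¬v⇝w = ⊥-elim (¬v⇝w v⇝w)

    y-out : ∀ {w} → ¬ Reach Γ v w → y w ≡ 0P
    y-out {w} ¬v⇝w with Reach? Γ v w
    ... | yes v⇝w = ⊥-elim (¬v⇝w v⇝w)
    ... | no  _    = refl

    opposite-signs-cancel : ∀ i j → col i ≢ col j → (signed (col j) (X j) *P X i) +P (signed (col i) (X i) *P X j) ≈ᴾ 0P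
    opposite-signs-cancel i j col-i≢col-j with col i | col j
    ... | 0ℙ | 0ℙ = ⊥-elim (col-i≢col-j refl)
    ... | 1ℙ | 1ℙ = ⊥-elim (col-i≢col-j refl)
    ... | 0ℙ | 1ℙ = ≈ᴾ-trans (+P-cong (≈ᴾ-trans (≈ᴾ-sym (-‿distribˡ-* (X j) (X i))) (-P-cong (*P-comm (X j) (X i))))
                                      (≈ᴾ-refl {X i *P X j})) (-P-inverseˡ (X i *P X j))
    ... | 1ℙ | 0ℙ = ≈ᴾ-trans (+P-cong (≈ᴾ-refl {X j *P X i})
                                      (≈ᴾ-trans (≈ᴾ-sym (-‿distribˡ-* (X i) (X j))) (-P-cong (*P-comm (X i) (X j)))))
                             (-P-inverseʳ (X j *P X i))

    M : Fin k → Fin k → Poly n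
    M a b = C⁺ (r a) (c b)

    kernel-row : ∀ a → sum (λ b → y (c b) *P M a b) ≈ᴾ 0P
    kernel-row a with r a | rows a
    ... | i , j | _ , i∼j with Reach? Γ v i
    ...   | yes v⇝i = ≈ᴾ-trans (sum-pair _ bj bi bj≢bi others)
                        (≈ᴾ-trans (+P-cong (≈ᴾ-reflexive at-j) (≈ᴾ-reflexive at-i)) (opposite-signs-cancel i j col-i≢col-j))
      where
      v⇝j = Reach-∷ʳ Γ v⇝i i∼j
      col-i≢col-j = proper i j v⇝i i∼j
      i≢j : i ≢ j
      i≢j i≡j = col-i≢col-j (cong col i≡j)
      bi = proj₁ (within i v⇝i)
      bj = proj₁ (within j v⇝j)
      c-bi : c bi ≡ i
      c-bi = proj₂ (within i v⇝i)
      c-bj : c bj ≡ j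
      c-bj = proj₂ (within j v⇝j)
      bj≢bi : bj ≢ bi
      bj≢bi bj≡bi = i≢j (trans (sym c-bi) (trans (cong c (sym bj≡bi)) c-bj))
      others : ∀ b → b ≢ bj → b ≢ bi → y (c b) *P C⁺ (i , j) (c b) ≈ᴾ 0P
      others b b≢bj b≢bi = ≈ᴾ-trans (*P-cong (≈ᴾ-refl {y (c b)}) (≈ᴾ-reflexive (C⁺-elsewhere i j (c b)
        (λ c-b≡i → b≢bi (c-inj (trans c-b≡i (sym c-bi)))) (λ c-b≡j → b≢bj (c-inj (trans c-b≡j (sym c-bj)))))))
        (zeroʳ (y (c b)))
      at-j : y (c bj) *P C⁺ (i , j) (c bj) ≡ signed (col j) (X j) *P X i
      at-j = trans (cong (λ w → y w *P C⁺ (i , j) w) c-bj) (cong₂ _*P_ (y-in v⇝j) (C⁺-at-j i j))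
      at-i : y (c bi) *P C⁺ (i , j) (c bi) ≡ signed (col i) (X i) *P X j
      at-i = trans (cong (λ w → y w *P C⁺ (i , j) w) c-bi) (cong₂ _*P_ (y-in v⇝i) (C⁺-at-i i j i≢j))
    ...   | no ¬v⇝i = sum-zero term≈0
      where
      ¬v⇝j : ¬ Reach Γ v j
      ¬v⇝j v⇝j = ¬v⇝i (Reach-∷ʳ Γ v⇝j (∼-sym Γ i∼j))
      term≈0 : ∀ b → y (c b) *P C⁺ (i , j) (c b) ≈ᴾ 0P
      term≈0 b = by-reachability (Reach? Γ v (c b))
        where
        by-reachability : Dec (Reach Γ v (c b)) → y (c b) *P C⁺ (i , j) (c b) ≈ᴾ 0P
        by-reachability (yes v⇝cb) = ≈ᴾ-trans (*P-cong (≈ᴾ-refl {y (c b)}) (≈ᴾ-reflexive (C⁺-elsewhere i j (c b)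
          (λ c-b≡i → ¬v⇝i (subst (Reach Γ v) c-b≡i v⇝cb)) (λ c-b≡j → ¬v⇝j (subst (Reach Γ v) c-b≡j v⇝cb)))))
          (zeroʳ (y (c b)))
        by-reachability (no ¬v⇝cb) = ≈ᴾ-trans (*P-cong (≈ᴾ-reflexive (y-out ¬v⇝cb)) (≈ᴾ-refl {C⁺ (i , j) (c b)})) (zeroˡ (C⁺ (i , j) (c b)))

    minor-vanishes : det M ≈ᴾ 0P
    minor-vanishes = ≈ᴾ-trans (det≈determinant M) (X*P-cancel v (determinant M) Xv*det≈0)
      where
      b₀ = proj₁ (within v here)
      y-v*det≈0 : signed (col v) (X v) *P determinant M ≈ᴾ 0P
      y-v*det≈0 = ≈ᴾ-trans (*P-cong (≈ᴾ-reflexive (sym (trans (cong y (proj₂ (within v here))) (y-in here))))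
                                     (≈ᴾ-refl {determinant M}))
                           (det-kernel M (y ∘ c) kernel-row b₀)
      Xv*det≈0 : X v *P determinant M ≈ᴾ 0P
      Xv*det≈0 with col v | y-v*det≈0
      ... | 0ℙ | X*det≈0  = X*det≈0
      ... | 1ℙ | -X*det≈0 = ≈ᴾ-trans (≈ᴾ-sym (-‿involutive _))
        (≈ᴾ-trans (-P-cong (≈ᴾ-trans (-‿distribˡ-* (X v) (determinant M)) -X*det≈0)) -0#≈0#)

  HasNonzeroMinor⇒≤n∸∣S∣ : (S : Subset n) → (∀ v → (v ∈ S) ⇔ IsOddFreeComponentRep Γ v) →
    ∀ k → HasNonzeroMinor Γ k → k ≤ n ∸ ∣ S ∣
  HasNonzeroMinor⇒≤n∸∣S∣ S S-reps k (r , c , rows , _ , c-inj , e , coeff≢0) with k ℕ.≤? n ∸ ∣ S ∣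
  ... | yes k≤ = k≤
  ... | no  k≰ with component-within-columns S S-reps c c-inj (ℕP.≰⇒> k≰)
  ... | v , (_ , no-odd-cycle) , within with oddCycle-or-colouring Γ v
  ...   | oddCycle odd-cycle   = ⊥-elim (no-odd-cycle odd-cycle)
  ...   | colouring col proper = ⊥-elim (coeff≢0 (coeff-≡ (KernelVector.minor-vanishes r c rows c-inj col proper within) e))

-- A nonvanishing minor of size n − d

module EdgeMatrices (n : ℕ) where
  open PolynomialDeterminant n

  infix 6 _at_

  -- A row of C⁺ for the edge {u, t}, together with the column it is paired with on the diagonal.
  record Placed : Set where
    constructor _at_
    field
      edge   : Fin n × Fin n
      column : Fin n
  open Placed public

  entry : Fin n × Fin n → Fin n → Poly n
  entry (u , t) k = if does (k Fin.≟ u) then X t else (if does (k Fin.≟ t) then X u else 0P)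

  entry-u : ∀ u t → entry (u , t) u ≡ X t
  entry-u u t with u Fin.≟ u
  ... | yes _   = refl
  ... | no u≢u  = ⊥-elim (u≢u refl)

  entry-t : ∀ u t → t ≢ u → entry (u , t) t ≡ X u
  entry-t u t t≢u with t Fin.≟ u | t Fin.≟ t
  ... | yes t≡u | _      = ⊥-elim (t≢u t≡u)
  ... | no _    | yes _  = refl
  ... | no _    | no t≢t = ⊥-elim (t≢t refl)

  entry-elsewhere : ∀ u t k → k ≢ u → k ≢ t → entry (u , t) k ≡ 0P
  entry-elsewhere u t k k≢u k≢t with k Fin.≟ u | k Fin.≟ t
  ... | yes k≡u | _       = ⊥-elim (k≢u k≡u)
  ... | no _    | yes k≡t = ⊥-elim (k≢t k≡t)
  ... | no _    | no _    = refl

  matrix : (ps : List Placed) → Matrix (length ps)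
  matrix ps a b = entry (edge (List.lookup ps a)) (column (List.lookup ps b))

  Off : Fin n → Placed → Set
  Off x p = x ≢ proj₁ (edge p) × x ≢ proj₂ (edge p)

  Avoids : List (Fin n) → Placed → Set
  Avoids vs p = proj₁ (edge p) Mem.∉ vs × proj₂ (edge p) Mem.∉ vs × column p Mem.∉ vs

  Avoids⇒Off : ∀ {x vs p} → x Mem.∈ vs → Avoids vs p → Off x p
  Avoids⇒Off x∈vs (u∉ , t∉ , _) = (λ x≡u → u∉ (subst (Mem._∈ _) x≡u x∈vs)) , (λ x≡t → t∉ (subst (Mem._∈ _) x≡t x∈vs))

  Avoids-⊆ : ∀ {vs ws} → (∀ {x} → x Mem.∈ vs → x Mem.∈ ws) → ∀ {p} → Avoids ws p → Avoids vs p
  Avoids-⊆ vs⊆ws (u∉ , t∉ , c∉) = u∉ ∘ vs⊆ws , t∉ ∘ vs⊆ws , c∉ ∘ vs⊆ws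

  columns : List Placed → List (Fin n)
  columns = List.map column

  column-∈ : ∀ ps j → column (List.lookup ps j) Mem.∈ columns ps
  column-∈ ps j = MemP.∈-map⁺ column (MemP.∈-lookup {xs = ps} j)

  Δ : List (Fin n) → Vec ℕ n → Vec ℕ n
  Δ []       e = e
  Δ (v ∷ vs) e = exponentOf v +ᵉ Δ vs e

  Δ-∷ʳ : ∀ xs y e → Δ (xs ++ y ∷ []) e ≡ Δ (y ∷ xs) e
  Δ-∷ʳ []       y e = refl
  Δ-∷ʳ (x ∷ xs) y e = trans (cong (exponentOf x +ᵉ_) (Δ-∷ʳ xs y e))
    (trans (sym (+ᵉ-assoc (exponentOf x) (exponentOf y) (Δ xs e)))
      (trans (cong (_+ᵉ Δ xs e) (+ᵉ-comm (exponentOf x) (exponentOf y))) (+ᵉ-assoc (exponentOf y) (exponentOf x) (Δ xs e))))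

  det-peel : ∀ x t ps → (∀ {p} → p Mem.∈ ps → Off x p) →
    determinant (matrix ((x , t) at x ∷ ps)) ≈ᴾ X t *P determinant (matrix ps)
  det-peel x t ps off = ≈ᴾ-trans (det-column₀ (matrix ((x , t) at x ∷ ps)) column₀≈0)
                                 (*P-cong (≈ᴾ-reflexive (entry-u x t)) ≈ᴾ-refl)
    where
    column₀≈0 : ∀ a → matrix ((x , t) at x ∷ ps) (Fin.suc a) Fin.zero ≈ᴾ 0P
    column₀≈0 a = let (x≢u , x≢t) = off (MemP.∈-lookup a) in ≈ᴾ-reflexive (entry-elsewhere _ _ x x≢u x≢t)

  nextOr : List (Fin n) → Fin n → Fin n
  nextOr []      z = z
  nextOr (y ∷ _) z = y

  path-rows : List (Fin n) → Fin n → List Placed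
  path-rows []       z = []
  path-rows (x ∷ xs) z = (x , nextOr xs z) at x ∷ path-rows xs z

  -- Deleting the first row and the column of x from the rows of the cycle z → x → ⋯ → z leaves these rows.
  shifted-rows : Fin n → List (Fin n) → Fin n → List Placed
  shifted-rows x xs z = (x , nextOr xs z) at z ∷ path-rows xs z

  columns-path-rows : ∀ xs z → columns (path-rows xs z) ≡ xs
  columns-path-rows []       z = refl
  columns-path-rows (x ∷ xs) z = cong (x ∷_) (columns-path-rows xs z)

  path-rows-edge : ∀ xs z {p} → p Mem.∈ path-rows xs z → proj₁ (edge p) Mem.∈ xs × (proj₂ (edge p) Mem.∈ xs ⊎ proj₂ (edge p) ≡ z)
  path-rows-edge (x ∷ [])     z (here refl) = here refl , inj₂ refl
  path-rows-edge (x ∷ y ∷ xs) z (here refl) = here refl , inj₁ (there (here refl))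
  path-rows-edge (x ∷ xs)     z (there p∈) with path-rows-edge xs z p∈
  ... | u∈ , inj₁ t∈ = there u∈ , inj₁ (there t∈)
  ... | u∈ , inj₂ t≡ = there u∈ , inj₂ t≡

  entry-beyond : ∀ u t rows Q {vs} → All (Avoids vs) Q → u Mem.∈ vs → t Mem.∈ vs → u Mem.∉ columns rows → t Mem.∉ columns rows →
    ∀ j → entry (u , t) (column (List.lookup (rows ++ Q) j)) ≡ 0P
  entry-beyond u t rows Q avoid u∈vs t∈vs u∉rows t∉rows j
    with MemP.∈-++⁻ (columns rows) (subst (column (List.lookup (rows ++ Q) j) Mem.∈_) (ListP.map-++ column rows Q)
                                          (column-∈ (rows ++ Q) j))
  ... | inj₁ c∈rows = entry-elsewhere u t _ (λ c≡u → u∉rows (subst (Mem._∈ _) c≡u c∈rows))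
                                            (λ c≡t → t∉rows (subst (Mem._∈ _) c≡t c∈rows))
  ... | inj₂ c∈Q with MemP.∈-map⁻ column c∈Q
  ...   | p , p∈Q , refl = let (_ , _ , c∉vs) = All.lookup avoid p∈Q in
          entry-elsewhere u t _ (λ c≡u → c∉vs (subst (Mem._∈ _) (sym c≡u) u∈vs)) (λ c≡t → c∉vs (subst (Mem._∈ _) (sym c≡t) t∈vs))

  private
    ∉-head : ∀ {x : Fin n} {xs} → Unique (x ∷ xs) → x Mem.∉ xs
    ∉-head (x∉ ∷ _) x∈ = All.lookup x∉ x∈ refl

    unique-tail : ∀ {x : Fin n} {xs} → Unique (x ∷ xs) → Unique xs
    unique-tail (_ ∷ u) = u

  det-path : ∀ x xs z Q K E → Unique (x ∷ xs) → z Mem.∉ x ∷ xs → All (Avoids (x ∷ xs)) Q →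
    determinant (matrix Q) ≈ᴾ monomial K E → determinant (matrix (path-rows (x ∷ xs) z ++ Q)) ≈ᴾ monomial K (Δ (xs ++ z ∷ []) E)
  det-path x [] z Q K E _ z∉ avoid det-Q =
    ≈ᴾ-trans (det-peel x z Q (λ p∈Q → Avoids⇒Off (here refl) (All.lookup avoid p∈Q)))
             (≈ᴾ-trans (*P-cong (≈ᴾ-refl {X z}) det-Q) (X*monomial z K E))
  det-path x (y ∷ ys) z Q K E u z∉ avoid det-Q =
    ≈ᴾ-trans (det-peel x y (path-rows (y ∷ ys) z ++ Q) off)
             (≈ᴾ-trans (*P-cong (≈ᴾ-refl {X y}) (det-path y ys z Q K E (unique-tail u) (z∉ ∘ there) (All.map (Avoids-⊆ there) avoid) det-Q))
                       (X*monomial y K _))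
    where
    off : ∀ {p} → p Mem.∈ path-rows (y ∷ ys) z ++ Q → Off x p
    off {p} p∈ with MemP.∈-++⁻ (path-rows (y ∷ ys) z) p∈
    ... | inj₂ p∈Q = Avoids⇒Off (here refl) (All.lookup avoid p∈Q)
    ... | inj₁ p∈path with path-rows-edge (y ∷ ys) z p∈path
    ...   | u∈ , t∈ = (λ x≡u → ∉-head u (subst (Mem._∈ _) (sym x≡u) u∈)) , not-t t∈
      where
      not-t : (proj₂ (edge p) Mem.∈ y ∷ ys ⊎ proj₂ (edge p) ≡ z) → x ≢ proj₂ (edge p)
      not-t (inj₁ t∈′) x≡t = ∉-head u (subst (Mem._∈ _) (sym x≡t) t∈′)
      not-t (inj₂ t≡z) x≡t = z∉ (here (sym (trans x≡t t≡z)))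

  alternate : ℕ → ℤ → ℤ
  alternate zero    a = a
  alternate (suc m) a = -ℤ alternate m a

  alternate-even : ∀ m a → parity m ≡ 0ℙ → alternate m a ≡ a
  alternate-even zero          a _  = refl
  alternate-even (suc zero)    a ()
  alternate-even (suc (suc m)) a pm = trans (ℤP.neg-involutive _) (alternate-even m a pm)

  minor₁-shifted : ∀ x y ys z Q a b →
    minor (Fin.suc Fin.zero) (matrix (shifted-rows x (y ∷ ys) z ++ Q)) a b ≡ matrix (shifted-rows y ys z ++ Q) a b
  minor₁-shifted x y ys z Q Fin.zero    Fin.zero    = refl
  minor₁-shifted x y ys z Q Fin.zero    (Fin.suc b) = refl
  minor₁-shifted x y ys z Q (Fin.suc a) Fin.zero    = refl
  minor₁-shifted x y ys z Q (Fin.suc a) (Fin.suc b) = refl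

  det-shifted-path : ∀ x ys z Q K E → Unique (x ∷ ys) → z Mem.∉ x ∷ ys → All (Avoids (z ∷ x ∷ ys)) Q →
    determinant (matrix Q) ≈ᴾ monomial K E →
    determinant (matrix (shifted-rows x ys z ++ Q)) ≈ᴾ monomial (alternate (length ys) K) (Δ (x ∷ ys) E)
  det-shifted-path x [] z Q K E _ z∉ avoid det-Q =
    ≈ᴾ-trans (det-column₀ (matrix ((x , z) at z ∷ Q)) column₀≈0)
             (≈ᴾ-trans (*P-cong (≈ᴾ-reflexive (entry-t x z (z∉ ∘ here))) det-Q) (X*monomial x K E))
    where
    column₀≈0 : ∀ a → matrix ((x , z) at z ∷ Q) (Fin.suc a) Fin.zero ≈ᴾ 0P
    column₀≈0 a = let (z≢u , z≢t) = Avoids⇒Off (here refl) (All.lookup avoid (MemP.∈-lookup a)) in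
      ≈ᴾ-reflexive (entry-elsewhere _ _ z z≢u z≢t)
  det-shifted-path x (y ∷ ys) z Q K E u z∉ avoid det-Q =
    ≈ᴾ-trans (det-row₀-single (matrix L) row₀≈0)
      (-P-cong (≈ᴾ-trans (*P-cong (≈ᴾ-reflexive (entry-t x y y≢x))
                                   (≈ᴾ-trans (det-cong (λ a b → ≈ᴾ-reflexive (minor₁-shifted x y ys z Q a b)))
                                             (det-shifted-path y ys z Q K E (unique-tail u) (z∉ ∘ there)
                                                (All.map (Avoids-⊆ skip-x) avoid) det-Q)))
                         (X*monomial x _ _)))
    where
    L = shifted-rows x (y ∷ ys) z ++ Q
    y≢x : y ≢ x
    y≢x y≡x = ∉-head u (here (sym y≡x))
    skip-x : ∀ {w} → w Mem.∈ z ∷ y ∷ ys → w Mem.∈ z ∷ x ∷ y ∷ ys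
    skip-x (here w≡z) = here w≡z
    skip-x (there w∈) = there (there w∈)
    row₀≈0 : ∀ j → j ≢ Fin.suc Fin.zero → matrix L Fin.zero j ≈ᴾ 0P
    row₀≈0 Fin.zero _ = ≈ᴾ-reflexive (entry-elsewhere x y z (z∉ ∘ here) (z∉ ∘ there ∘ here))
    row₀≈0 (Fin.suc Fin.zero) j≢1 = ⊥-elim (j≢1 refl)
    row₀≈0 (Fin.suc (Fin.suc j)) _ = ≈ᴾ-reflexive (entry-beyond x y (path-rows ys z) Q avoid
      (there (here refl)) (there (there (here refl)))
      (λ x∈ → ∉-head u (there (subst (x Mem.∈_) (columns-path-rows ys z) x∈)))
      (λ y∈ → ∉-head (unique-tail u) (subst (y Mem.∈_) (columns-path-rows ys z) y∈)) j)

  det-odd-cycle : ∀ c₀ c₁ c₂ cs Q K E → Unique (c₀ ∷ c₁ ∷ c₂ ∷ cs) → parity (length cs) ≡ 0ℙ →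
    All (Avoids (c₀ ∷ c₁ ∷ c₂ ∷ cs)) Q → determinant (matrix Q) ≈ᴾ monomial K E →
    determinant (matrix (path-rows (c₀ ∷ c₁ ∷ c₂ ∷ cs) c₀ ++ Q)) ≈ᴾ monomial (K +ℤ K) (Δ (c₀ ∷ c₁ ∷ c₂ ∷ cs) E)
  det-odd-cycle c₀ c₁ c₂ cs Q K E u even avoid det-Q =
    ≈ᴾ-trans (det-row₀-pair (matrix L) row₀≈0) (≈ᴾ-trans (+P-cong along-path around-cycle) (monomial-+ K K _))
    where
    L = path-rows (c₀ ∷ c₁ ∷ c₂ ∷ cs) c₀ ++ Q
    c₁≢c₀ : c₁ ≢ c₀
    c₁≢c₀ c₁≡c₀ = ∉-head u (here (sym c₁≡c₀))
    row₀≈0 : ∀ j → j ≢ Fin.zero → j ≢ Fin.suc Fin.zero → matrix L Fin.zero j ≈ᴾ 0P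
    row₀≈0 Fin.zero j≢0 _ = ⊥-elim (j≢0 refl)
    row₀≈0 (Fin.suc Fin.zero) _ j≢1 = ⊥-elim (j≢1 refl)
    row₀≈0 (Fin.suc (Fin.suc j)) _ _ = ≈ᴾ-reflexive (entry-beyond c₀ c₁ (path-rows (c₂ ∷ cs) c₀) Q avoid
      (here refl) (there (here refl))
      (λ c₀∈ → ∉-head u (there (subst (c₀ Mem.∈_) (columns-path-rows (c₂ ∷ cs) c₀) c₀∈)))
      (λ c₁∈ → ∉-head (unique-tail u) (subst (c₁ Mem.∈_) (columns-path-rows (c₂ ∷ cs) c₀) c₁∈)) j)
    along-path : matrix L Fin.zero Fin.zero *P determinant (minor Fin.zero (matrix L)) ≈ᴾ monomial K (Δ (c₀ ∷ c₁ ∷ c₂ ∷ cs) E)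
    along-path = ≈ᴾ-trans (*P-cong (≈ᴾ-reflexive (entry-u c₀ c₁))
                   (det-path c₁ (c₂ ∷ cs) c₀ Q K E (unique-tail u) (∉-head u) (All.map (Avoids-⊆ there) avoid) det-Q))
                 (≈ᴾ-trans (X*monomial c₁ K _) (≈ᴾ-reflexive (cong (monomial K) (Δ-∷ʳ (c₁ ∷ c₂ ∷ cs) c₀ E))))
    around-cycle : -P (matrix L Fin.zero (Fin.suc Fin.zero) *P determinant (minor (Fin.suc Fin.zero) (matrix L)))
                   ≈ᴾ monomial K (Δ (c₀ ∷ c₁ ∷ c₂ ∷ cs) E)
    around-cycle = ≈ᴾ-trans (-P-cong (≈ᴾ-trans (*P-cong (≈ᴾ-reflexive (entry-t c₀ c₁ c₁≢c₀))
                     (≈ᴾ-trans (det-cong (λ a b → ≈ᴾ-reflexive (minor₁-shifted c₀ c₁ (c₂ ∷ cs) c₀ Q a b)))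
                               (det-shifted-path c₁ (c₂ ∷ cs) c₀ Q K E (unique-tail u) (∉-head u) avoid det-Q)))
                     (X*monomial c₀ _ _)))
                   (≈ᴾ-reflexive (cong (λ a → monomial a _) (trans (ℤP.neg-involutive _) (alternate-even (length cs) K even))))

  MonomialDet : List Placed → Set
  MonomialDet ps = ∃ λ a → ∃ λ e → a ≢ 0ℤ × determinant (matrix ps) ≈ᴾ monomial a e

  rows-of : (Fin n → Fin n) → List (Fin n) → List Placed
  rows-of β = List.map (λ w → (w , β w) at w)

  -- Column x vanishes in all rows below the row of x.
  Peelable : (Fin n → Fin n) → List (Fin n) → List Placed → Set
  Peelable β []      Q = ⊤
  Peelable β (x ∷ T) Q = (∀ {p} → p Mem.∈ rows-of β T ++ Q → Off x p) × Peelable β T Q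

  det-peel-rows : ∀ β T Q → Peelable β T Q → MonomialDet Q → MonomialDet (rows-of β T ++ Q)
  det-peel-rows β []      Q _               det-Q = det-Q
  det-peel-rows β (x ∷ T) Q (off , peelable) det-Q with det-peel-rows β T Q peelable det-Q
  ... | a , e , a≢0 , det≈ = a , exponentOf (β x) +ᵉ e , a≢0 ,
    ≈ᴾ-trans (det-peel x (β x) (rows-of β T ++ Q) off) (≈ᴾ-trans (*P-cong (≈ᴾ-refl {X (β x)}) det≈) (X*monomial (β x) a e))

  rows-of-path : ∀ β {k} (g : Fin (suc k) → Fin n) z → (∀ i → β (g (Fin.inject₁ i)) ≡ g (Fin.suc i)) →
    β (g (Fin.fromℕ k)) ≡ z → rows-of β (List.tabulate g) ≡ path-rows (List.tabulate g) z
  rows-of-path β {zero}  g z _    β-last = cong (λ t → (g Fin.zero , t) at g Fin.zero ∷ []) β-last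
  rows-of-path β {suc k} g z β-next β-last = cong₂ _∷_ (cong (λ t → (g Fin.zero , t) at g Fin.zero) (β-next Fin.zero))
    (rows-of-path β (g ∘ Fin.suc) z (β-next ∘ Fin.suc) β-last)

  det-cycle-rows : ∀ β {len} (vert : Fin (suc len) → Fin n) → Injective _≡_ _≡_ vert → Odd (suc len) →
    (∀ i → β (vert i) ≡ vert (next i)) → ∀ Q → All (Avoids (List.tabulate vert)) Q →
    MonomialDet Q → MonomialDet (rows-of β (List.tabulate vert) ++ Q)
  det-cycle-rows β {len} vert inj odd β-vert Q avoid (a , e , a≢0 , det-Q) =
    subst (λ rows → MonomialDet (rows ++ Q)) (sym (rows-of-path β vert (vert Fin.zero) β-next β-last))
          (by-length len vert inj odd avoid)
    where
    β-next : ∀ i → β (vert (Fin.inject₁ i)) ≡ vert (Fin.suc i)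
    β-next i = trans (β-vert _) (cong vert (FinP.toℕ-injective
      (trans (next-< (Fin.inject₁ i) (subst (_< len) (sym (FinP.toℕ-inject₁ i)) (FinP.toℕ<n i)))
             (cong suc (FinP.toℕ-inject₁ i)))))
    β-last : β (vert (Fin.fromℕ len)) ≡ vert Fin.zero
    β-last = trans (β-vert _) (cong vert (next-≮ (Fin.fromℕ len) (λ lt → ℕP.<-irrefl (FinP.toℕ-fromℕ len) lt)))
    by-length : ∀ len (vert : Fin (suc len) → Fin n) → Injective _≡_ _≡_ vert → Odd (suc len) →
      All (Avoids (List.tabulate vert)) Q → MonomialDet (path-rows (List.tabulate vert) (vert Fin.zero) ++ Q)
    by-length zero vert _ _ avoid = a , exponentOf (vert Fin.zero) +ᵉ e , a≢0 ,
      ≈ᴾ-trans (det-peel (vert Fin.zero) (vert Fin.zero) Q (λ p∈Q → Avoids⇒Off (here refl) (All.lookup avoid p∈Q)))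
               (≈ᴾ-trans (*P-cong (≈ᴾ-refl {X (vert Fin.zero)}) det-Q) (X*monomial (vert Fin.zero) a e))
    by-length (suc zero) vert _ odd _ with () ← trans (sym (Odd⇒parity≡1ℙ odd)) refl
    by-length (suc (suc m)) vert inj odd avoid = a +ℤ a , _ , (λ a+a≡0 → a≢0 (i+i≡0⇒i≡0 a a+a≡0)) ,
      det-odd-cycle (vert Fin.zero) (vert (Fin.suc Fin.zero)) (vert (Fin.suc (Fin.suc Fin.zero))) rest Q a e
        (UniqueP.tabulate⁺ inj) even-rest avoid det-Q
      where
      rest = List.tabulate (vert ∘ Fin.suc ∘ Fin.suc ∘ Fin.suc)
      even-rest : parity (length rest) ≡ 0ℙ
      even-rest = trans (cong parity (ListP.length-tabulate (vert ∘ Fin.suc ∘ Fin.suc ∘ Fin.suc)))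
        (ℙP.⁻¹-injective {x = parity m} {y = 0ℙ} (trans (sym (parity-suc m)) (Odd⇒parity≡1ℙ odd)))

module SpanningMinor {n : ℕ} (Γ : Graph n) where
  open SpanningMap Γ
  open PolynomialDeterminant n
  open EdgeMatrices n

  isTree : Class → Bool
  isTree tree = true
  isTree _    = false

  T-isTree : ∀ {c} → T (isTree c) ⇔ c ≡ tree
  T-isTree {tree}  = mk⇔ (λ _ → refl) (λ _ → tt)
  T-isTree {rep}   = mk⇔ (λ ()) (λ ())
  T-isTree {cycle} = mk⇔ (λ ()) (λ ())

  level : ℕ → List (Fin n)
  level d = filterᵇ (λ v → isTree (class v) ∧ does (pot v ℕ.≟ d)) (allFin n)

  byPotential : ℕ → List (Fin n)
  byPotential zero    = level zero
  byPotential (suc d) = level (suc d) ++ byPotential d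

  ∈-level⁻ : ∀ d {v} → v Mem.∈ level d → class v ≡ tree × pot v ≡ d
  ∈-level⁻ d {v} v∈ with Equivalence.to T-∧ (∈-filterᵇ⁻ (λ v → isTree (class v) ∧ does (pot v ℕ.≟ d)) {xs = allFin n} v∈)
  ... | is-tree , pot≡ = Equivalence.to T-isTree is-tree , T-does⁻ (pot v ℕ.≟ d) pot≡

  ∈-level⁺ : ∀ d {v} → class v ≡ tree → pot v ≡ d → v Mem.∈ level d
  ∈-level⁺ d {v} is-tree pot≡ = ∈-filterᵇ⁺ _ (MemP.∈-allFin v)
    (Equivalence.from T-∧ (Equivalence.from T-isTree is-tree , T-does⁺ (pot v ℕ.≟ d) pot≡))

  ∈-byPotential⁻ : ∀ d {v} → v Mem.∈ byPotential d → class v ≡ tree × pot v ≤ d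
  ∈-byPotential⁻ zero v∈ = let (is-tree , pot≡) = ∈-level⁻ zero v∈ in is-tree , ℕP.≤-reflexive pot≡
  ∈-byPotential⁻ (suc d) v∈ with MemP.∈-++⁻ (level (suc d)) v∈
  ... | inj₁ v∈level = let (is-tree , pot≡) = ∈-level⁻ (suc d) v∈level in is-tree , ℕP.≤-reflexive pot≡
  ... | inj₂ v∈below = let (is-tree , pot≤) = ∈-byPotential⁻ d v∈below in is-tree , ℕP.m≤n⇒m≤1+n pot≤

  ∈-byPotential⁺ : ∀ d {v} → class v ≡ tree → pot v ≤ d → v Mem.∈ byPotential d
  ∈-byPotential⁺ zero    is-tree pot≤ = ∈-level⁺ zero is-tree (ℕP.n≤0⇒n≡0 pot≤)
  ∈-byPotential⁺ (suc d) is-tree pot≤ with ℕP.m≤n⇒m<n∨m≡n pot≤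
  ... | inj₁ pot< = MemP.∈-++⁺ʳ (level (suc d)) (∈-byPotential⁺ d is-tree (ℕP.≤-pred pot<))
  ... | inj₂ pot≡ = MemP.∈-++⁺ˡ (∈-level⁺ (suc d) is-tree pot≡)

  unique-level : ∀ d → Unique (level d)
  unique-level d = UniqueP.filter⁺ (T? ∘ _) (UniqueP.allFin⁺ n)

  unique-byPotential : ∀ d → Unique (byPotential d)
  unique-byPotential zero    = unique-level zero
  unique-byPotential (suc d) = UniqueP.++⁺ (unique-level (suc d)) (unique-byPotential d)
    (λ (v∈level , v∈below) → ℕP.<-irrefl refl (ℕP.≤-trans (ℕP.≤-reflexive (cong suc (sym (proj₂ (∈-level⁻ (suc d) v∈level)))))
                                                            (s≤s (proj₂ (∈-byPotential⁻ d v∈below)))))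

  Decreasing : List (Fin n) → Set
  Decreasing = AllPairs (λ x y → pot y ≤ pot x)

  constant⇒Decreasing : ∀ d xs → (∀ {x} → x Mem.∈ xs → pot x ≡ d) → Decreasing xs
  constant⇒Decreasing d []       _    = []
  constant⇒Decreasing d (x ∷ xs) pot≡ =
    All.tabulate (λ y∈ → ℕP.≤-reflexive (trans (pot≡ (there y∈)) (sym (pot≡ (here refl)))))
    ∷ constant⇒Decreasing d xs (pot≡ ∘ there)

  decreasing-byPotential : ∀ d → Decreasing (byPotential d)
  decreasing-byPotential zero    = constant⇒Decreasing zero (level zero) (proj₂ ∘ ∈-level⁻ zero)
  decreasing-byPotential (suc d) = AllPairsP.++⁺ (constant⇒Decreasing (suc d) (level (suc d)) (proj₂ ∘ ∈-level⁻ (suc d)))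
    (decreasing-byPotential d)
    (All.tabulate (λ x∈ → All.tabulate (λ y∈ →
      ℕP.≤-trans (proj₂ (∈-byPotential⁻ d y∈)) (ℕP.≤-trans (ℕP.n≤1+n d) (ℕP.≤-reflexive (sym (proj₂ (∈-level⁻ (suc d) x∈))))))))

  cycleOfᴷ : ∀ r → OddCycleOrColouring Γ r → List (Fin n)
  cycleOfᴷ r (oddCycle (c , _)) = List.tabulate (OddCycle.vert c)
  cycleOfᴷ r (colouring _ _)   = []

  cycleOf : Fin n → List (Fin n)
  cycleOf r = cycleOfᴷ r (kind r)

  IsRoot : Fin n → Set
  IsRoot r = root Γ r ≡ r

  ∈-cycleOf⁻ : ∀ {r w} → IsRoot r → w Mem.∈ cycleOf r → class w ≡ cycle × root Γ w ≡ r
  ∈-cycleOf⁻ {r} r-root w∈ with kind r in kind≡ | w∈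
  ... | oddCycle (c , r⇝c) | w∈tabulate with MemP.∈-tabulate⁻ {f = OddCycle.vert c} w∈tabulate
  ...   | i , refl = let (root≡ , class≡ , _) = on-cycle r-root kind≡ i in class≡ , root≡

  ∈-cycleOf⁺ : ∀ {w} → class w ≡ cycle → w Mem.∈ cycleOf (root Γ w)
  ∈-cycleOf⁺ {w} class≡ with cycle⇒CycleThrough w class≡
  ... | c , r⇝c , kind≡ , i , vert-i≡w =
    subst (λ K → w Mem.∈ cycleOfᴷ (root Γ w) K) (sym kind≡) (subst (Mem._∈ _) vert-i≡w (MemP.∈-tabulate⁺ {f = OddCycle.vert c} i))

  unique-cycleOf : ∀ r → Unique (cycleOf r)
  unique-cycleOf r with kind r
  ... | oddCycle (c , _) = UniqueP.tabulate⁺ (OddCycle.inj c)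
  ... | colouring _ _   = []

  cyclesOf : List (Fin n) → List (Fin n)
  cyclesOf []       = []
  cyclesOf (r ∷ rs) = cycleOf r ++ cyclesOf rs

  ∈-cyclesOf⁻ : ∀ {rs w} → All IsRoot rs → w Mem.∈ cyclesOf rs → class w ≡ cycle × root Γ w Mem.∈ rs
  ∈-cyclesOf⁻ {r ∷ rs} (r-root ∷ roots) w∈ with MemP.∈-++⁻ (cycleOf r) w∈
  ... | inj₁ w∈r  = let (class≡ , root≡) = ∈-cycleOf⁻ r-root w∈r in class≡ , here root≡
  ... | inj₂ w∈rs = let (class≡ , root∈) = ∈-cyclesOf⁻ roots w∈rs in class≡ , there root∈

  ∈-cyclesOf⁺ : ∀ rs {w} → class w ≡ cycle → root Γ w Mem.∈ rs → w Mem.∈ cyclesOf rs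
  ∈-cyclesOf⁺ (r ∷ rs) class≡ (here refl)  = MemP.∈-++⁺ˡ (∈-cycleOf⁺ class≡)
  ∈-cyclesOf⁺ (r ∷ rs) class≡ (there root∈) = MemP.∈-++⁺ʳ (cycleOf r) (∈-cyclesOf⁺ rs class≡ root∈)

  unique-cyclesOf : ∀ {rs} → Unique rs → All IsRoot rs → Unique (cyclesOf rs)
  unique-cyclesOf {[]}     _            _                = []
  unique-cyclesOf {r ∷ rs} (r∉rs ∷ u) (r-root ∷ roots) = UniqueP.++⁺ (unique-cycleOf r) (unique-cyclesOf u roots)
    (λ (w∈r , w∈rs) → All.lookup r∉rs (subst (Mem._∈ rs) (proj₂ (∈-cycleOf⁻ r-root w∈r)) (proj₂ (∈-cyclesOf⁻ roots w∈rs))) refl)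

  roots : List (Fin n)
  roots = filterᵇ (λ r → does (root Γ r Fin.≟ r)) (allFin n)

  unique-roots : Unique roots
  unique-roots = UniqueP.filter⁺ (T? ∘ _) (UniqueP.allFin⁺ n)

  all-roots : All IsRoot roots
  all-roots = All.tabulate (λ {r} r∈ → T-does⁻ (root Γ r Fin.≟ r) (∈-filterᵇ⁻ _ {xs = allFin n} r∈))

  root∈roots : ∀ v → root Γ v Mem.∈ roots
  root∈roots v = ∈-filterᵇ⁺ _ (MemP.∈-allFin (root Γ v)) (T-does⁺ (root Γ (root Γ v) Fin.≟ root Γ v) (root-idem Γ v))

  det-cycles : ∀ {rs} → Unique rs → All IsRoot rs → MonomialDet (rows-of β (cyclesOf rs))
  det-cycles {[]} _ _ = ℤ.+ 1 , Vec.replicate n 0 , (λ ()) , ≈ᴾ-refl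
  det-cycles {r ∷ rs} (r∉rs ∷ u) (r-root ∷ roots) =
    subst MonomialDet (sym (ListP.map-++ _ (cycleOf r) (cyclesOf rs))) (with-kind (kind r) refl)
    where
    with-kind : ∀ K → kind r ≡ K → MonomialDet (rows-of β (cycleOfᴷ r K) ++ rows-of β (cyclesOf rs))
    with-kind (colouring _ _)      _     = det-cycles u roots
    with-kind (oddCycle (c , r⇝c)) kind≡ = det-cycle-rows β vert inj odd (λ i → proj₂ (proj₂ (on-cycle r-root kind≡ i)))
      (rows-of β (cyclesOf rs)) (All.tabulate avoids) (det-cycles u roots)
      where
      open OddCycle c
      outside : ∀ {w} → root Γ w Mem.∈ rs → w Mem.∉ List.tabulate vert
      outside root∈rs w∈c with MemP.∈-tabulate⁻ {f = vert} w∈c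
      ... | i , refl = All.lookup r∉rs (subst (Mem._∈ rs) (proj₁ (on-cycle r-root kind≡ i)) root∈rs) refl
      avoids : ∀ {p} → p Mem.∈ rows-of β (cyclesOf rs) → Avoids (List.tabulate vert) p
      avoids p∈ with MemP.∈-map⁻ _ p∈
      ... | y , y∈ , refl with ∈-cyclesOf⁻ roots y∈
      ...   | class≡ , root∈rs = outside root∈rs ,
              outside (subst (Mem._∈ rs) (Reach⇒root≡ Γ (∼⇒Reach Γ (proj₂ (cycle-β y class≡)))) root∈rs) ,
              outside root∈rs

  cycleRows : List Placed
  cycleRows = rows-of β (cyclesOf roots)

  peelable : ∀ T → Unique T → Decreasing T → All (λ x → class x ≡ tree) T → Peelable β T cycleRows
  peelable []      _            _                     _                 = tt
  peelable (x ∷ T) (x∉T ∷ u) (x-above ∷ decreasing) (x-tree ∷ trees) = off , peelable T u decreasing trees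
    where
    x≢cycle : ∀ {v} → class v ≡ cycle → x ≢ v
    x≢cycle v-cycle x≡v with () ← trans (sym x-tree) (trans (cong class x≡v) v-cycle)
    off : ∀ {p} → p Mem.∈ rows-of β T ++ cycleRows → Off x p
    off p∈ with MemP.∈-++⁻ (rows-of β T) p∈
    ... | inj₁ p∈T with MemP.∈-map⁻ _ p∈T
    ...   | y , y∈T , refl = (λ x≡y → All.lookup x∉T y∈T x≡y) ,
            (λ x≡βy → ℕP.<-irrefl refl (ℕP.<-≤-trans (subst (λ v → pot v < pot y) (sym x≡βy) (tree-pot y (All.lookup trees y∈T)))
                                                     (All.lookup x-above y∈T)))
    off p∈ | inj₂ p∈C with MemP.∈-map⁻ _ p∈C
    ...   | y , y∈C , refl = let y-cycle = proj₁ (∈-cyclesOf⁻ all-roots y∈C) in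
            x≢cycle y-cycle , x≢cycle (proj₁ (cycle-β y y-cycle))

  spanned : List (Fin n)
  spanned = byPotential n ++ cyclesOf roots

  ∈-spanned⁻ : ∀ {w} → w Mem.∈ spanned → class w ≢ rep
  ∈-spanned⁻ w∈ class≡rep with MemP.∈-++⁻ (byPotential n) w∈
  ... | inj₁ w∈T with () ← trans (sym class≡rep) (proj₁ (∈-byPotential⁻ n w∈T))
  ... | inj₂ w∈C with () ← trans (sym class≡rep) (proj₁ (∈-cyclesOf⁻ all-roots w∈C))

  ∈-spanned⁺ : ∀ w → class w ≢ rep → w Mem.∈ spanned
  ∈-spanned⁺ w class≢rep with class w in class≡
  ... | rep   = ⊥-elim (class≢rep refl)
  ... | tree  = MemP.∈-++⁺ˡ (∈-byPotential⁺ n class≡ (pot≤n w))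
  ... | cycle = MemP.∈-++⁺ʳ (byPotential n) (∈-cyclesOf⁺ roots class≡ (root∈roots w))

  unique-spanned : Unique spanned
  unique-spanned = UniqueP.++⁺ (unique-byPotential n) (unique-cyclesOf unique-roots all-roots)
    (λ (w∈T , w∈C) → tree≢cycle (trans (sym (proj₁ (∈-byPotential⁻ n w∈T))) (proj₁ (∈-cyclesOf⁻ all-roots w∈C))))
    where
    tree≢cycle : tree ≢ cycle
    tree≢cycle ()

  det-spanned : MonomialDet (rows-of β spanned)
  det-spanned = subst MonomialDet (sym (ListP.map-++ _ (byPotential n) (cyclesOf roots)))
    (det-peel-rows β (byPotential n) cycleRows
      (peelable (byPotential n) (unique-byPotential n) (decreasing-byPotential n) (All.tabulate (proj₁ ∘ ∈-byPotential⁻ n)))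
      (det-cycles unique-roots all-roots))

  no-2-cycle : ∀ u w → class u ≢ rep → class w ≢ rep → β u ≡ w → β w ≡ u → u ≡ w
  no-2-cycle u w u≢rep w≢rep βu≡w βw≡u with class u in class-u | class w in class-w
  ... | rep   | _     = ⊥-elim (u≢rep refl)
  ... | _     | rep   = ⊥-elim (w≢rep refl)
  ... | tree  | tree  = ⊥-elim (ℕP.<-irrefl refl (ℕP.<-trans (subst (λ v → pot v < pot u) βu≡w (tree-pot u class-u))
                                                             (subst (λ v → pot v < pot w) βw≡u (tree-pot w class-w))))
  ... | tree  | cycle with () ← trans (sym class-u) (subst (λ v → class v ≡ cycle) βw≡u (proj₁ (cycle-β w class-w)))
  ... | cycle | tree  with () ← trans (sym class-w) (subst (λ v → class v ≡ cycle) βu≡w (proj₁ (cycle-β u class-u)))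
  ... | cycle | cycle with cycle⇒CycleThrough u class-u
  ...   | c , r⇝c , kind≡ , i , refl = trans (cong vert (sym (next∘next≡⇒next≡ odd i (inj (sym u≡))))) (sym w≡)
    where
    open OddCycle c
    β-vert : ∀ j → β (vert j) ≡ vert (next j)
    β-vert j = proj₂ (proj₂ (on-cycle (root-idem Γ (vert i)) kind≡ j))
    w≡ : w ≡ vert (next i)
    w≡ = trans (sym βu≡w) (β-vert i)
    u≡ : vert i ≡ vert (next (next i))
    u≡ = trans (sym βw≡u) (trans (cong β w≡) (β-vert (next i)))

  orderBy : ∀ {u t : Fin n} → Dec (toℕ u ≤ toℕ t) → Fin n × Fin n
  orderBy {u} {t} (yes _) = u , t
  orderBy {u} {t} (no  _) = t , u

  ordered : Fin n × Fin n → Fin n × Fin n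
  ordered (u , t) = orderBy (toℕ u ℕ.≤? toℕ t)

  ordered-IsEdgeRow : ∀ {u t} → _∼_ Γ u t → IsEdgeRow Γ (ordered (u , t))
  ordered-IsEdgeRow {u} {t} u∼t = by-order (toℕ u ℕ.≤? toℕ t)
    where
    by-order : (d : Dec (toℕ u ≤ toℕ t)) → IsEdgeRow Γ (orderBy d)
    by-order (yes u≤t) = u≤t , u∼t
    by-order (no  u≰t) = ℕP.<⇒≤ (ℕP.≰⇒> u≰t) , ∼-sym Γ u∼t

  C⁺-ordered : ∀ u t k → C⁺ (ordered (u , t)) k ≡ entry (u , t) k
  C⁺-ordered u t k = by-order (toℕ u ℕ.≤? toℕ t)
    where
    by-order : (d : Dec (toℕ u ≤ toℕ t)) → C⁺ (orderBy d) k ≡ entry (u , t) k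
    by-order (no _) = refl
    by-order (yes _) with k Fin.≟ t | k Fin.≟ u
    ... | yes refl | yes refl = refl
    ... | yes _    | no  _    = refl
    ... | no  _    | yes _    = refl
    ... | no  _    | no  _    = refl

  ordered-injective : ∀ u t u′ t′ → ordered (u , t) ≡ ordered (u′ , t′) → (u ≡ u′ × t ≡ t′) ⊎ (u ≡ t′ × t ≡ u′)
  ordered-injective u t u′ t′ = by-order (toℕ u ℕ.≤? toℕ t) (toℕ u′ ℕ.≤? toℕ t′)
    where
    by-order : (d : Dec (toℕ u ≤ toℕ t)) (d′ : Dec (toℕ u′ ≤ toℕ t′)) → orderBy d ≡ orderBy d′ →
      (u ≡ u′ × t ≡ t′) ⊎ (u ≡ t′ × t ≡ u′)
    by-order (yes _) (yes _) refl = inj₁ (refl , refl)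
    by-order (yes _) (no  _) refl = inj₂ (refl , refl)
    by-order (no  _) (yes _) refl = inj₂ (refl , refl)
    by-order (no  _) (no  _) refl = inj₁ (refl , refl)

  spannedRows : List Placed
  spannedRows = rows-of β spanned

  row-at : ∀ a → ∃ λ w → w Mem.∈ spanned × List.lookup spannedRows a ≡ (w , β w) at w
  row-at a = MemP.∈-map⁻ _ (MemP.∈-lookup {xs = spannedRows} a)

  spanned-minor : HasNonzeroMinor Γ (length spannedRows)
  spanned-minor = rows , cols , edge-rows , rows-injective , cols-injective , nonzero
    where
    rows : Fin (length spannedRows) → Fin n × Fin n
    rows a = ordered (edge (List.lookup spannedRows a))
    cols : Fin (length spannedRows) → Fin n
    cols b = column (List.lookup spannedRows b)
    edge-rows : ∀ a → IsEdgeRow Γ (rows a)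
    edge-rows a with row-at a
    ... | w , w∈ , row≡ rewrite row≡ = ordered-IsEdgeRow (∼β w (∈-spanned⁻ w∈))
    cols-injective : Injective _≡_ _≡_ cols
    cols-injective = Unique-map⇒lookup-injective column spannedRows
      (subst Unique (sym (trans (sym (ListP.map-∘ spanned)) (ListP.map-id spanned))) unique-spanned)
    rows-injective : Injective _≡_ _≡_ rows
    rows-injective {a} {b} rows≡ with row-at a | row-at b
    ... | wa , wa∈ , row-a≡ | wb , wb∈ , row-b≡ = cols-injective (trans (cong column row-a≡) (trans wa≡wb (sym (cong column row-b≡))))
      where
      wa≡wb : wa ≡ wb
      wa≡wb with ordered-injective wa (β wa) wb (β wb)
                   (trans (cong (ordered ∘ edge) (sym row-a≡)) (trans rows≡ (cong (ordered ∘ edge) row-b≡)))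
      ... | inj₁ (wa≡wb , _)        = wa≡wb
      ... | inj₂ (wa≡βwb , βwa≡wb) = no-2-cycle wa wb (∈-spanned⁻ wa∈) (∈-spanned⁻ wb∈) βwa≡wb (sym wa≡βwb)
    nonzero : NonZeroPoly (det (λ a b → C⁺ (rows a) (cols b)))
    nonzero with det-spanned
    ... | K , E , K≢0 , det≈ = ≈monomial⇒NonZeroPoly K E
      (≈ᴾ-trans (det≈determinant (λ a b → C⁺ (rows a) (cols b)))
                 (≈ᴾ-trans (det-cong (λ a b → ≈ᴾ-reflexive (C⁺-ordered (proj₁ (edge (List.lookup spannedRows a)))
                                                                       (proj₂ (edge (List.lookup spannedRows a))) (cols b))))
                           det≈)) K≢0

  length-spanned : (S : Subset n) → (∀ v → (v ∈ S) ⇔ IsOddFreeComponentRep Γ v) → length spanned ≡ n ∸ ∣ S ∣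
  length-spanned S S-reps = begin
    length spanned                                    ≡⟨ length≡count (not ∘ Vec.lookup S) unique-spanned ∈⇒∉S ∉S⇒∈ ⟩
    count (not ∘ Vec.lookup S)                        ≡⟨ sym (ℕP.m+n∸m≡n (count (Vec.lookup S)) _) ⟩
    count (Vec.lookup S) + count (not ∘ Vec.lookup S) ∸ count (Vec.lookup S)
                                                      ≡⟨ cong₂ _∸_ (count-complement (Vec.lookup S)) (sym (∣S∣≡count S)) ⟩
    n ∸ ∣ S ∣                                         ∎
    where
    open ≡-Reasoning
    rep⇔∈S : ∀ v → class v ≡ rep ⇔ T (Vec.lookup S v)
    rep⇔∈S v = ⇔.trans (rep⇔IsOddFreeComponentRep v) (⇔.trans (⇔.sym (S-reps v)) (∈⇔T-lookup S v))
    ∈⇒∉S : ∀ {v} → v Mem.∈ spanned → T (not (Vec.lookup S v))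
    ∈⇒∉S {v} v∈ with Vec.lookup S v in ∈S
    ... | false = tt
    ... | true  = ∈-spanned⁻ v∈ (Equivalence.from (rep⇔∈S v) (subst T (sym ∈S) tt))
    ∉S⇒∈ : ∀ {v} → T (not (Vec.lookup S v)) → v Mem.∈ spanned
    ∉S⇒∈ {v} ∉S = ∈-spanned⁺ v (λ rep≡ → subst (λ b → T (not b)) (Equivalence.to T-≡ (Equivalence.to (rep⇔∈S v) rep≡)) ∉S)

HasNonzeroMinor-n∸∣S∣ : {n : ℕ} (Γ : Graph n) (S : Subset n) → (∀ v → (v ∈ S) ⇔ IsOddFreeComponentRep Γ v) →
  HasNonzeroMinor Γ (n ∸ ∣ S ∣)
HasNonzeroMinor-n∸∣S∣ Γ S S-reps = subst (HasNonzeroMinor Γ) (trans (ListP.length-map _ spanned) (length-spanned S S-reps)) spanned-minor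
  where open SpanningMinor Γ

proposition7p5 : (n : ℕ) (Γ : Graph n) (S : Subset n)
    → (∀ v → (v ∈ S) ⇔ IsOddFreeComponentRep Γ v)
    → OddNonempty Γ (n ∸ ∣ S ∣) × ¬ OddNonempty Γ ((n ∸ ∣ S ∣) + 1) × RankC⁺ Γ (n ∸ ∣ S ∣)
proposition7p5 n Γ S S-reps =
    OddNonempty-n∸∣S∣ Γ S S-reps
  , ¬OddNonempty-n∸∣S∣+1 Γ S S-reps
  , HasNonzeroMinor-n∸∣S∣ Γ S S-reps
  , HasNonzeroMinor⇒≤n∸∣S∣ Γ S S-reps
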